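{- Let $G$ be a $(3,6)$-tight finite graph containing a cycle $d$ of length $|d|\ge 3$. Then for any integers $|b|\ge3$, $|c|\ge3$ with $|d|-3=(|b|-3)+(|c|-3)$ there is a triangulation $H$ of the bordered surface $B={\mathbb{S}}_0\backslash 3{\mathbb{D}}$ whose three boundary cycles $a,b,c$ have lengths $|a|=|d|$, $|b|$, $|c|$, such that the join $G^+=G\cup_{d=a}H$ is $(3,6)$-tight. Moreover, there exist such triangulations $H$ that may be obtained from the cycle $d$ by Henneberg 0-extension moves.
   Context: For a finite graph $G=(V,E)$, $f(G)=3|V|-|E|$. A finite graph is $(3,6)$-sparse if $f(G')\ge 6$ for every subgraph $G'$ with at least 3 vertices, and $(3,6)$-tight if moreover $f(G)=6$. ${\mathbb{S}}_0\backslash 3{\mathbb{D}}$ is the sphere with the interiors of three disjoint closed discs removed. A triangulation of a compact bordered surface is an embedded finite graph all of whose faces are triangles (bounded by 3-cycles), with each boundary curve of the surface forming a cycle of the graph (a boundary cycle). The join $G\cup_{d=a}H$ is the graph obtained from the disjoint union of $G$ and $H$ by identifying the cycle $a$ of $H$ with the cycle $d$ of $G$ (vertex by vertex, respecting the cyclic order). A Henneberg 0-extension move adds a new vertex $v$ together with three edges $w_1v,w_2v,w_3v$ to distinct existing vertices $w_1,w_2,w_3$. -}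

module Defs where

open import Data.Nat using (ℕ; zero; suc; _+_; _*_; _≤_)
import Data.Nat
import Data.List.Relation.Unary.Any
open import Data.Fin as Fin using (Fin)
open import Data.Fin.Properties as FinP using ()
open import Data.Bool using (Bool; true; false; if_then_else_; _∧_; _∨_; not)
open import Data.List using (List; []; _∷_; _++_; [_]; length; map; zip; filterᵇ; mapMaybe; allFin)
open import Data.Bool.ListAction using (any)
open import Data.List.Membership.Propositional using (_∈_; _∉_)
open import Data.List.Relation.Unary.All using (All)
open import Data.List.Relation.Unary.Unique.Propositional using (Unique)
open import Data.List.Relation.Binary.Sublist.Propositional using (_⊆_)
open import Data.List.Relation.Binary.Permutation.Propositional using (_↭_)
open import Data.List.Relation.Binary.Disjoint.Propositional using (Disjoint)
open import Data.Maybe using (Maybe; just; nothing; maybe)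
open import Data.Product using (Σ; ∃; _×_; _,_; proj₁; proj₂)
open import Data.Sum using (_⊎_; inj₁; inj₂)
open import Relation.Binary.PropositionalEquality using (_≡_; _≢_)
open import Relation.Nullary.Decidable using (⌊_⌋)

-- Finite (multi)graphs given by a vertex list and an edge list.
-- Edges are ordered pairs; orientation is irrelevant everywhere below.

record Graph (V : Set) : Set where
  constructor graph
  field
    verts : List V
    edges : List (V × V)
open Graph public

Adj : {V : Set} → List (V × V) → V → V → Set
Adj es x y = (x , y) ∈ es ⊎ (y , x) ∈ es

record Subgraph {V : Set} (G : Graph V) : Set where
  field
    S      : List V
    E'     : List (V × V)
    S-uniq : Unique S
    S-sub  : All (λ v → v ∈ verts G) S
    E'-sub : E' ⊆ edges G
    E'-in  : All (λ e → proj₁ e ∈ S × proj₂ e ∈ S) E'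
open Subgraph public

Sparse36 : {V : Set} → Graph V → Set
Sparse36 G = (H : Subgraph G) → 3 ≤ length (S H) → 6 + length (E' H) ≤ 3 * length (S H)

Tight36 : {V : Set} → Graph V → Set
Tight36 G = Sparse36 G × (6 + length (edges G) ≡ 3 * length (verts G))

FinGraph : (n : ℕ) → Graph (Fin n) → Set
FinGraph n G = verts G ≡ allFin n

IsSimple : {n : ℕ} → Graph (Fin n) → Set
IsSimple G = All (λ e → proj₁ e Fin.< proj₂ e) (edges G) × Unique (edges G)

cycleEdges : {V : Set} → List V → List (V × V)
cycleEdges [] = []
cycleEdges (x ∷ xs) = zip (x ∷ xs) (xs ++ [ x ])

IsCycle : {V : Set} → Graph V → List V → Set
IsCycle G d = Unique d × 3 ≤ length d × All (λ v → v ∈ verts G) d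
              × All (λ e → Adj (edges G) (proj₁ e) (proj₂ e)) (cycleEdges d)

data Reach {V : Set} (es : List (V × V)) (x : V) : V → Set where
  here : Reach es x x
  step : ∀ {y z} → Reach es x y → Adj es y z → Reach es x z

-- Combinatorial triangulations on vertex set Fin m.
-- Triangles stored as (x , y , z) with x < y < z; edges as (i , j), i < j.

Tri : ℕ → Set
Tri m = Fin m × Fin m × Fin m

_≟E_ : {m : ℕ} → (e f : Fin m × Fin m) → Bool
(a , b) ≟E (c , d) = ⌊ a FinP.≟ c ⌋ ∧ ⌊ b FinP.≟ d ⌋

sameEdge : {m : ℕ} → (e f : Fin m × Fin m) → Bool
sameEdge (a , b) (c , d) = ((a , b) ≟E (c , d)) ∨ ((a , b) ≟E (d , c))

norm : {m : ℕ} → Fin m × Fin m → Fin m × Fin m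
norm (a , b) = if ⌊ a Fin.≤? b ⌋ then (a , b) else (b , a)

triEdges : {m : ℕ} → Tri m → List (Fin m × Fin m)
triEdges (x , y , z) = (x , y) ∷ (y , z) ∷ (x , z) ∷ []

_∈T_ : {m : ℕ} → Fin m → Tri m → Set
v ∈T (x , y , z) = v ≡ x ⊎ v ≡ y ⊎ v ≡ z

trisAt : {m : ℕ} → List (Tri m) → Fin m × Fin m → List (Tri m)
trisAt ts e = filterᵇ (λ t → any (sameEdge e) (triEdges t)) ts

opp : {m : ℕ} → Fin m → Tri m → Maybe (Fin m × Fin m)
opp v (x , y , z) =
  if ⌊ v FinP.≟ x ⌋ then just (y , z) else
  if ⌊ v FinP.≟ y ⌋ then just (x , z) else
  if ⌊ v FinP.≟ z ⌋ then just (x , y) else nothing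

link : {m : ℕ} → List (Tri m) → Fin m → List (Fin m × Fin m)
link ts v = mapMaybe (opp v) ts

boundaryEdges : {m : ℕ} → List (Tri m) → List (Fin m × Fin m) → List (Fin m × Fin m)
boundaryEdges ts es = filterᵇ (λ e → ⌊ length (trisAt ts e) Data.Nat.≟ 1 ⌋) es

-- A triangulation (simplicial surface) with vertex set Fin m, triangles ts,
-- edge set es, of a compact connected bordered surface of Euler
-- characteristic -1 whose boundary consists of exactly the three disjoint
-- cycles a, b, c.  By the classification of surfaces such a surface is
-- S₀ \ 3D (a non-orientable one would have χ ≤ 1 - 3 = -2).
record TriangulationS03D (m : ℕ) (ts : List (Tri m)) (es : List (Fin m × Fin m))
                         (a b c : List (Fin m)) : Set where
  field
    edges-canon : All (λ e → proj₁ e Fin.< proj₂ e) es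
    edges-uniq  : Unique es
    tris-canon  : All (λ t → proj₁ t Fin.< proj₁ (proj₂ t) × proj₁ (proj₂ t) Fin.< proj₂ (proj₂ t)) ts
    tris-uniq   : Unique ts
    vert-on-tri : (v : Fin m) → Data.List.Relation.Unary.Any.Any (v ∈T_) ts
    tri-sides   : All (λ t → All (_∈ es) (triEdges t)) ts
    edge-deg    : All (λ e → length (trisAt ts e) ≡ 1 ⊎ length (trisAt ts e) ≡ 2) es
    -- manifold condition at vertices: every vertex link is connected
    -- (hence, having max degree ≤ 2, a path or a cycle)
    link-conn   : (v : Fin m) → (e f : Fin m × Fin m) → e ∈ link ts v → f ∈ link ts v →
                  Reach (link ts v) (proj₁ e) (proj₁ f)
    connected   : (x y : Fin m) → Reach es x y
    euler       : m + length ts + 1 ≡ length es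
    a-uniq      : Unique a
    b-uniq      : Unique b
    c-uniq      : Unique c
    a-len       : 3 ≤ length a
    b-len       : 3 ≤ length b
    c-len       : 3 ≤ length c
    ab-disj     : Disjoint a b
    ac-disj     : Disjoint a c
    bc-disj     : Disjoint b c
    boundary    : map norm (cycleEdges a ++ cycleEdges b ++ cycleEdges c) ↭ boundaryEdges ts es

-- The join G ∪_{d=a} H : vertex a_i of H is identified with d_i of G
-- (i-th entries of the cyclically ordered lists), the edges of the cycle a
-- are identified with those of d; everything else is kept (as a multigraph).

lookupAssoc : {m n : ℕ} → List (Fin m × Fin n) → Fin m → Maybe (Fin n)
lookupAssoc [] v = nothing
lookupAssoc ((x , y) ∷ ps) v = if ⌊ v FinP.≟ x ⌋ then just y else lookupAssoc ps v

joinMap : {n m : ℕ} → List (Fin n) → List (Fin m) → Fin m → Fin n ⊎ Fin m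
joinMap d a v = maybe inj₁ (inj₂ v) (lookupAssoc (zip a d) v)

memb : {m : ℕ} → Fin m → List (Fin m) → Bool
memb v xs = any (λ x → ⌊ v FinP.≟ x ⌋) xs

join : {n m : ℕ} → Graph (Fin n) → List (Fin n) → List (Fin m) → List (Fin m × Fin m) →
       Graph (Fin n ⊎ Fin m)
join {n} {m} G d a esH = graph
  (map inj₁ (verts G) ++ map inj₂ (filterᵇ (λ v → not (memb v a)) (allFin m)))
  (map (λ e → inj₁ (proj₁ e) , inj₁ (proj₂ e)) (edges G) ++
   map (λ e → joinMap d a (proj₁ e) , joinMap d a (proj₂ e))
       (filterᵇ (λ e → not (any (sameEdge e) (cycleEdges a))) esH))

data Henneberg0 {V : Set} (vs₀ : List V) (es₀ : List (V × V)) : List V → List (V × V) → Set where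
  base : Henneberg0 vs₀ es₀ vs₀ es₀
  ext  : ∀ {vs es} (v w₁ w₂ w₃ : V) → Henneberg0 vs₀ es₀ vs es →
         v ∉ vs → w₁ ∈ vs → w₂ ∈ vs → w₃ ∈ vs → w₁ ≢ w₂ → w₁ ≢ w₃ → w₂ ≢ w₃ →
         Henneberg0 vs₀ es₀ (v ∷ vs) ((w₁ , v) ∷ (w₂ , v) ∷ (w₃ , v) ∷ es)

ObtainedFromCycle : (m : ℕ) → List (Fin m) → List (Fin m × Fin m) → Set
ObtainedFromCycle m a es =
  ∃ λ vs → ∃ λ es' → Henneberg0 a (cycleEdges a) vs es' × vs ↭ allFin m × map norm es' ↭ map norm es

{-# OPTIONS --safe #-}
-- H is grown from the cycle a by Henneberg 0-extensions, each adding a vertex joined to three vertices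
-- of the current boundary.  The first one, v0 joined to a0, a1 and aj, cuts the disc bounded by a into
-- two fronts of lengths |b| and |c|, which is possible as |a| - 3 = (|b| - 3) + (|c| - 3).  Each front is
-- then pushed off by a ring of ears, one new vertex over each of its corners, leaving a parallel cycle of
-- new vertices.  The result is a sphere with three holes bounded by a, b and c.  That it is a
-- triangulation is carried along as an invariant: every edge has two sides, each a triangle or an edge
-- of the open boundary, the links of the vertices stay connected, and V - E + F drops by one at the
-- split.  The join stays (3,6)-tight because a 0-extension adds one vertex and three edges, and a set of
-- vertices containing the new vertex spans at most three new edges.

module Submission where

open import Defs
open import Data.Nat using (ℕ; zero; suc; _+_; _*_; _∸_; _≤_; _<_; z≤n; s≤s) renaming (_≟_ to _≟ℕ_; _≤?_ to _≤?ℕ_)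
import Data.Nat.Properties as ℕₚ
open ℕₚ using (+-comm; +-assoc; +-suc)
open import Data.Nat.Tactic.RingSolver using (solve-∀)
open import Algebra.Properties.CommutativeSemigroup ℕₚ.+-commutativeSemigroup using (x∙yz≈y∙xz; xy∙z≈xz∙y)
open import Data.Fin as Fin using (Fin)
import Data.Fin.Properties as FinP
open import Data.Bool using (Bool; true; false; _∧_; _∨_; not; T)
import Data.Bool.Properties as Boolₚ
open Boolₚ using (∨-zeroʳ; ¬-not)
open import Data.Bool.ListAction using (any)
open import Data.Maybe using (just; nothing)
open import Data.Product as Product using (∃; _×_; _,_; proj₁; proj₂; swap)
open import Data.Sum as Sum using (_⊎_; inj₁; inj₂)
import Data.Sum.Properties as Sumₚ
open import Data.Empty using (⊥; ⊥-elim)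
open import Data.Unit using (⊤; tt)
open import Data.List using (List; []; _∷_; _++_; [_]; _∷ʳ_; length; map; zip; filterᵇ; allFin; initLast; _∷ʳ′_)
import Data.List.Properties as Listₚ
open Listₚ using (++-assoc; length-++; length-map)
open import Data.List.Membership.Propositional using (_∈_; _∉_; find)
import Data.List.Membership.Propositional.Properties as MemP
open MemP using (∈-++⁺ˡ; ∈-++⁺ʳ; ∈-++⁻)
import Data.List.Membership.DecPropositional as DecMem
open import Data.List.Relation.Unary.Any as Any using (Any; here; there)
import Data.List.Relation.Unary.Any.Properties as AnyP
open import Data.List.Relation.Unary.All as All using (All; []; _∷_)
import Data.List.Relation.Unary.All.Properties as AllP
open import Data.List.Relation.Unary.AllPairs as AllPairs using (AllPairs; []; _∷_)
import Data.List.Relation.Unary.AllPairs.Properties as AllPairsₚ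
open import Data.List.Relation.Unary.Unique.Propositional using (Unique)
import Data.List.Relation.Unary.Unique.Propositional.Properties as Uniqueₚ
open Uniqueₚ using (Unique[x∷xs]⇒x∉xs)
open import Data.List.Relation.Binary.Permutation.Propositional as Perm using (_↭_; ↭-refl; ↭-sym; ↭-trans; ↭-reflexive; module PermutationReasoning)
import Data.List.Relation.Binary.Permutation.Propositional.Properties as PermP
open PermP using (∈-resp-↭; ∷↭∷ʳ)
open import Data.List.Relation.Binary.Sublist.Propositional as SubL using (_⊆_)
import Data.List.Relation.Binary.Sublist.Propositional.Properties as SubListₚ
import Data.List.Relation.Binary.BagAndSetEquality as BagAndSet
import Data.List.Membership.Propositional.Properties.WithK as WithK
open import Function.Bundles using (mk⇔)
open import Function using (_∘_)
open import Relation.Binary.Structures using (IsEquivalence)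
open import Relation.Binary.Definitions using (DecidableEquality)
open import Relation.Binary.Construct.Closure.Equivalence as EqClosure using (EqClosure; _⋆)
open import Relation.Binary.Construct.Closure.ReflexiveTransitive using (ε; _◅_; _◅◅_)
open import Relation.Binary.Construct.Closure.Symmetric using (fwd; bwd)
open import Relation.Binary.PropositionalEquality hiding ([_])
open import Relation.Nullary using (yes; no; ¬_; Dec)
open import Relation.Nullary.Decidable using (⌊_⌋; dec-true; dec-false; isYes≗does; fromWitness; toWitness)

private
  variable
    X : Set
    m : ℕ

-- Counting, and lists without repetition

indicator : Bool → ℕ
indicator true = 1
indicator false = 0

countᵇ : (X → Bool) → List X → ℕ
countᵇ p [] = 0
countᵇ p (x ∷ xs) = indicator (p x) + countᵇ p xs

length-filterᵇ : (p : X → Bool) (xs : List X) → length (filterᵇ p xs) ≡ countᵇ p xs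
length-filterᵇ p [] = refl
length-filterᵇ p (x ∷ xs) with p x
... | true = cong suc (length-filterᵇ p xs)
... | false = length-filterᵇ p xs

countᵇ-++ : (p : X → Bool) (xs ys : List X) → countᵇ p (xs ++ ys) ≡ countᵇ p xs + countᵇ p ys
countᵇ-++ p [] ys = refl
countᵇ-++ p (x ∷ xs) ys = trans (cong (indicator (p x) +_) (countᵇ-++ p xs ys)) (sym (+-assoc (indicator (p x)) _ _))

countᵇ-↭ : (p : X → Bool) {xs ys : List X} → xs ↭ ys → countᵇ p xs ≡ countᵇ p ys
countᵇ-↭ p Perm.refl = refl
countᵇ-↭ p (Perm.prep x q) = cong (indicator (p x) +_) (countᵇ-↭ p q)
countᵇ-↭ p (Perm.swap x y q) = trans (x∙yz≈y∙xz (indicator (p x)) (indicator (p y)) _)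
  (cong (λ n → indicator (p y) + (indicator (p x) + n)) (countᵇ-↭ p q))
countᵇ-↭ p (Perm.trans q r) = trans (countᵇ-↭ p q) (countᵇ-↭ p r)

countᵇ-cong : (p q : X → Bool) (xs : List X) → (∀ x → x ∈ xs → p x ≡ q x) → countᵇ p xs ≡ countᵇ q xs
countᵇ-cong p q [] h = refl
countᵇ-cong p q (x ∷ xs) h = cong₂ _+_ (cong indicator (h x (here refl))) (countᵇ-cong p q xs (λ y i → h y (there i)))

countᵇ-map : {Y : Set} (p : Y → Bool) (f : X → Y) (xs : List X) → countᵇ p (map f xs) ≡ countᵇ (λ x → p (f x)) xs
countᵇ-map p f [] = refl
countᵇ-map p f (x ∷ xs) = cong (indicator (p (f x)) +_) (countᵇ-map p f xs)

countᵇ-map-filterᵇ : {Y : Set} (q : Y → Bool) (g : X → Y) (p : X → Bool) (xs : List X) →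
                     countᵇ q (map g (filterᵇ p xs)) ≡ countᵇ (λ x → p x ∧ q (g x)) xs
countᵇ-map-filterᵇ q g p [] = refl
countᵇ-map-filterᵇ q g p (x ∷ xs) with p x
... | true = cong (indicator (q (g x)) +_) (countᵇ-map-filterᵇ q g p xs)
... | false = countᵇ-map-filterᵇ q g p xs

countᵇ-none : (p : X → Bool) (xs : List X) → (∀ x → x ∈ xs → p x ≡ false) → countᵇ p xs ≡ 0
countᵇ-none p [] h = refl
countᵇ-none p (x ∷ xs) h rewrite h x (here refl) = countᵇ-none p xs (λ y i → h y (there i))

∈⇒1≤countᵇ : (p : X → Bool) (xs : List X) {x : X} → x ∈ xs → p x ≡ true → 1 ≤ countᵇ p xs
∈⇒1≤countᵇ p (y ∷ xs) (here refl) px rewrite px = s≤s z≤n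
∈⇒1≤countᵇ p (y ∷ xs) (there i) px = ℕₚ.≤-trans (∈⇒1≤countᵇ p xs i px) (ℕₚ.m≤n+m _ (indicator (p y)))

1≤countᵇ⇒∃ : (p : X → Bool) (xs : List X) → 1 ≤ countᵇ p xs → ∃ λ x → x ∈ xs × p x ≡ true
1≤countᵇ⇒∃ p (x ∷ xs) h with p x in px
... | true = x , here refl , px
... | false = let (y , i , py) = 1≤countᵇ⇒∃ p xs h in y , there i , py

⊆⇒length≤countᵇ : (p : X → Bool) {E' E : List X} → E' ⊆ E → All (λ e → p e ≡ true) E' → length E' ≤ countᵇ p E
⊆⇒length≤countᵇ p SubL.[] _ = z≤n
⊆⇒length≤countᵇ p (y SubL.∷ʳ s) al = ℕₚ.≤-trans (⊆⇒length≤countᵇ p s al) (ℕₚ.m≤n+m _ (indicator (p y)))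
⊆⇒length≤countᵇ p (refl SubL.∷ s) (px ∷ al) rewrite px = s≤s (⊆⇒length≤countᵇ p s al)

filterᵇ-accept : (p : X → Bool) {x : X} (xs : List X) → p x ≡ true → filterᵇ p (x ∷ xs) ≡ x ∷ filterᵇ p xs
filterᵇ-accept p xs px = Listₚ.filter-accept (Boolₚ.T? ∘ p) (subst T (sym px) _)

filterᵇ-none : (p : X → Bool) (xs : List X) → (∀ {x} → x ∈ xs → p x ≡ false) → filterᵇ p xs ≡ []
filterᵇ-none p [] h = refl
filterᵇ-none p (x ∷ xs) h with p x | h (here refl)
... | .false | refl = filterᵇ-none p xs (λ i → h (there i))

unique-∷ : {x : X} {xs : List X} → x ∉ xs → Unique xs → Unique (x ∷ xs)
unique-∷ x∉xs u = AllP.¬Any⇒All¬ _ x∉xs ∷ u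

unique-↭ : {xs ys : List X} → xs ↭ ys → Unique xs → Unique ys
unique-↭ Perm.refl u = u
unique-↭ (Perm.prep x p) u = unique-∷ (λ i → Unique[x∷xs]⇒x∉xs u (∈-resp-↭ (↭-sym p) i)) (unique-↭ p (AllPairs.tail u))
unique-↭ (Perm.swap x y p) (x∉ ∷ y∉ ∷ u) =
  unique-∷ (λ { (here refl) → All.head x∉ refl ; (there i) → AllP.All¬⇒¬Any y∉ (∈-resp-↭ (↭-sym p) i) })
    (unique-∷ (λ i → AllP.All¬⇒¬Any (All.tail x∉) (∈-resp-↭ (↭-sym p) i)) (unique-↭ p u))
unique-↭ (Perm.trans p q) u = unique-↭ q (unique-↭ p u)

unique-++ˡ : (xs : List X) {ys : List X} → Unique (xs ++ ys) → Unique xs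
unique-++ˡ [] u = []
unique-++ˡ (x ∷ xs) u = unique-∷ (λ i → Unique[x∷xs]⇒x∉xs u (∈-++⁺ˡ i)) (unique-++ˡ xs (AllPairs.tail u))

unique-++ʳ : (xs : List X) {ys : List X} → Unique (xs ++ ys) → Unique ys
unique-++ʳ [] u = u
unique-++ʳ (x ∷ xs) u = unique-++ʳ xs (AllPairs.tail u)

unique-++-disjoint : (xs : List X) {ys : List X} → Unique (xs ++ ys) → ∀ {z} → z ∈ xs → z ∈ ys → ⊥
unique-++-disjoint (x ∷ xs) u (here refl) j = Unique[x∷xs]⇒x∉xs u (∈-++⁺ʳ xs j)
unique-++-disjoint (x ∷ xs) u (there i) j = unique-++-disjoint xs (AllPairs.tail u) i j

unique-++⁺ : {xs ys : List X} → Unique xs → Unique ys → (∀ {z} → z ∈ xs → z ∈ ys → ⊥) → Unique (xs ++ ys)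
unique-++⁺ u v disjoint = Uniqueₚ.++⁺ u v (λ (i , j) → disjoint i j)

unique-∷ʳ : (xs : List X) (x : X) → Unique xs → x ∉ xs → Unique (xs ∷ʳ x)
unique-∷ʳ xs x u x∉xs = unique-++⁺ u (unique-∷ (λ ()) []) (λ i j → x∉xs (subst (_∈ xs) (AnyP.singleton⁻ j) i))

unique-map⇒injective : {Y : Set} (f : X → Y) (xs : List X) → Unique (map f xs) → ∀ {a b} → a ∈ xs → b ∈ xs → f a ≡ f b → a ≡ b
unique-map⇒injective f (x ∷ xs) u (here refl) (here refl) e = refl
unique-map⇒injective f (x ∷ xs) u (here refl) (there j) e = ⊥-elim (Unique[x∷xs]⇒x∉xs u (subst (_∈ map f xs) (sym e) (MemP.∈-map⁺ f j)))
unique-map⇒injective f (x ∷ xs) u (there i) (here refl) e = ⊥-elim (Unique[x∷xs]⇒x∉xs u (subst (_∈ map f xs) e (MemP.∈-map⁺ f i)))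
unique-map⇒injective f (x ∷ xs) u (there i) (there j) e = unique-map⇒injective f xs (AllPairs.tail u) i j e

countᵇ≤1 : {Y : Set} (f : X → Y) (p : X → Bool) (xs : List X) → Unique (map f xs) →
           (∀ {a b} → a ∈ xs → b ∈ xs → p a ≡ true → p b ≡ true → f a ≡ f b) → countᵇ p xs ≤ 1
countᵇ≤1 f p [] u h = z≤n
countᵇ≤1 f p (x ∷ xs) u h with p x in px
... | false = countᵇ≤1 f p xs (AllPairs.tail u) (λ i j → h (there i) (there j))
... | true = ℕₚ.+-monoʳ-≤ 1 (ℕₚ.≤-reflexive (countᵇ-none p xs rest))
  where
  rest : ∀ y → y ∈ xs → p y ≡ false
  rest y i with p y in py
  ... | false = refl
  ... | true = ⊥-elim (Unique[x∷xs]⇒x∉xs u (subst (_∈ map f xs) (sym (h (here refl) (there i) px py)) (MemP.∈-map⁺ f i)))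

AllPairs-++⁻ : {R : X → X → Set} (xs : List X) {ys : List X} → AllPairs R (xs ++ ys) →
               AllPairs R xs × AllPairs R ys × All (λ x → All (R x) ys) xs
AllPairs-++⁻ [] rs = [] , rs , []
AllPairs-++⁻ (x ∷ xs) (r ∷ rs) =
  let (rxs , rys , rxys) = AllPairs-++⁻ xs rs ; (r₁ , r₂) = AllP.++⁻ xs r in (r₁ ∷ rxs) , rys , (r₂ ∷ rxys)

⌊⌋-true : {P : Set} (p? : Dec P) → P → ⌊ p? ⌋ ≡ true
⌊⌋-true p? p = trans (isYes≗does p?) (dec-true p? p)

⌊⌋-false : {P : Set} (p? : Dec P) → ¬ P → ⌊ p? ⌋ ≡ false
⌊⌋-false p? ¬p = trans (isYes≗does p?) (dec-false p? ¬p)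

∧≡true⇒≡true : {a b : Bool} → a ∧ b ≡ true → a ≡ true × b ≡ true
∧≡true⇒≡true {true} {true} _ = refl , refl

T-∧⇒≡true : {a b : Bool} → T (a ∧ b) → a ≡ true × b ≡ true
T-∧⇒≡true {true} {true} _ = refl , refl

true⇔true⇒≡ : {b c : Bool} → (b ≡ true → c ≡ true) → (c ≡ true → b ≡ true) → b ≡ c
true⇔true⇒≡ {true} {true} f g = refl
true⇔true⇒≡ {true} {false} f g = sym (f refl)
true⇔true⇒≡ {false} {true} f g = g refl
true⇔true⇒≡ {false} {false} f g = refl

any-∈ : (p : X → Bool) (xs : List X) {x : X} → x ∈ xs → p x ≡ true → any p xs ≡ true
any-∈ p (y ∷ xs) (here refl) px rewrite px = refl
any-∈ p (y ∷ xs) (there i) px rewrite any-∈ p xs i px = ∨-zeroʳ (p y)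

any-none : (p : X → Bool) (xs : List X) → (∀ {x} → x ∈ xs → p x ≡ false) → any p xs ≡ false
any-none p [] h = refl
any-none p (x ∷ xs) h rewrite h (here refl) = any-none p xs (λ i → h (there i))

any-cong : (p q : X → Bool) (xs : List X) → (∀ x → p x ≡ q x) → any p xs ≡ any q xs
any-cong p q [] h = refl
any-cong p q (x ∷ xs) h = cong₂ _∨_ (h x) (any-cong p q xs h)

-- Undirected edges, paths and cycles

SameEdge : X × X → X × X → Set
SameEdge e f = e ≡ f ⊎ e ≡ swap f

SameEdge-refl : {e : X × X} → SameEdge e e
SameEdge-refl = inj₁ refl

SameEdge-sym : {e f : X × X} → SameEdge e f → SameEdge f e
SameEdge-sym (inj₁ refl) = inj₁ refl
SameEdge-sym {e = x , y} (inj₂ refl) = inj₂ refl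

SameEdge-trans : {e f g : X × X} → SameEdge e f → SameEdge f g → SameEdge e g
SameEdge-trans (inj₁ refl) q = q
SameEdge-trans {g = x , y} (inj₂ refl) (inj₁ refl) = inj₂ refl
SameEdge-trans {g = x , y} (inj₂ refl) (inj₂ refl) = inj₁ refl

SameEdge-swap : {e f : X × X} → SameEdge e f → SameEdge e (swap f)
SameEdge-swap {f = x , y} (inj₁ refl) = inj₂ refl
SameEdge-swap {f = x , y} (inj₂ refl) = inj₁ refl

SameEdge-cases : {a b c d : X} → SameEdge (a , b) (c , d) → (a ≡ c × b ≡ d) ⊎ (a ≡ d × b ≡ c)
SameEdge-cases (inj₁ refl) = inj₁ (refl , refl)
SameEdge-cases (inj₂ refl) = inj₂ (refl , refl)

SameEdge-∈₁ : {x y a b : X} → SameEdge (x , y) (a , b) → x ≡ a ⊎ x ≡ b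
SameEdge-∈₁ (inj₁ refl) = inj₁ refl
SameEdge-∈₁ (inj₂ refl) = inj₂ refl

SameEdge-∈₂ : {x y a b : X} → SameEdge (x , y) (a , b) → y ≡ a ⊎ y ≡ b
SameEdge-∈₂ (inj₁ refl) = inj₂ refl
SameEdge-∈₂ (inj₂ refl) = inj₁ refl

sameEdge-swapped⇒SameEdge : (a b c d : Fin m) → ⌊ a FinP.≟ d ⌋ ∧ ⌊ b FinP.≟ c ⌋ ≡ true → SameEdge (a , b) (c , d)
sameEdge-swapped⇒SameEdge a b c d h with a FinP.≟ d | b FinP.≟ c | h
... | yes refl | yes refl | _ = inj₂ refl
... | yes _ | no _ | ()
... | no _ | _ | ()

sameEdge⇒SameEdge : (e f : Fin m × Fin m) → sameEdge e f ≡ true → SameEdge e f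
sameEdge⇒SameEdge (a , b) (c , d) h with a FinP.≟ c | b FinP.≟ d
... | yes refl | yes refl = inj₁ refl
... | yes _ | no _ = sameEdge-swapped⇒SameEdge a b c d h
... | no _ | _ = sameEdge-swapped⇒SameEdge a b c d h

SameEdge⇒sameEdge : (e f : Fin m × Fin m) → SameEdge e f → sameEdge e f ≡ true
SameEdge⇒sameEdge (a , b) _ (inj₁ refl) rewrite ⌊⌋-true (a FinP.≟ a) refl | ⌊⌋-true (b FinP.≟ b) refl = refl
SameEdge⇒sameEdge (a , b) _ (inj₂ refl) rewrite ⌊⌋-true (a FinP.≟ a) refl | ⌊⌋-true (b FinP.≟ b) refl = ∨-zeroʳ _

sameEdge-false : (e f : Fin m × Fin m) → ¬ SameEdge e f → sameEdge e f ≡ false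
sameEdge-false e f ¬same = ¬-not (λ h → ¬same (sameEdge⇒SameEdge e f h))

sameEdge-refl : (e : Fin m × Fin m) → sameEdge e e ≡ true
sameEdge-refl e = SameEdge⇒sameEdge e e SameEdge-refl

sameEdge-cong : (e f e' f' : Fin m × Fin m) → (SameEdge e f → SameEdge e' f') → (SameEdge e' f' → SameEdge e f) →
                sameEdge e f ≡ sameEdge e' f'
sameEdge-cong e f e' f' to from = true⇔true⇒≡ (λ h → SameEdge⇒sameEdge e' f' (to (sameEdge⇒SameEdge e f h)))
                                               (λ h → SameEdge⇒sameEdge e f (from (sameEdge⇒SameEdge e' f' h)))

sameEdge-swapʳ : (e f : Fin m × Fin m) → sameEdge e (swap f) ≡ sameEdge e f
sameEdge-swapʳ e (x , y) = sameEdge-cong e (y , x) e (x , y) SameEdge-swap SameEdge-swap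

sameEdge-respˡ : (e f g : Fin m × Fin m) → SameEdge e f → sameEdge e g ≡ sameEdge f g
sameEdge-respˡ e f g e~f = sameEdge-cong e g f g (SameEdge-trans (SameEdge-sym e~f)) (SameEdge-trans e~f)

sameEdge-both⇒SameEdge : (e f g : Fin m × Fin m) → sameEdge e f ≡ true → sameEdge e g ≡ true → SameEdge f g
sameEdge-both⇒SameEdge e f g h₁ h₂ = SameEdge-trans (SameEdge-sym (sameEdge⇒SameEdge e f h₁)) (sameEdge⇒SameEdge e g h₂)

norm-SameEdge : (e : Fin m × Fin m) → SameEdge (norm e) e
norm-SameEdge (a , b) with a Fin.≤? b
... | yes _ = inj₁ refl
... | no _ = inj₂ refl

norm-swap : (e : Fin m × Fin m) → norm (swap e) ≡ norm e
norm-swap (a , b) with a Fin.≤? b | b Fin.≤? a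
... | yes a≤b | yes b≤a = cong₂ _,_ (FinP.≤-antisym b≤a a≤b) (FinP.≤-antisym a≤b b≤a)
... | yes _ | no _ = refl
... | no _ | yes _ = refl
... | no a≰b | no b≰a = ⊥-elim (a≰b (ℕₚ.<⇒≤ (ℕₚ.≰⇒> b≰a)))

SameEdge⇒norm≡ : {e f : Fin m × Fin m} → SameEdge e f → norm e ≡ norm f
SameEdge⇒norm≡ (inj₁ refl) = refl
SameEdge⇒norm≡ {f = f} (inj₂ refl) = norm-swap f

norm≡⇒SameEdge : {e f : Fin m × Fin m} → norm e ≡ norm f → SameEdge e f
norm≡⇒SameEdge {e = e} {f} h = SameEdge-trans (SameEdge-sym (norm-SameEdge e)) (subst (λ n → SameEdge n f) (sym h) (norm-SameEdge f))

sameEdge⇒norm≡ : (e f : Fin m × Fin m) → sameEdge e f ≡ true → norm e ≡ norm f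
sameEdge⇒norm≡ e f h = SameEdge⇒norm≡ (sameEdge⇒SameEdge e f h)

norm≡⇒sameEdge : (e f : Fin m × Fin m) → norm e ≡ norm f → sameEdge e f ≡ true
norm≡⇒sameEdge e f h = SameEdge⇒sameEdge e f (norm≡⇒SameEdge h)

norm-< : (e : Fin m × Fin m) → proj₁ e ≢ proj₂ e → proj₁ (norm e) Fin.< proj₂ (norm e)
norm-< (a , b) a≢b with a Fin.≤? b
... | yes a≤b = FinP.≤∧≢⇒< a≤b a≢b
... | no a≰b = ℕₚ.≰⇒> a≰b

norm-≤ : {a b : Fin m} → a Fin.≤ b → norm (a , b) ≡ (a , b)
norm-≤ {a = a} {b} a≤b with a Fin.≤? b
... | yes _ = refl
... | no a≰b = ⊥-elim (a≰b a≤b)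

norm-idem : (e : Fin m × Fin m) → norm (norm e) ≡ norm e
norm-idem (a , b) with a Fin.≤? b
... | yes a≤b = norm-≤ a≤b
... | no a≰b = norm-≤ (ℕₚ.<⇒≤ (ℕₚ.≰⇒> a≰b))

map-norm-idem : (es : List (Fin m × Fin m)) → map norm (map norm es) ≡ map norm es
map-norm-idem [] = refl
map-norm-idem (e ∷ es) = cong₂ _∷_ (norm-idem e) (map-norm-idem es)

∈-map-proj₁ : {Y : Set} {a : X} {b : Y} {xs : List (X × Y)} → (a , b) ∈ xs → a ∈ map proj₁ xs
∈-map-proj₁ i = MemP.∈-map⁺ proj₁ i

∈-map-proj₂ : {Y : Set} {a : X} {b : Y} {xs : List (X × Y)} → (a , b) ∈ xs → b ∈ map proj₂ xs
∈-map-proj₂ i = MemP.∈-map⁺ proj₂ i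

pathEdges : List X → List (X × X)
pathEdges [] = []
pathEdges (x ∷ []) = []
pathEdges (x ∷ y ∷ r) = (x , y) ∷ pathEdges (y ∷ r)

zip-∷ʳ≡pathEdges : (y : X) (ys : List X) (x : X) → zip (y ∷ ys) (ys ∷ʳ x) ≡ pathEdges (y ∷ ys ∷ʳ x)
zip-∷ʳ≡pathEdges y [] x = refl
zip-∷ʳ≡pathEdges y (z ∷ zs) x = cong ((y , z) ∷_) (zip-∷ʳ≡pathEdges z zs x)

cycleEdges≡pathEdges : (x : X) (xs : List X) → cycleEdges (x ∷ xs) ≡ pathEdges (x ∷ xs ∷ʳ x)
cycleEdges≡pathEdges x xs = zip-∷ʳ≡pathEdges x xs x

pathEdges-++ : (xs : List X) (y : X) (ys : List X) → pathEdges (xs ++ y ∷ ys) ≡ pathEdges (xs ∷ʳ y) ++ pathEdges (y ∷ ys)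
pathEdges-++ [] y ys = refl
pathEdges-++ (x ∷ []) y ys = refl
pathEdges-++ (x ∷ x' ∷ xs) y ys = cong ((x , x') ∷_) (pathEdges-++ (x' ∷ xs) y ys)

pathEdges-∈₁ : (xs : List X) {a b : X} → (a , b) ∈ pathEdges xs → a ∈ xs
pathEdges-∈₁ (x ∷ y ∷ xs) (here refl) = here refl
pathEdges-∈₁ (x ∷ y ∷ xs) (there i) = there (pathEdges-∈₁ (y ∷ xs) i)

pathEdges-∈₁-init : (xs : List X) (z : X) {a b : X} → (a , b) ∈ pathEdges (xs ∷ʳ z) → a ∈ xs
pathEdges-∈₁-init (x ∷ []) z (here refl) = here refl
pathEdges-∈₁-init (x ∷ x' ∷ xs) z (here refl) = here refl
pathEdges-∈₁-init (x ∷ x' ∷ xs) z (there i) = there (pathEdges-∈₁-init (x' ∷ xs) z i)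

pathEdges-∈₂-tail : (z : X) (xs : List X) {a b : X} → (a , b) ∈ pathEdges (z ∷ xs) → b ∈ xs
pathEdges-∈₂-tail z (x ∷ xs) (here refl) = here refl
pathEdges-∈₂-tail z (x ∷ xs) (there i) = there (pathEdges-∈₂-tail x xs i)

pathEdges-prefix : (xs ys : List X) → ∀ {e} → e ∈ pathEdges xs → e ∈ pathEdges (xs ++ ys)
pathEdges-prefix (a ∷ b ∷ xs) ys (here refl) = here refl
pathEdges-prefix (a ∷ b ∷ xs) ys (there i) = there (pathEdges-prefix (b ∷ xs) ys i)

pathEdges-head : (a b : X) (xs : List X) → Unique (a ∷ b ∷ xs) → ∀ {c} → (a , c) ∈ pathEdges (a ∷ b ∷ xs) → c ≡ b
pathEdges-head a b xs u (here refl) = refl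
pathEdges-head a b xs u (there i) = ⊥-elim (Unique[x∷xs]⇒x∉xs u (pathEdges-∈₁ (b ∷ xs) i))

pathEdges-no-loop : (xs : List X) → Unique xs → ∀ {x} → (x , x) ∈ pathEdges xs → ⊥
pathEdges-no-loop (a ∷ b ∷ xs) u (here refl) = Unique[x∷xs]⇒x∉xs u (here refl)
pathEdges-no-loop (a ∷ b ∷ xs) u (there i) = pathEdges-no-loop (b ∷ xs) (AllPairs.tail u) i

pathEdges-no-reversal : (xs : List X) → Unique xs → ∀ {x y} → (x , y) ∈ pathEdges xs → (y , x) ∈ pathEdges xs → ⊥
pathEdges-no-reversal (a ∷ b ∷ xs) u (here refl) (here refl) = Unique[x∷xs]⇒x∉xs u (here refl)
pathEdges-no-reversal (a ∷ b ∷ xs) u (here refl) (there j) = Unique[x∷xs]⇒x∉xs u (there (pathEdges-∈₂-tail b xs j))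
pathEdges-no-reversal (a ∷ b ∷ xs) u (there i) (here refl) = Unique[x∷xs]⇒x∉xs u (there (pathEdges-∈₂-tail b xs i))
pathEdges-no-reversal (a ∷ b ∷ xs) u (there i) (there j) = pathEdges-no-reversal (b ∷ xs) (AllPairs.tail u) i j

cycleEdges-closing : (a : X) (xs : List X) (z : X) → cycleEdges (a ∷ xs ∷ʳ z) ≡ pathEdges (a ∷ xs ∷ʳ z) ∷ʳ (z , a)
cycleEdges-closing a xs z rewrite cycleEdges≡pathEdges a (xs ∷ʳ z) | ++-assoc xs [ z ] [ a ] = pathEdges-++ (a ∷ xs) z [ a ]

cycleEdges-rotate : (x : X) (xs : List X) → cycleEdges (xs ∷ʳ x) ↭ cycleEdges (x ∷ xs)
cycleEdges-rotate x [] = ↭-refl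
cycleEdges-rotate x (y ∷ ys) rewrite cycleEdges≡pathEdges y (ys ∷ʳ x) | cycleEdges≡pathEdges x (y ∷ ys)
  | ++-assoc ys [ x ] [ y ] | pathEdges-++ (y ∷ ys) x [ y ] = ↭-sym (∷↭∷ʳ (x , y) (pathEdges (y ∷ ys ∷ʳ x)))

length-∷ʳ : (xs : List X) (x : X) → length (xs ∷ʳ x) ≡ suc (length xs)
length-∷ʳ xs x = trans (length-++ xs) (ℕₚ.+-comm (length xs) 1)

length-zip : {Y : Set} (xs : List X) (ys : List Y) → length xs ≡ length ys → length (zip xs ys) ≡ length xs
length-zip [] [] _ = refl
length-zip (x ∷ xs) (y ∷ ys) h = cong suc (length-zip xs ys (ℕₚ.suc-injective h))

length-cycleEdges : (xs : List X) → length (cycleEdges xs) ≡ length xs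
length-cycleEdges [] = refl
length-cycleEdges (x ∷ xs) = length-zip (x ∷ xs) (xs ∷ʳ x) (sym (length-∷ʳ xs x))

map-proj₁-zip : {Y : Set} (xs : List X) (ys : List Y) → length xs ≡ length ys → map proj₁ (zip xs ys) ≡ xs
map-proj₁-zip [] [] _ = refl
map-proj₁-zip (x ∷ xs) (y ∷ ys) h = cong (x ∷_) (map-proj₁-zip xs ys (ℕₚ.suc-injective h))

map-proj₂-zip : {Y : Set} (xs : List X) (ys : List Y) → length xs ≡ length ys → map proj₂ (zip xs ys) ≡ ys
map-proj₂-zip [] [] _ = refl
map-proj₂-zip (x ∷ xs) (y ∷ ys) h = cong (y ∷_) (map-proj₂-zip xs ys (ℕₚ.suc-injective h))

map-proj₁-cycleEdges : (xs : List X) → map proj₁ (cycleEdges xs) ≡ xs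
map-proj₁-cycleEdges [] = refl
map-proj₁-cycleEdges (x ∷ xs) = map-proj₁-zip (x ∷ xs) (xs ∷ʳ x) (sym (length-∷ʳ xs x))

map-proj₂-cycleEdges : (x : X) (xs : List X) → map proj₂ (cycleEdges (x ∷ xs)) ≡ xs ∷ʳ x
map-proj₂-cycleEdges x xs = map-proj₂-zip (x ∷ xs) (xs ∷ʳ x) (sym (length-∷ʳ xs x))

cycleEdges-∈₁ : (xs : List X) {a b : X} → (a , b) ∈ cycleEdges xs → a ∈ xs
cycleEdges-∈₁ xs i = subst (_ ∈_) (map-proj₁-cycleEdges xs) (∈-map-proj₁ i)

cycleEdges-∈₂ : (xs : List X) {a b : X} → (a , b) ∈ cycleEdges xs → b ∈ xs
cycleEdges-∈₂ (x ∷ xs) i = ∈-resp-↭ (↭-sym (∷↭∷ʳ x xs)) (subst (_ ∈_) (map-proj₂-cycleEdges x xs) (∈-map-proj₂ i))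

out-edge : (xs : List X) {w : X} → w ∈ xs → ∃ λ y → (w , y) ∈ cycleEdges xs
out-edge xs i with MemP.∈-map⁻ proj₁ (subst (_ ∈_) (sym (map-proj₁-cycleEdges xs)) i)
... | (_ , y) , j , refl = y , j

in-edge : (xs : List X) {w : X} → w ∈ xs → ∃ λ x → (x , w) ∈ cycleEdges xs
in-edge (x ∷ xs) i with MemP.∈-map⁻ proj₂ (subst (_ ∈_) (sym (map-proj₂-cycleEdges x xs)) (∈-resp-↭ (∷↭∷ʳ x xs) i))
... | (y , _) , j , refl = y , j

in-edge-unique : (xs : List X) → Unique xs → ∀ {x x' w} → (x , w) ∈ cycleEdges xs → (x' , w) ∈ cycleEdges xs → x ≡ x'
in-edge-unique (z ∷ zs) u i j =
  cong proj₁ (unique-map⇒injective proj₂ _ (subst Unique (sym (map-proj₂-cycleEdges z zs)) (unique-↭ (∷↭∷ʳ z zs) u)) i j refl)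

out-edge-unique : (xs : List X) → Unique xs → ∀ {y y' w} → (w , y) ∈ cycleEdges xs → (w , y') ∈ cycleEdges xs → y ≡ y'
out-edge-unique xs u i j = cong proj₂ (unique-map⇒injective proj₁ _ (subst Unique (sym (map-proj₁-cycleEdges xs)) u) i j refl)

cycleEdges-no-loop : (xs : List X) → Unique xs → 2 ≤ length xs → ∀ {x} → (x , x) ∈ cycleEdges xs → ⊥
cycleEdges-no-loop (a ∷ xs) u l i with initLast xs | l
... | [] | s≤s ()
... | zs ∷ʳ′ z | _ rewrite cycleEdges-closing a zs z with ∈-++⁻ (pathEdges (a ∷ zs ∷ʳ z)) i
...   | inj₁ j = pathEdges-no-loop _ u j
...   | inj₂ (here refl) = Unique[x∷xs]⇒x∉xs u (∈-++⁺ʳ zs (here refl))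

cycleEdges-no-reversal : (xs : List X) → Unique xs → 3 ≤ length xs → ∀ {x y} → (x , y) ∈ cycleEdges xs → (y , x) ∈ cycleEdges xs → ⊥
cycleEdges-no-reversal (a ∷ []) u (s≤s ()) i j
cycleEdges-no-reversal (a ∷ b ∷ xs) u l i j with initLast xs | l
... | [] | s≤s (s≤s ())
... | zs ∷ʳ′ z | _ rewrite cycleEdges-closing a (b ∷ zs) z =
  no-reversal (∈-++⁻ (pathEdges (a ∷ b ∷ zs ∷ʳ z)) i) (∈-++⁻ (pathEdges (a ∷ b ∷ zs ∷ʳ z)) j)
  where
  z∈ : z ∈ b ∷ zs ∷ʳ z
  z∈ = there (∈-++⁺ʳ zs (here refl))
  closing-not-path : (a , z) ∉ pathEdges (a ∷ b ∷ zs ∷ʳ z)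
  closing-not-path k with pathEdges-head a b (zs ∷ʳ z) u k
  ... | refl = Unique[x∷xs]⇒x∉xs (AllPairs.tail u) (∈-++⁺ʳ zs (here refl))
  no-reversal : ∀ {x y} → (x , y) ∈ pathEdges (a ∷ b ∷ zs ∷ʳ z) ⊎ (x , y) ∈ [ (z , a) ] →
                (y , x) ∈ pathEdges (a ∷ b ∷ zs ∷ʳ z) ⊎ (y , x) ∈ [ (z , a) ] → ⊥
  no-reversal (inj₁ p) (inj₁ q) = pathEdges-no-reversal _ u p q
  no-reversal (inj₁ p) (inj₂ (here refl)) = closing-not-path p
  no-reversal (inj₂ (here refl)) (inj₁ q) = closing-not-path q
  no-reversal (inj₂ (here refl)) (inj₂ (here refl)) = Unique[x∷xs]⇒x∉xs u z∈

unique-map-norm : (es : List (Fin m × Fin m)) → Unique (map proj₁ es) → (∀ {x y} → (x , y) ∈ es → (y , x) ∈ es → x ≡ y) →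
                  Unique (map norm es)
unique-map-norm [] u h = []
unique-map-norm (e ∷ es) u h = unique-∷ fresh (unique-map-norm es (AllPairs.tail u) (λ i j → h (there i) (there j)))
  where
  fresh : norm e ∉ map norm es
  fresh k with MemP.∈-map⁻ norm k
  ... | e' , k' , q with norm≡⇒SameEdge q
  ... | inj₁ refl = Unique[x∷xs]⇒x∉xs u (∈-map-proj₁ k')
  ... | inj₂ refl with h (here refl) (there k')
  ... | refl = Unique[x∷xs]⇒x∉xs u (∈-map-proj₁ k')

unique-norm-cycleEdges : (xs : List (Fin m)) → Unique xs → 3 ≤ length xs → Unique (map norm (cycleEdges xs))
unique-norm-cycleEdges xs u l =
  unique-map-norm (cycleEdges xs) (subst Unique (sym (map-proj₁-cycleEdges xs)) u) (λ i j → ⊥-elim (cycleEdges-no-reversal xs u l i j))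

norm-cycleEdges-disjoint : (xs ys : List (Fin m)) → (∀ {z} → z ∈ xs → z ∈ ys → ⊥) →
                           ∀ {e} → e ∈ map norm (cycleEdges xs) → e ∈ map norm (cycleEdges ys) → ⊥
norm-cycleEdges-disjoint xs ys disjoint i j with MemP.∈-map⁻ norm i | MemP.∈-map⁻ norm j
... | e , ei , refl | f , fj , q with norm≡⇒SameEdge q
... | inj₁ refl = disjoint (cycleEdges-∈₁ xs ei) (cycleEdges-∈₁ ys fj)
... | inj₂ refl = disjoint (cycleEdges-∈₁ xs ei) (cycleEdges-∈₂ ys fj)

reach-mono : {es es' : List (X × X)} → (∀ {e} → e ∈ es → e ∈ es') → ∀ {x y} → Reach es x y → Reach es' x y
reach-mono f here = here
reach-mono f (step r (inj₁ a)) = step (reach-mono f r) (inj₁ (f a))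
reach-mono f (step r (inj₂ a)) = step (reach-mono f r) (inj₂ (f a))

reach-trans : {es : List (X × X)} {x y z : X} → Reach es x y → Reach es y z → Reach es x z
reach-trans p here = p
reach-trans p (step q a) = step (reach-trans p q) a

reach-sym : {es : List (X × X)} {x y : X} → Reach es x y → Reach es y x
reach-sym here = here
reach-sym (step r a) = reach-trans (step here (Sum.swap a)) (reach-sym r)

reach-isEquivalence : (es : List (X × X)) → IsEquivalence (Reach es)
reach-isEquivalence es = record { refl = here ; sym = reach-sym ; trans = reach-trans }

Reach-map-norm : {es : List (Fin m × Fin m)} {x y : Fin m} → Reach es x y → Reach (map norm es) x y
Reach-map-norm here = here
Reach-map-norm {es = es} (step r a) = step (Reach-map-norm r) (adjacent a)
  where
  adjacent : ∀ {a b} → Adj es a b → Adj (map norm es) a b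
  adjacent {a} {b} (inj₁ i) with norm (a , b) | norm-SameEdge (a , b) | MemP.∈-map⁺ norm i
  ... | .(a , b) | inj₁ refl | j = inj₁ j
  ... | .(b , a) | inj₂ refl | j = inj₂ j
  adjacent {a} {b} (inj₂ i) with norm (b , a) | norm-SameEdge (b , a) | MemP.∈-map⁺ norm i
  ... | .(b , a) | inj₁ refl | j = inj₂ j
  ... | .(a , b) | inj₂ refl | j = inj₁ j

pathEdges-reach : (a : X) (as : List X) → ∀ {w} → w ∈ a ∷ as → Reach (pathEdges (a ∷ as)) a w
pathEdges-reach a as (here refl) = here
pathEdges-reach a (b ∷ r) (there i) = reach-trans (step here (inj₁ (here refl))) (reach-mono there (pathEdges-reach b r i))

cycleEdges-reach : (xs : List X) → ∀ {x y} → x ∈ xs → y ∈ xs → Reach (cycleEdges xs) x y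
cycleEdges-reach (a ∷ as) i j rewrite cycleEdges≡pathEdges a as =
  reach-trans (reach-sym (along (pathEdges-reach a as i))) (along (pathEdges-reach a as j))
  where
  along : ∀ {x y} → Reach (pathEdges (a ∷ as)) x y → Reach (pathEdges (a ∷ as ∷ʳ a)) x y
  along = reach-mono (pathEdges-prefix (a ∷ as) [ a ])

-- Triangles, links and partial triangulations

Touches : (X → X → Set) → X → Set
Touches R x = ∃ λ y → R x y ⊎ R y x

Connected : (X → X → Set) → Set
Connected R = ∀ {x y} → Touches R x → Touches R y → EqClosure R x y

Touches-map : {R R' : X → X → Set} → (∀ {x y} → R x y → R' x y) → ∀ {x} → Touches R x → Touches R' x
Touches-map f (y , r) = y , Sum.map f f r

Connected-hub : {R : X → X → Set} (h : X) → (∀ {x} → Touches R x → EqClosure R h x) → Connected R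
Connected-hub h reach x y = EqClosure.symmetric _ (reach x) ◅◅ reach y

Connected-transfer : {R R' : X → X → Set} → Connected R → (∀ {x y} → R x y → EqClosure R' x y) →
                     (∀ {x} → Touches R' x → ∃ λ z → Touches R z × EqClosure R' z x) → Connected R'
Connected-transfer connected simulate anchor x y =
  let (zx , tx , px) = anchor x ; (zy , ty , py) = anchor y in
  EqClosure.symmetric _ px ◅◅ (simulate ⋆) (connected tx ty) ◅◅ py

Connected-resp : {R R' : X → X → Set} → Connected R → (∀ {x y} → R' x y → R x y) → (∀ {x y} → R x y → R' x y) → Connected R'
Connected-resp connected to from =
  Connected-transfer connected (λ r → fwd (from r) ◅ ε) (λ { (y , r) → _ , (y , Sum.map to to r) , ε })

Connected-single : {R : X → X → Set} → (∀ {x y x' y'} → R x y → R x' y' → x ≡ x' × y ≡ y') → Connected R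
Connected-single single (_ , inj₁ r₁) (_ , inj₁ r₂) with single r₁ r₂
... | refl , _ = ε
Connected-single single (_ , inj₁ r₁) (_ , inj₂ r₂) with single r₁ r₂
... | refl , refl = fwd r₁ ◅ ε
Connected-single single (_ , inj₂ r₁) (_ , inj₁ r₂) with single r₁ r₂
... | refl , refl = bwd r₂ ◅ ε
Connected-single single (_ , inj₂ r₁) (_ , inj₂ r₂) with single r₁ r₂
... | _ , refl = ε

tri : Fin m → Fin m → Fin m → Tri m
tri w₁ w₂ v = proj₁ (norm (w₁ , w₂)) , proj₂ (norm (w₁ , w₂)) , v

Canonical : Tri m → Set
Canonical t = proj₁ t Fin.< proj₁ (proj₂ t) × proj₁ (proj₂ t) Fin.< proj₂ (proj₂ t)

Distinct3 : Fin m → Fin m → Fin m → Set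
Distinct3 x y z = x ≢ y × x ≢ z × y ≢ z

δ : Fin m × Fin m → Fin m × Fin m → ℕ
δ e f = indicator (sameEdge e f)

triCount : Fin m × Fin m → List (Tri m) → ℕ
triCount e ts = countᵇ (λ t → any (sameEdge e) (triEdges t)) ts

indicator-∨₃ : (a b c : Bool) → (a ≡ true → b ≡ true → ⊥) → (a ≡ true → c ≡ true → ⊥) → (b ≡ true → c ≡ true → ⊥) →
               indicator (a ∨ (b ∨ (c ∨ false))) ≡ indicator a + indicator b + indicator c
indicator-∨₃ true true c ab ac bc = ⊥-elim (ab refl refl)
indicator-∨₃ true false true ab ac bc = ⊥-elim (ac refl refl)
indicator-∨₃ true false false ab ac bc = refl
indicator-∨₃ false true true ab ac bc = ⊥-elim (bc refl refl)
indicator-∨₃ false true false ab ac bc = refl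
indicator-∨₃ false false true ab ac bc = refl
indicator-∨₃ false false false ab ac bc = refl

indicator-triEdges : (e : Fin m × Fin m) (x y z : Fin m) → Distinct3 x y z →
                     indicator (any (sameEdge e) (triEdges (x , y , z))) ≡ δ e (x , y) + δ e (y , z) + δ e (x , z)
indicator-triEdges e x y z (x≢y , x≢z , y≢z) = indicator-∨₃ _ _ _
  (λ h₁ h₂ → xy-yz (SameEdge-cases (sameEdge-both⇒SameEdge e _ _ h₁ h₂)))
  (λ h₁ h₂ → xy-xz (SameEdge-cases (sameEdge-both⇒SameEdge e _ _ h₁ h₂)))
  (λ h₁ h₂ → yz-xz (SameEdge-cases (sameEdge-both⇒SameEdge e _ _ h₁ h₂)))
  where
  xy-yz : (x ≡ y × y ≡ z) ⊎ (x ≡ z × y ≡ y) → ⊥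
  xy-yz = Sum.[ x≢y ∘ proj₁ , x≢z ∘ proj₁ ]
  xy-xz : (x ≡ x × y ≡ z) ⊎ (x ≡ z × y ≡ x) → ⊥
  xy-xz = Sum.[ y≢z ∘ proj₂ , x≢z ∘ proj₁ ]
  yz-xz : (y ≡ x × z ≡ z) ⊎ (y ≡ z × z ≡ x) → ⊥
  yz-xz = Sum.[ x≢y ∘ sym ∘ proj₁ , y≢z ∘ proj₁ ]

indicator-triEdges-tri : (e : Fin m × Fin m) (w₁ w₂ v : Fin m) → Distinct3 w₁ w₂ v →
                         indicator (any (sameEdge e) (triEdges (tri w₁ w₂ v))) ≡ δ e (w₁ , w₂) + δ e (w₁ , v) + δ e (w₂ , v)
indicator-triEdges-tri e w₁ w₂ v (w₁≢w₂ , w₁≢v , w₂≢v) with norm (w₁ , w₂) | norm-SameEdge (w₁ , w₂)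
... | .(w₁ , w₂) | inj₁ refl =
      trans (indicator-triEdges e w₁ w₂ v (w₁≢w₂ , w₁≢v , w₂≢v)) (xy∙z≈xz∙y (δ e (w₁ , w₂)) (δ e (w₂ , v)) (δ e (w₁ , v)))
... | .(w₂ , w₁) | inj₂ refl = trans (indicator-triEdges e w₂ w₁ v (w₁≢w₂ ∘ sym , w₂≢v , w₁≢v))
      (cong (λ b → indicator b + δ e (w₁ , v) + δ e (w₂ , v)) (sameEdge-swapʳ e (w₁ , w₂)))

∈T-tri : {w w₁ w₂ v : Fin m} → w ∈T tri w₁ w₂ v → w ≡ w₁ ⊎ w ≡ w₂ ⊎ w ≡ v
∈T-tri {w₁ = w₁} {w₂} h with norm (w₁ , w₂) | norm-SameEdge (w₁ , w₂)
... | .(w₁ , w₂) | inj₁ refl = h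
... | .(w₂ , w₁) | inj₂ refl = Sum.[ inj₂ ∘ inj₁ , Sum.[ inj₁ , inj₂ ∘ inj₂ ] ] h

∈T-tri₁ : (w₁ w₂ v : Fin m) → w₁ ∈T tri w₁ w₂ v
∈T-tri₁ w₁ w₂ v with norm (w₁ , w₂) | norm-SameEdge (w₁ , w₂)
... | .(w₁ , w₂) | inj₁ refl = inj₁ refl
... | .(w₂ , w₁) | inj₂ refl = inj₂ (inj₁ refl)

tri-canonical : (w₁ w₂ v : Fin m) → w₁ ≢ w₂ → w₁ Fin.< v → w₂ Fin.< v → Canonical (tri w₁ w₂ v)
tri-canonical w₁ w₂ v w₁≢w₂ w₁<v w₂<v with norm (w₁ , w₂) | norm-SameEdge (w₁ , w₂) | norm-< (w₁ , w₂) w₁≢w₂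
... | .(w₁ , w₂) | inj₁ refl | lt = lt , w₂<v
... | .(w₂ , w₁) | inj₂ refl | lt = lt , w₁<v

SameEdge⇒∈T : {e : Fin m × Fin m} {a b : Fin m} {t : Tri m} → a ∈T t → b ∈T t → SameEdge e (a , b) → proj₁ e ∈T t × proj₂ e ∈T t
SameEdge⇒∈T a∈t b∈t (inj₁ refl) = a∈t , b∈t
SameEdge⇒∈T a∈t b∈t (inj₂ refl) = b∈t , a∈t

triEdges-endpoints : (e : Fin m × Fin m) (t : Tri m) → any (sameEdge e) (triEdges t) ≡ true → proj₁ e ∈T t × proj₂ e ∈T t
triEdges-endpoints e (x , y , z) h with sameEdge e (x , y) in exy | sameEdge e (y , z) in eyz | sameEdge e (x , z) in exz | h
... | true | _ | _ | _ = SameEdge⇒∈T (inj₁ refl) (inj₂ (inj₁ refl)) (sameEdge⇒SameEdge e _ exy)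
... | false | true | _ | _ = SameEdge⇒∈T (inj₂ (inj₁ refl)) (inj₂ (inj₂ refl)) (sameEdge⇒SameEdge e _ eyz)
... | false | false | true | _ = SameEdge⇒∈T (inj₁ refl) (inj₂ (inj₂ refl)) (sameEdge⇒SameEdge e _ exz)
... | false | false | false | ()

opp-first : (x y z : Fin m) → opp x (x , y , z) ≡ just (y , z)
opp-first x y z rewrite ⌊⌋-true (x FinP.≟ x) refl = refl

opp-second : (x y z : Fin m) → x ≢ y → opp y (x , y , z) ≡ just (x , z)
opp-second x y z x≢y rewrite ⌊⌋-false (y FinP.≟ x) (x≢y ∘ sym) | ⌊⌋-true (y FinP.≟ y) refl = refl

opp-third : (x y z : Fin m) → x ≢ z → y ≢ z → opp z (x , y , z) ≡ just (x , y)
opp-third x y z x≢z y≢z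
  rewrite ⌊⌋-false (z FinP.≟ x) (x≢z ∘ sym) | ⌊⌋-false (z FinP.≟ y) (y≢z ∘ sym) | ⌊⌋-true (z FinP.≟ z) refl = refl

opp≡just : (w x y z : Fin m) {a b : Fin m} → opp w (x , y , z) ≡ just (a , b) →
           (w ≡ x × a ≡ y × b ≡ z) ⊎ (w ≡ y × a ≡ x × b ≡ z) ⊎ (w ≡ z × a ≡ x × b ≡ y)
opp≡just w x y z h with w FinP.≟ x
opp≡just w x y z refl | yes w≡x = inj₁ (w≡x , refl , refl)
... | no _ with w FinP.≟ y
opp≡just w x y z refl | no _ | yes w≡y = inj₂ (inj₁ (w≡y , refl , refl))
... | no _ with w FinP.≟ z
opp≡just w x y z refl | no _ | no _ | yes w≡z = inj₂ (inj₂ (w≡z , refl , refl))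
opp≡just w x y z () | no _ | no _ | no _

opp⇒∈T : (w : Fin m) (t : Tri m) {x y : Fin m} → opp w t ≡ just (x , y) → w ∈T t
opp⇒∈T w (x , y , z) h = Sum.map proj₁ (Sum.map proj₁ proj₁) (opp≡just w x y z h)

record Opposite (w : Fin m) (t : Tri m) (x y : Fin m) : Set where
  constructor mkOpposite
  field opposite : opp w t ≡ just (x , y) ⊎ opp w t ≡ just (y , x)

Opposite-sym : {w : Fin m} {t : Tri m} {a b : Fin m} → Opposite w t a b → Opposite w t b a
Opposite-sym (mkOpposite o) = mkOpposite (Sum.swap o)

OppositeCases : (w x y z a b : Fin m) → Set
OppositeCases w x y z a b =
  (w ≡ z × SameEdge (a , b) (x , y)) ⊎ (w ≡ x × SameEdge (a , b) (y , z)) ⊎ (w ≡ y × SameEdge (a , b) (x , z))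

Opposite-triple : (w x y z a b : Fin m) → Opposite w (x , y , z) a b → OppositeCases w x y z a b
Opposite-triple w x y z a b (mkOpposite (inj₁ o)) = cases (opp≡just w x y z o)
  where
  cases : (w ≡ x × a ≡ y × b ≡ z) ⊎ (w ≡ y × a ≡ x × b ≡ z) ⊎ (w ≡ z × a ≡ x × b ≡ y) → OppositeCases w x y z a b
  cases (inj₁ (w≡x , refl , refl)) = inj₂ (inj₁ (w≡x , SameEdge-refl))
  cases (inj₂ (inj₁ (w≡y , refl , refl))) = inj₂ (inj₂ (w≡y , SameEdge-refl))
  cases (inj₂ (inj₂ (w≡z , refl , refl))) = inj₁ (w≡z , SameEdge-refl)
Opposite-triple w x y z a b (mkOpposite (inj₂ o)) =
  Sum.map (Product.map₂ flip) (Sum.map (Product.map₂ flip) (Product.map₂ flip)) (Opposite-triple w x y z b a (mkOpposite (inj₁ o)))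
  where
  flip : ∀ {e} → SameEdge (b , a) e → SameEdge (a , b) e
  flip = SameEdge-trans (inj₂ refl)

Opposite-tri : (w₁ w₂ v w a b : Fin m) → Opposite w (tri w₁ w₂ v) a b →
  (w ≡ v × SameEdge (a , b) (w₁ , w₂)) ⊎ (w ≡ w₁ × SameEdge (a , b) (w₂ , v)) ⊎ (w ≡ w₂ × SameEdge (a , b) (w₁ , v))
Opposite-tri w₁ w₂ v w a b o with norm (w₁ , w₂) | norm-SameEdge (w₁ , w₂)
... | .(w₁ , w₂) | inj₁ refl = Opposite-triple w w₁ w₂ v a b o
... | .(w₂ , w₁) | inj₂ refl with Opposite-triple w w₂ w₁ v a b o
...   | inj₁ (w≡v , ab~w₂w₁) = inj₁ (w≡v , SameEdge-swap ab~w₂w₁)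
...   | inj₂ (inj₁ (w≡w₂ , ab~w₁v)) = inj₂ (inj₂ (w≡w₂ , ab~w₁v))
...   | inj₂ (inj₂ (w≡w₁ , ab~w₂v)) = inj₂ (inj₁ (w≡w₁ , ab~w₂v))

Opposite-tri-apex : (w₁ w₂ v : Fin m) → Distinct3 w₁ w₂ v → Opposite v (tri w₁ w₂ v) w₁ w₂
Opposite-tri-apex w₁ w₂ v (_ , w₁≢v , w₂≢v) with norm (w₁ , w₂) | norm-SameEdge (w₁ , w₂)
... | .(w₁ , w₂) | inj₁ refl = mkOpposite (inj₁ (opp-third w₁ w₂ v w₁≢v w₂≢v))
... | .(w₂ , w₁) | inj₂ refl = mkOpposite (inj₂ (opp-third w₂ w₁ v w₂≢v w₁≢v))

Opposite-tri₁ : (w₁ w₂ v : Fin m) → Distinct3 w₁ w₂ v → Opposite w₁ (tri w₁ w₂ v) w₂ v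
Opposite-tri₁ w₁ w₂ v (w₁≢w₂ , _) with norm (w₁ , w₂) | norm-SameEdge (w₁ , w₂)
... | .(w₁ , w₂) | inj₁ refl = mkOpposite (inj₁ (opp-first w₁ w₂ v))
... | .(w₂ , w₁) | inj₂ refl = mkOpposite (inj₁ (opp-second w₂ w₁ v (w₁≢w₂ ∘ sym)))

Opposite-tri₂ : (w₁ w₂ v : Fin m) → Distinct3 w₁ w₂ v → Opposite w₂ (tri w₁ w₂ v) w₁ v
Opposite-tri₂ w₁ w₂ v (w₁≢w₂ , _) with norm (w₁ , w₂) | norm-SameEdge (w₁ , w₂)
... | .(w₁ , w₂) | inj₁ refl = mkOpposite (inj₁ (opp-second w₁ w₂ v w₁≢w₂))
... | .(w₂ , w₁) | inj₂ refl = mkOpposite (inj₁ (opp-first w₂ w₁ v))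

-- A record rather than a definition, so that the relation LinkEdge ts w is not unfolded during inference.
record LinkEdge (ts : List (Tri m)) (w x y : Fin m) : Set where
  constructor mkLinkEdge
  field link-edge : (x , y) ∈ link ts w

∈-link-∷ : (t : Tri m) (ts : List (Tri m)) (w : Fin m) {e : Fin m × Fin m} → e ∈ link (t ∷ ts) w → opp w t ≡ just e ⊎ e ∈ link ts w
∈-link-∷ t ts w h with opp w t
∈-link-∷ t ts w (here refl) | just _ = inj₁ refl
∈-link-∷ t ts w (there h) | just _ = inj₂ h
∈-link-∷ t ts w h | nothing = inj₂ h

∈-link-∷ˡ : (t : Tri m) (ts : List (Tri m)) (w : Fin m) {e : Fin m × Fin m} → opp w t ≡ just e → e ∈ link (t ∷ ts) w
∈-link-∷ˡ t ts w h with opp w t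
∈-link-∷ˡ t ts w refl | just _ = here refl

∈-link-∷ʳ : (t : Tri m) (ts : List (Tri m)) (w : Fin m) {e : Fin m × Fin m} → e ∈ link ts w → e ∈ link (t ∷ ts) w
∈-link-∷ʳ t ts w h with opp w t
... | just _ = there h
... | nothing = h

LinkEdge-∷ : (t : Tri m) (ts : List (Tri m)) (w : Fin m) {x y : Fin m} →
             LinkEdge (t ∷ ts) w x y → opp w t ≡ just (x , y) ⊎ LinkEdge ts w x y
LinkEdge-∷ t ts w (mkLinkEdge h) = Sum.map₂ mkLinkEdge (∈-link-∷ t ts w h)

LinkEdge-∷ˡ : (t : Tri m) (ts : List (Tri m)) (w : Fin m) {x y : Fin m} → opp w t ≡ just (x , y) → LinkEdge (t ∷ ts) w x y
LinkEdge-∷ˡ t ts w o = mkLinkEdge (∈-link-∷ˡ t ts w o)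

LinkEdge-∷ʳ : (t : Tri m) (ts : List (Tri m)) (w : Fin m) {x y : Fin m} → LinkEdge ts w x y → LinkEdge (t ∷ ts) w x y
LinkEdge-∷ʳ t ts w (mkLinkEdge h) = mkLinkEdge (∈-link-∷ʳ t ts w h)

LinkEdge⇒opp : (ts : List (Tri m)) (w : Fin m) {x y : Fin m} → LinkEdge ts w x y → ∃ λ t → t ∈ ts × opp w t ≡ just (x , y)
LinkEdge⇒opp (t ∷ ts) w h with LinkEdge-∷ t ts w h
... | inj₁ o = t , here refl , o
... | inj₂ l = let (t' , i , o) = LinkEdge⇒opp ts w l in t' , there i , o

opp⇒LinkEdge : {t : Tri m} {ts : List (Tri m)} {w x y : Fin m} → t ∈ ts → opp w t ≡ just (x , y) → LinkEdge ts w x y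
opp⇒LinkEdge {ts = t ∷ ts} {w} (here refl) o = LinkEdge-∷ˡ t ts w o
opp⇒LinkEdge {ts = t ∷ ts} {w} (there i) o = LinkEdge-∷ʳ t ts w (opp⇒LinkEdge i o)

Opposite⇒LinkPath : {t : Tri m} {ts : List (Tri m)} {w x y : Fin m} → t ∈ ts → Opposite w t x y → EqClosure (LinkEdge ts w) x y
Opposite⇒LinkPath i (mkOpposite (inj₁ o)) = fwd (opp⇒LinkEdge i o) ◅ ε
Opposite⇒LinkPath i (mkOpposite (inj₂ o)) = bwd (opp⇒LinkEdge i o) ◅ ε

Opposite⇒Touches₁ : {t : Tri m} {ts : List (Tri m)} {w x y : Fin m} → t ∈ ts → Opposite w t x y → Touches (LinkEdge ts w) x
Opposite⇒Touches₁ {y = y} i (mkOpposite (inj₁ o)) = y , inj₁ (opp⇒LinkEdge i o)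
Opposite⇒Touches₁ {y = y} i (mkOpposite (inj₂ o)) = y , inj₂ (opp⇒LinkEdge i o)

Opposite⇒Touches₂ : {t : Tri m} {ts : List (Tri m)} {w x y : Fin m} → t ∈ ts → Opposite w t x y → Touches (LinkEdge ts w) y
Opposite⇒Touches₂ i o = Opposite⇒Touches₁ i (Opposite-sym o)

LinkEdge-mono : {ts ts' : List (Tri m)} → (∀ {t} → t ∈ ts → t ∈ ts') → ∀ {w x y} → LinkEdge ts w x y → EqClosure (LinkEdge ts' w) x y
LinkEdge-mono {ts = ts} sub {w} l = let (t , i , o) = LinkEdge⇒opp ts w l in Opposite⇒LinkPath (sub i) (mkOpposite (inj₁ o))

LinkPath⇒Reach : {ts : List (Tri m)} {w x y : Fin m} → EqClosure (LinkEdge ts w) x y → Reach (link ts w) x y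
LinkPath⇒Reach = EqClosure.fold (reach-isEquivalence _) (λ (mkLinkEdge l) → step here (inj₁ l))

FrontCorner : List (List (Fin m)) → Fin m → Fin m → Fin m → Set
FrontCorner FR w x y = Any (λ F → (x , w) ∈ cycleEdges F × (w , y) ∈ cycleEdges F) FR

LinkOrCorner : List (Tri m) → List (List (Fin m)) → Fin m → Fin m → Fin m → Set
LinkOrCorner TS FR w x y = LinkEdge TS w x y ⊎ FrontCorner FR w x y

frontEdges : List (List (Fin m)) → List (Fin m × Fin m)
frontEdges [] = []
frontEdges (F ∷ Fs) = cycleEdges F ++ frontEdges Fs

openEdges : List (Fin m) → List (List (Fin m)) → List (Fin m × Fin m)
openEdges A FR = cycleEdges A ++ frontEdges FR

Touches-in-edge : {FR : List (List (Fin m))} {F : List (Fin m)} → F ∈ FR → ∀ {x w} → (x , w) ∈ cycleEdges F → Touches (FrontCorner FR w) x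
Touches-in-edge {F = F} F∈ i = let (y , j) = out-edge F (cycleEdges-∈₂ F i) in y , inj₁ (Any.map (λ { refl → i , j }) F∈)

Touches-out-edge : {FR : List (List (Fin m))} {F : List (Fin m)} → F ∈ FR → ∀ {y w} → (w , y) ∈ cycleEdges F → Touches (FrontCorner FR w) y
Touches-out-edge {F = F} F∈ j = let (x , i) = in-edge F (cycleEdges-∈₁ F j) in x , inj₂ (Any.map (λ { refl → i , j }) F∈)

Touches-corner : {TS : List (Tri m)} {FR : List (List (Fin m))} {w x : Fin m} →
                 Touches (FrontCorner FR w) x → Touches (LinkOrCorner TS FR w) x
Touches-corner (y , r) = y , Sum.map inj₂ inj₂ r

LinkPath⇒LinkOrCorner : {TS : List (Tri m)} {FR : List (List (Fin m))} {w x y : Fin m} →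
                        EqClosure (LinkEdge TS w) x y → EqClosure (LinkOrCorner TS FR w) x y
LinkPath⇒LinkOrCorner = EqClosure.map inj₁

-- A partial triangulation grown from the cycle A.  Its open boundary consists of A and the fronts FR,
-- the cycles still to be filled; CR are the vertices created as apexes, whose links are connected
-- already, and k counts the splits, by which V - E + F has dropped.
record Stage (A VS : List (Fin m)) (ES : List (Fin m × Fin m)) (TS : List (Tri m))
             (FR : List (List (Fin m))) (CR : List (Fin m)) (k : ℕ) : Set where
  field
    verts-unique : Unique VS
    henneberg : Henneberg0 A (cycleEdges A) VS ES
    edge-endpoints : ∀ {x y} → (x , y) ∈ ES → x ∈ VS × y ∈ VS
    edge-no-loop : ∀ {x y} → (x , y) ∈ ES → x ≢ y
    edges-unique : Unique (map norm ES)
    tri-verts : ∀ {t w} → t ∈ TS → w ∈T t → w ∈ VS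
    tris-unique : Unique TS
    tris-canonical : All Canonical TS
    front-verts : ∀ {F w} → F ∈ FR → w ∈ F → w ∈ VS
    front-cycle : ∀ {F} → F ∈ FR → Unique F × 3 ≤ length F
    side-count : ∀ e → triCount e TS + countᵇ (sameEdge e) (openEdges A FR) ≡ 2 * countᵇ (sameEdge e) ES
    star-connected : ∀ w → Connected (LinkOrCorner TS FR w)
    apex-link : ∀ w → w ∈ CR → Connected (LinkEdge TS w) ×
                (∀ {x y} → FrontCorner FR w x y → Touches (LinkEdge TS w) x × Touches (LinkEdge TS w) y)
    reach : ∀ {x y} → x ∈ VS → y ∈ VS → Reach ES x y
    vert-on-edge : ∀ {w} → w ∈ VS → ∃ λ e → e ∈ ES × (proj₁ e ≡ w ⊎ proj₂ e ≡ w)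
    euler : length VS + length TS + k ≡ length ES
    apexes⊆verts : ∀ {w} → w ∈ CR → w ∈ VS

initialStage : (A : List (Fin m)) → Unique A → 3 ≤ length A → Stage A A (cycleEdges A) [] (A ∷ []) [] 0
initialStage A u l = record
  { verts-unique = u
  ; henneberg = base
  ; edge-endpoints = λ i → cycleEdges-∈₁ A i , cycleEdges-∈₂ A i
  ; edge-no-loop = λ i x≡y → cycleEdges-no-loop A u (ℕₚ.≤-trans (ℕₚ.n≤1+n 2) l) (subst (λ z → (z , _) ∈ cycleEdges A) x≡y i)
  ; edges-unique = unique-norm-cycleEdges A u l
  ; tri-verts = λ ()
  ; tris-unique = []
  ; tris-canonical = []
  ; front-verts = λ { (here refl) i → i }
  ; front-cycle = λ { (here refl) → u , l }
  ; side-count = λ e → trans (countᵇ-++ (sameEdge e) (cycleEdges A) _)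
                               (cong (countᵇ (sameEdge e) (cycleEdges A) +_) (countᵇ-++ (sameEdge e) (cycleEdges A) []))
  ; star-connected = λ w → Connected-single corner-unique
  ; apex-link = λ w ()
  ; reach = cycleEdges-reach A
  ; vert-on-edge = λ {w} i → let (y , j) = out-edge A i in (w , y) , j , inj₁ refl
  ; euler = trans (ℕₚ.+-identityʳ _) (trans (ℕₚ.+-identityʳ _) (sym (length-cycleEdges A)))
  ; apexes⊆verts = λ ()
  }
  where
  corner-unique : ∀ {w x y x' y'} → LinkOrCorner [] (A ∷ []) w x y → LinkOrCorner [] (A ∷ []) w x' y' → x ≡ x' × y ≡ y'
  corner-unique (inj₂ (here (i₁ , o₁))) (inj₂ (here (i₂ , o₂))) = in-edge-unique A u i₁ i₂ , out-edge-unique A u o₁ o₂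

-- Growing the triangulation: ears, splits and push-offs

reframe : {A VS : List (Fin m)} {ES : List (Fin m × Fin m)} {TS : List (Tri m)} {FR FR' : List (List (Fin m))} {CR : List (Fin m)} {k : ℕ} →
          Stage A VS ES TS FR CR k →
          (∀ {F w} → F ∈ FR' → w ∈ F → w ∈ VS) → (∀ {F} → F ∈ FR' → Unique F × 3 ≤ length F) → frontEdges FR ↭ frontEdges FR' →
          (∀ {w x y} → FrontCorner FR' w x y → FrontCorner FR w x y) → (∀ {w x y} → FrontCorner FR w x y → FrontCorner FR' w x y) →
          Stage A VS ES TS FR' CR k
reframe {A = A} {TS = TS} {FR} {FR'} stage front-verts front-cycle same-edges to from = record
  { verts-unique = S.verts-unique ; henneberg = S.henneberg ; edge-endpoints = S.edge-endpoints ; edge-no-loop = S.edge-no-loop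
  ; edges-unique = S.edges-unique ; tri-verts = S.tri-verts ; tris-unique = S.tris-unique ; tris-canonical = S.tris-canonical
  ; front-verts = front-verts ; front-cycle = front-cycle
  ; side-count = λ e → trans (cong (triCount e TS +_) (same-open-count e)) (S.side-count e)
  ; star-connected = λ w → Connected-resp (S.star-connected w) (Sum.map₂ to) (Sum.map₂ from)
  ; apex-link = λ w c → proj₁ (S.apex-link w c) , λ r → proj₂ (S.apex-link w c) (to r)
  ; reach = S.reach ; vert-on-edge = S.vert-on-edge ; euler = S.euler ; apexes⊆verts = S.apexes⊆verts
  }
  where
  module S = Stage stage
  same-open-count : ∀ e → countᵇ (sameEdge e) (openEdges A FR') ≡ countᵇ (sameEdge e) (openEdges A FR)
  same-open-count e = countᵇ-↭ (sameEdge e) (PermP.++⁺ˡ (cycleEdges A) (↭-sym same-edges))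

rotateFront : {A VS : List (Fin m)} {ES : List (Fin m × Fin m)} {TS : List (Tri m)} {Os : List (List (Fin m))} {CR : List (Fin m)} {k : ℕ}
              {x : Fin m} {xs : List (Fin m)} → Stage A VS ES TS ((x ∷ xs) ∷ Os) CR k → Stage A VS ES TS ((xs ∷ʳ x) ∷ Os) CR k
rotateFront {Os = Os} {x = x} {xs} stage = reframe stage
  (λ { (here refl) j → S.front-verts (here refl) (∈-resp-↭ (↭-sym (∷↭∷ʳ x xs)) j) ; (there G) j → S.front-verts (there G) j })
  (λ { (here refl) → unique-↭ (∷↭∷ʳ x xs) (proj₁ (S.front-cycle (here refl))) ,
                     subst (3 ≤_) (sym (length-∷ʳ xs x)) (proj₂ (S.front-cycle (here refl)))
     ; (there G) → S.front-cycle (there G) })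
  (PermP.++⁺ʳ (frontEdges Os) (↭-sym (cycleEdges-rotate x xs)))
  (λ { (here (i , o)) → here (∈-resp-↭ (cycleEdges-rotate x xs) i , ∈-resp-↭ (cycleEdges-rotate x xs) o) ; (there j) → there j })
  (λ { (here (i , o)) → here (∈-resp-↭ (↭-sym (cycleEdges-rotate x xs)) i , ∈-resp-↭ (↭-sym (cycleEdges-rotate x xs)) o) ; (there j) → there j })
  where module S = Stage stage

swapFronts : {A VS : List (Fin m)} {ES : List (Fin m × Fin m)} {TS : List (Tri m)} {Os : List (List (Fin m))} {CR : List (Fin m)} {k : ℕ}
             {F G : List (Fin m)} → Stage A VS ES TS (F ∷ G ∷ Os) CR k → Stage A VS ES TS (G ∷ F ∷ Os) CR k
swapFronts {F = F} {G} stage = reframe stage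
  (λ { (here refl) j → S.front-verts (there (here refl)) j ; (there (here refl)) j → S.front-verts (here refl) j
     ; (there (there H)) j → S.front-verts (there (there H)) j })
  (λ { (here refl) → S.front-cycle (there (here refl)) ; (there (here refl)) → S.front-cycle (here refl)
     ; (there (there H)) → S.front-cycle (there (there H)) })
  (PermP.shifts (cycleEdges F) (cycleEdges G))
  (λ { (here r) → there (here r) ; (there (here r)) → here r ; (there (there r)) → there (there r) })
  (λ { (here r) → there (here r) ; (there (here r)) → here r ; (there (there r)) → there (there r) })
  where module S = Stage stage

module NewVertex {A VS : List (Fin m)} {ES : List (Fin m × Fin m)} {TS : List (Tri m)} {FR : List (List (Fin m))} {CR : List (Fin m)} {k : ℕ}
                 (stage : Stage A VS ES TS FR CR k) (v w₁ w₂ w₃ : Fin m) (fresh : All (Fin._< v) VS)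
                 (w₁∈ : w₁ ∈ VS) (w₂∈ : w₂ ∈ VS) (w₃∈ : w₃ ∈ VS) (w₁≢w₂ : w₁ ≢ w₂) (w₁≢w₃ : w₁ ≢ w₃) (w₂≢w₃ : w₂ ≢ w₃) where
  private
    module S = Stage stage

  VS′ : List (Fin m)
  VS′ = v ∷ VS

  ES′ : List (Fin m × Fin m)
  ES′ = (w₁ , v) ∷ (w₂ , v) ∷ (w₃ , v) ∷ ES

  below-v : ∀ {w} → w ∈ VS → w Fin.< v
  below-v i = All.lookup fresh i

  v∉VS : v ∉ VS
  v∉VS i = FinP.<-irrefl refl (below-v i)

  ≢v : ∀ {w} → w ∈ VS → w ≢ v
  ≢v i w≡v = v∉VS (subst (_∈ VS) w≡v i)

  verts-unique′ : Unique VS′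
  verts-unique′ = unique-∷ v∉VS S.verts-unique

  henneberg′ : Henneberg0 A (cycleEdges A) VS′ ES′
  henneberg′ = ext v w₁ w₂ w₃ S.henneberg v∉VS w₁∈ w₂∈ w₃∈ w₁≢w₂ w₁≢w₃ w₂≢w₃

  edge-endpoints′ : ∀ {x y} → (x , y) ∈ ES′ → x ∈ VS′ × y ∈ VS′
  edge-endpoints′ (here refl) = there w₁∈ , here refl
  edge-endpoints′ (there (here refl)) = there w₂∈ , here refl
  edge-endpoints′ (there (there (here refl))) = there w₃∈ , here refl
  edge-endpoints′ (there (there (there i))) = Product.map there there (S.edge-endpoints i)

  edge-no-loop′ : ∀ {x y} → (x , y) ∈ ES′ → x ≢ y
  edge-no-loop′ (here refl) = ≢v w₁∈
  edge-no-loop′ (there (here refl)) = ≢v w₂∈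
  edge-no-loop′ (there (there (here refl))) = ≢v w₃∈
  edge-no-loop′ (there (there (there i))) = S.edge-no-loop i

  new-edge-fresh : ∀ {a} → norm (a , v) ∉ map norm ES
  new-edge-fresh k with MemP.∈-map⁻ norm k
  ... | _ , i , q with norm≡⇒SameEdge q
  ... | inj₁ refl = v∉VS (proj₂ (S.edge-endpoints i))
  ... | inj₂ refl = v∉VS (proj₁ (S.edge-endpoints i))

  new-edges-distinct : ∀ {a b} → a ≢ b → a ∈ VS → norm (a , v) ≢ norm (b , v)
  new-edges-distinct a≢b a∈ q with norm≡⇒SameEdge q
  ... | inj₁ e = a≢b (cong proj₁ e)
  ... | inj₂ e = ≢v a∈ (cong proj₁ e)

  edges-unique′ : Unique (map norm ES′)
  edges-unique′ =
    unique-∷ (λ { (here q) → new-edges-distinct w₁≢w₂ w₁∈ q ; (there (here q)) → new-edges-distinct w₁≢w₃ w₁∈ q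
                ; (there (there k)) → new-edge-fresh k })
    (unique-∷ (λ { (here q) → new-edges-distinct w₂≢w₃ w₂∈ q ; (there k) → new-edge-fresh k })
    (unique-∷ new-edge-fresh S.edges-unique))

  reach′ : ∀ {x y} → x ∈ VS′ → y ∈ VS′ → Reach ES′ x y
  reach′ (here refl) (here refl) = here
  reach′ (here refl) (there j) = reach-sym (reach-v j)
    where
    reach-v : ∀ {x} → x ∈ VS → Reach ES′ x v
    reach-v i = step (reach-mono (there ∘ there ∘ there) (S.reach i w₁∈)) (inj₁ (here refl))
  reach′ (there i) (here refl) = step (reach-mono (there ∘ there ∘ there) (S.reach i w₁∈)) (inj₁ (here refl))
  reach′ (there i) (there j) = reach-mono (there ∘ there ∘ there) (S.reach i j)

  vert-on-edge′ : ∀ {w} → w ∈ VS′ → ∃ λ e → e ∈ ES′ × (proj₁ e ≡ w ⊎ proj₂ e ≡ w)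
  vert-on-edge′ (here refl) = (w₁ , v) , here refl , inj₂ refl
  vert-on-edge′ (there i) = let (e , j , on) = S.vert-on-edge i in e , there (there (there j)) , on

  new-tri-fresh : ∀ {a b} → tri a b v ∉ TS
  new-tri-fresh i = v∉VS (S.tri-verts i (inj₂ (inj₂ refl)))

  new-tri-canonical : ∀ {a b} → a ∈ VS → b ∈ VS → a ≢ b → Canonical (tri a b v)
  new-tri-canonical {a} {b} a∈ b∈ a≢b = tri-canonical a b v a≢b (below-v a∈) (below-v b∈)

  new-tri-verts : ∀ {a b w} → a ∈ VS → b ∈ VS → w ∈T tri a b v → w ∈ VS′
  new-tri-verts {a} {b} a∈ b∈ h =
    Sum.[ (λ { refl → there a∈ }) , Sum.[ (λ { refl → there b∈ }) , (λ { refl → here refl }) ] ] (∈T-tri {w₁ = a} {b} h)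

ear-count-arith : (T a o c s₁₂ s₂₃ s₁ s₂ s₃ : ℕ) →
                  ((s₁₂ + s₁ + s₂) + ((s₂₃ + s₂ + s₃) + T)) + (a + ((s₁ + (s₃ + c)) + o)) ≡
                  (T + (a + ((s₁₂ + (s₂₃ + c)) + o))) + 2 * (s₁ + (s₂ + s₃))
ear-count-arith = solve-∀

ear-double-arith : (a b c E : ℕ) → 2 * E + 2 * (a + (b + c)) ≡ 2 * (a + (b + (c + E)))
ear-double-arith = solve-∀

ear-euler-arith : (a b k : ℕ) → suc a + suc (suc b) + k ≡ 3 + (a + b + k)
ear-euler-arith = solve-∀

-- The ear over the corner w₂ of the first front w₁ w₂ w₃ R glues on the triangles w₁w₂v and w₂w₃v;
-- v takes the place of w₂ on the front.
module Ear {A VS : List (Fin m)} {ES : List (Fin m × Fin m)} {TS : List (Tri m)} {Os : List (List (Fin m))} {CR : List (Fin m)} {k : ℕ}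
           {w₁ w₂ w₃ : Fin m} {R : List (Fin m)} (v : Fin m)
           (stage : Stage A VS ES TS ((w₁ ∷ w₂ ∷ w₃ ∷ R) ∷ Os) CR k) (fresh : All (Fin._< v) VS) where
  private
    module S = Stage stage

  F F′ : List (Fin m)
  F = w₁ ∷ w₂ ∷ w₃ ∷ R
  F′ = w₁ ∷ v ∷ w₃ ∷ R

  FR FR′ : List (List (Fin m))
  FR = F ∷ Os
  FR′ = F′ ∷ Os

  t₁ t₂ : Tri m
  t₁ = tri w₁ w₂ v
  t₂ = tri w₂ w₃ v

  TS′ : List (Tri m)
  TS′ = t₁ ∷ t₂ ∷ TS

  tailEdges : List (Fin m × Fin m)
  tailEdges = zip (w₃ ∷ R) (R ∷ʳ w₁)

  F-unique : Unique F
  F-unique = proj₁ (S.front-cycle (here refl))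

  F⊆VS : ∀ {w} → w ∈ F → w ∈ VS
  F⊆VS = S.front-verts (here refl)

  w₁∈ : w₁ ∈ VS
  w₁∈ = F⊆VS (here refl)
  w₂∈ : w₂ ∈ VS
  w₂∈ = F⊆VS (there (here refl))
  w₃∈ : w₃ ∈ VS
  w₃∈ = F⊆VS (there (there (here refl)))

  w₁≢w₂ : w₁ ≢ w₂
  w₁≢w₂ e = Unique[x∷xs]⇒x∉xs F-unique (here e)
  w₁≢w₃ : w₁ ≢ w₃
  w₁≢w₃ e = Unique[x∷xs]⇒x∉xs F-unique (there (here e))
  w₂≢w₃ : w₂ ≢ w₃
  w₂≢w₃ e = Unique[x∷xs]⇒x∉xs (AllPairs.tail F-unique) (here e)

  open NewVertex stage v w₁ w₂ w₃ fresh w₁∈ w₂∈ w₃∈ w₁≢w₂ w₁≢w₃ w₂≢w₃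

  D₁ : Distinct3 w₁ w₂ v
  D₁ = w₁≢w₂ , ≢v w₁∈ , ≢v w₂∈
  D₂ : Distinct3 w₂ w₃ v
  D₂ = w₂≢w₃ , ≢v w₂∈ , ≢v w₃∈

  tailEdges-∈₁ : ∀ {a b} → (a , b) ∈ tailEdges → a ∈ w₃ ∷ R
  tailEdges-∈₁ i = pathEdges-∈₁-init (w₃ ∷ R) w₁ (subst (_ ∈_) (zip-∷ʳ≡pathEdges w₃ R w₁) i)
  tailEdges-∈₂ : ∀ {a b} → (a , b) ∈ tailEdges → b ∈ R ∷ʳ w₁
  tailEdges-∈₂ i = pathEdges-∈₂-tail w₃ (R ∷ʳ w₁) (subst (_ ∈_) (zip-∷ʳ≡pathEdges w₃ R w₁) i)

  w₂∉tail₁ : w₂ ∉ w₃ ∷ R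
  w₂∉tail₁ = Unique[x∷xs]⇒x∉xs (AllPairs.tail F-unique)
  w₂∉tail₂ : w₂ ∉ R ∷ʳ w₁
  w₂∉tail₂ i with ∈-++⁻ R i
  ... | inj₁ j = w₂∉tail₁ (there j)
  ... | inj₂ (here e) = w₁≢w₂ (sym e)
  v∉tail₁ : v ∉ w₃ ∷ R
  v∉tail₁ i = v∉VS (F⊆VS (there (there i)))
  v∉tail₂ : v ∉ R ∷ʳ w₁
  v∉tail₂ i with ∈-++⁻ R i
  ... | inj₁ j = v∉VS (F⊆VS (there (there (there j))))
  ... | inj₂ (here e) = v∉VS (subst (_∈ VS) (sym e) w₁∈)

  t₁-at-v : Opposite v t₁ w₁ w₂
  t₁-at-v = Opposite-tri-apex w₁ w₂ v D₁
  t₁-at-w₁ : Opposite w₁ t₁ w₂ v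
  t₁-at-w₁ = Opposite-tri₁ w₁ w₂ v D₁
  t₁-at-w₂ : Opposite w₂ t₁ w₁ v
  t₁-at-w₂ = Opposite-tri₂ w₁ w₂ v D₁
  t₂-at-v : Opposite v t₂ w₂ w₃
  t₂-at-v = Opposite-tri-apex w₂ w₃ v D₂
  t₂-at-w₂ : Opposite w₂ t₂ w₃ v
  t₂-at-w₂ = Opposite-tri₁ w₂ w₃ v D₂
  t₂-at-w₃ : Opposite w₃ t₂ w₂ v
  t₂-at-w₃ = Opposite-tri₂ w₂ w₃ v D₂

  t₁∈ : t₁ ∈ TS′
  t₁∈ = here refl
  t₂∈ : t₂ ∈ TS′
  t₂∈ = there (here refl)

  corner-w₁ : ∃ λ p → FrontCorner FR w₁ p w₂
  corner-w₁ = let (p , i) = in-edge F (here refl) in p , here (i , here refl)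
  corner-w₂ : FrontCorner FR w₂ w₁ w₃
  corner-w₂ = here (here refl , there (here refl))
  corner-w₃ : ∃ λ h → FrontCorner FR w₃ w₂ h
  corner-w₃ = let (h , o) = out-edge F (there (there (here refl))) in h , here (there (here refl) , o)

  -- The new triangles cover w₁w₂ and w₂w₃, which leave the front, once and w₂v twice; they cover w₁v
  -- and w₃v once, and these join the front.
  side-count′ : ∀ e → triCount e TS′ + countᵇ (sameEdge e) (openEdges A FR′) ≡ 2 * countᵇ (sameEdge e) ES′
  side-count′ e = begin
      triCount e TS′ + countᵇ se (openEdges A FR′)
        ≡⟨ cong₂ _+_ (cong₂ _+_ (indicator-triEdges-tri e w₁ w₂ v D₁) (cong (_+ Tc) (indicator-triEdges-tri e w₂ w₃ v D₂)))
                     (trans (countᵇ-++ se (cycleEdges A) _) (cong (cA +_) (countᵇ-++ se (cycleEdges F′) (frontEdges Os)))) ⟩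
      (s12 + s1v + s2v) + ((s23 + s2v + s3v) + Tc) + (cA + ((s1v + (indicator (se (v , w₃)) + cT)) + cO))
        ≡⟨ cong (λ z → (s12 + s1v + s2v) + ((s23 + s2v + s3v) + Tc) + (cA + ((s1v + (indicator z + cT)) + cO))) (sameEdge-swapʳ e (w₃ , v)) ⟩
      (s12 + s1v + s2v) + ((s23 + s2v + s3v) + Tc) + (cA + ((s1v + (s3v + cT)) + cO))
        ≡⟨ ear-count-arith Tc cA cO cT s12 s23 s1v s2v s3v ⟩
      (Tc + (cA + ((s12 + (s23 + cT)) + cO))) + 2 * (s1v + (s2v + s3v))
        ≡⟨ cong (_+ 2 * (s1v + (s2v + s3v)))
             (trans (cong (Tc +_) (sym (trans (countᵇ-++ se (cycleEdges A) _) (cong (cA +_) (countᵇ-++ se (cycleEdges F) (frontEdges Os))))))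
                    (S.side-count e)) ⟩
      2 * countᵇ se ES + 2 * (s1v + (s2v + s3v))
        ≡⟨ ear-double-arith s1v s2v s3v (countᵇ se ES) ⟩
      2 * countᵇ se ES′ ∎
    where
    open ≡-Reasoning
    se = sameEdge e
    cA = countᵇ se (cycleEdges A)
    cO = countᵇ se (frontEdges Os)
    cT = countᵇ se tailEdges
    Tc = triCount e TS
    s12 = δ e (w₁ , w₂)
    s23 = δ e (w₂ , w₃)
    s1v = δ e (w₁ , v)
    s2v = δ e (w₂ , v)
    s3v = δ e (w₃ , v)

  link-weaken : ∀ {w x y} → LinkEdge TS w x y → LinkEdge TS′ w x y
  link-weaken {w} l = LinkEdge-∷ʳ t₁ _ w (LinkEdge-∷ʳ t₂ TS w l)

  opposite-path : ∀ {t w x y} → t ∈ TS′ → Opposite w t x y → EqClosure (LinkOrCorner TS′ FR′ w) x y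
  opposite-path i o = LinkPath⇒LinkOrCorner (Opposite⇒LinkPath i o)

  old-corner-path : ∀ {w x y} → FrontCorner FR w x y → EqClosure (LinkOrCorner TS′ FR′ w) x y
  old-corner-path (there j) = fwd (inj₂ (there j)) ◅ ε
  old-corner-path (here (here refl , here e)) = ⊥-elim (w₁≢w₂ (sym (cong proj₁ e)))
  old-corner-path (here (here refl , there (here refl))) = opposite-path t₁∈ t₁-at-w₂ ◅◅ opposite-path t₂∈ (Opposite-sym t₂-at-w₂)
  old-corner-path (here (here refl , there (there o))) = ⊥-elim (w₂∉tail₁ (tailEdges-∈₁ o))
  old-corner-path (here (there (here refl) , here e)) = ⊥-elim (w₁≢w₃ (sym (cong proj₁ e)))
  old-corner-path (here (there (here refl) , there (here e))) = ⊥-elim (w₂≢w₃ (sym (cong proj₁ e)))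
  old-corner-path (here (there (here refl) , there (there o))) = opposite-path t₂∈ t₂-at-w₃ ◅◅ fwd (inj₂ (here (there (here refl) , there (there o)))) ◅ ε
  old-corner-path (here (there (there i) , here refl)) = fwd (inj₂ (here (there (there i) , here refl))) ◅ opposite-path t₁∈ (Opposite-sym t₁-at-w₁)
  old-corner-path (here (there (there i) , there (here refl))) = ⊥-elim (w₂∉tail₂ (tailEdges-∈₂ i))
  old-corner-path (here (there (there i) , there (there o))) = fwd (inj₂ (here (there (there i) , there (there o)))) ◅ ε

  new-link-edge : ∀ {w x y} → LinkEdge TS′ w x y → w ≢ v →
                  LinkEdge TS w x y ⊎ (w ≡ w₁ × SameEdge (x , y) (w₂ , v)) ⊎ (w ≡ w₂ × SameEdge (x , y) (w₁ , v)) ⊎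
                  (w ≡ w₂ × SameEdge (x , y) (w₃ , v)) ⊎ (w ≡ w₃ × SameEdge (x , y) (w₂ , v))
  new-link-edge {w} {x} {y} l n with LinkEdge-∷ t₁ (t₂ ∷ TS) w l
  ... | inj₁ e with Opposite-tri w₁ w₂ v w x y (mkOpposite (inj₁ e))
  ... | inj₁ (p , _) = ⊥-elim (n p)
  ... | inj₂ (inj₁ (p , q)) = inj₂ (inj₁ (p , q))
  ... | inj₂ (inj₂ (p , q)) = inj₂ (inj₂ (inj₁ (p , q)))
  new-link-edge {w} {x} {y} l n | inj₂ l2 with LinkEdge-∷ t₂ TS w l2
  ... | inj₂ l3 = inj₁ l3
  ... | inj₁ e with Opposite-tri w₂ w₃ v w x y (mkOpposite (inj₁ e))
  ... | inj₁ (p , _) = ⊥-elim (n p)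
  ... | inj₂ (inj₁ (p , q)) = inj₂ (inj₂ (inj₂ (inj₁ (p , q))))
  ... | inj₂ (inj₂ (p , q)) = inj₂ (inj₂ (inj₂ (inj₂ (p , q))))

  star-at-v : ∀ {x y} → LinkOrCorner TS′ FR′ v x y → SameEdge (x , y) (w₁ , w₂) ⊎ SameEdge (x , y) (w₂ , w₃) ⊎ (x ≡ w₁ × y ≡ w₃)
  star-at-v {x} {y} (inj₁ l) with LinkEdge-∷ t₁ (t₂ ∷ TS) v l
  ... | inj₁ e with Opposite-tri w₁ w₂ v v x y (mkOpposite (inj₁ e))
  ... | inj₁ (_ , q) = inj₁ q
  ... | inj₂ (inj₁ (p , _)) = ⊥-elim (≢v w₁∈ (sym p))
  ... | inj₂ (inj₂ (p , _)) = ⊥-elim (≢v w₂∈ (sym p))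
  star-at-v {x} {y} (inj₁ l) | inj₂ l2 with LinkEdge-∷ t₂ TS v l2
  ... | inj₁ e with Opposite-tri w₂ w₃ v v x y (mkOpposite (inj₁ e))
  ... | inj₁ (_ , q) = inj₂ (inj₁ q)
  ... | inj₂ (inj₁ (p , _)) = ⊥-elim (≢v w₂∈ (sym p))
  ... | inj₂ (inj₂ (p , _)) = ⊥-elim (≢v w₃∈ (sym p))
  star-at-v {x} {y} (inj₁ l) | inj₂ l2 | inj₂ l3 = let (t , i , e) = LinkEdge⇒opp TS v l3 in ⊥-elim (v∉VS (S.tri-verts i (opp⇒∈T v t e)))
  star-at-v (inj₂ (there j)) = let (G , Gi , (i , o)) = find j in ⊥-elim (v∉VS (S.front-verts (there Gi) (cycleEdges-∈₂ G i)))
  star-at-v (inj₂ (here (here refl , here e))) = ⊥-elim (≢v w₁∈ (sym (cong proj₁ e)))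
  star-at-v (inj₂ (here (here refl , there (here refl)))) = inj₂ (inj₂ (refl , refl))
  star-at-v (inj₂ (here (here refl , there (there o)))) = ⊥-elim (v∉tail₁ (tailEdges-∈₁ o))
  star-at-v (inj₂ (here (there (here e) , _))) = ⊥-elim (≢v w₃∈ (sym (cong proj₂ e)))
  star-at-v (inj₂ (here (there (there i) , _))) = ⊥-elim (v∉tail₂ (tailEdges-∈₂ i))

  -- An edge of the new star of w ≠ v is old or has v as an end; then some vertex touching the old star
  -- is joined to v inside the new star, so the old star's connectedness carries over.
  new-star-edge : ∀ {w x y} → w ≢ v → LinkOrCorner TS′ FR′ w x y → LinkOrCorner TS FR w x y ⊎
                  (∃ λ a → Touches (LinkOrCorner TS FR w) a × EqClosure (LinkOrCorner TS′ FR′ w) a v ×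
                     (SameEdge (x , y) (a , v) ⊎ (x ≡ v × Touches (LinkOrCorner TS FR w) y) ⊎ (y ≡ v × Touches (LinkOrCorner TS FR w) x)))
  new-star-edge n (inj₁ l) with new-link-edge l n
  ... | inj₁ l0 = inj₁ (inj₁ l0)
  ... | inj₂ (inj₁ (refl , q)) = let (p , f) = corner-w₁ in inj₂ (w₂ , (p , inj₂ (inj₂ f)) , opposite-path t₁∈ t₁-at-w₁ , inj₁ q)
  ... | inj₂ (inj₂ (inj₁ (refl , q))) = inj₂ (w₁ , (w₃ , inj₁ (inj₂ corner-w₂)) , opposite-path t₁∈ t₁-at-w₂ , inj₁ q)
  ... | inj₂ (inj₂ (inj₂ (inj₁ (refl , q)))) = inj₂ (w₃ , (w₁ , inj₂ (inj₂ corner-w₂)) , opposite-path t₂∈ t₂-at-w₂ , inj₁ q)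
  ... | inj₂ (inj₂ (inj₂ (inj₂ (refl , q)))) = let (h , f) = corner-w₃ in inj₂ (w₂ , (h , inj₁ (inj₂ f)) , opposite-path t₂∈ t₂-at-w₃ , inj₁ q)
  new-star-edge n (inj₂ (there j)) = inj₁ (inj₂ (there j))
  new-star-edge n (inj₂ (here (here refl , _))) = ⊥-elim (n refl)
  new-star-edge n (inj₂ (here (there (here refl) , there (here e)))) = ⊥-elim (n (cong proj₁ e))
  new-star-edge n (inj₂ (here (there (here refl) , here e))) = ⊥-elim (w₁≢w₃ (sym (cong proj₁ e)))
  new-star-edge n (inj₂ (here (there (here refl) , there (there o)))) = let (h , f) = corner-w₃ in
     inj₂ (w₂ , (h , inj₁ (inj₂ f)) , opposite-path t₂∈ t₂-at-w₃ , inj₂ (inj₁ (refl , Touches-corner (Touches-out-edge (here refl) (there (there o))))))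
  new-star-edge n (inj₂ (here (there (there i) , here refl))) = let (p , f) = corner-w₁ in
     inj₂ (w₂ , (p , inj₂ (inj₂ f)) , opposite-path t₁∈ t₁-at-w₁ , inj₂ (inj₂ (refl , Touches-corner (Touches-in-edge (here refl) (there (there i))))))
  new-star-edge n (inj₂ (here (there (there i) , there (here e)))) = ⊥-elim (n (cong proj₁ e))
  new-star-edge n (inj₂ (here (there (there i) , there (there o)))) = inj₁ (inj₂ (here (there (there i) , there (there o))))

  anchor₁ : ∀ {w x y} → w ≢ v → LinkOrCorner TS′ FR′ w x y → ∃ λ z → Touches (LinkOrCorner TS FR w) z × EqClosure (LinkOrCorner TS′ FR′ w) z x
  anchor₁ {x = x} {y} n r with new-star-edge n r
  ... | inj₁ r0 = x , (y , inj₁ r0) , ε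
  ... | inj₂ (a , va , p , inj₁ q) with SameEdge-∈₁ q
  ... | inj₁ refl = a , va , ε
  ... | inj₂ refl = a , va , p
  anchor₁ n r | inj₂ (a , va , p , inj₂ (inj₁ (refl , vy))) = a , va , p
  anchor₁ {x = x} n r | inj₂ (a , va , p , inj₂ (inj₂ (refl , vx))) = x , vx , ε

  anchor₂ : ∀ {w x y} → w ≢ v → LinkOrCorner TS′ FR′ w x y → ∃ λ z → Touches (LinkOrCorner TS FR w) z × EqClosure (LinkOrCorner TS′ FR′ w) z y
  anchor₂ {x = x} {y} n r with new-star-edge n r
  ... | inj₁ r0 = y , (x , inj₂ r0) , ε
  ... | inj₂ (a , va , p , inj₁ q) with SameEdge-∈₂ q
  ... | inj₁ refl = a , va , ε
  ... | inj₂ refl = a , va , p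
  anchor₂ {y = y} n r | inj₂ (a , va , p , inj₂ (inj₁ (refl , vy))) = y , vy , ε
  anchor₂ n r | inj₂ (a , va , p , inj₂ (inj₂ (refl , vx))) = a , va , p

  from-w₂ : ∀ {x} → x ≡ w₁ ⊎ x ≡ w₂ ⊎ x ≡ w₃ → EqClosure (LinkEdge TS′ v) w₂ x
  from-w₂ (inj₁ refl) = Opposite⇒LinkPath t₁∈ (Opposite-sym t₁-at-v)
  from-w₂ (inj₂ (inj₁ refl)) = ε
  from-w₂ (inj₂ (inj₂ refl)) = Opposite⇒LinkPath t₂∈ t₂-at-v

  touches-v : ∀ {x} → x ≡ w₁ ⊎ x ≡ w₂ ⊎ x ≡ w₃ → Touches (LinkEdge TS′ v) x
  touches-v (inj₁ refl) = Opposite⇒Touches₁ t₁∈ t₁-at-v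
  touches-v (inj₂ (inj₁ refl)) = Opposite⇒Touches₂ t₁∈ t₁-at-v
  touches-v (inj₂ (inj₂ refl)) = Opposite⇒Touches₂ t₂∈ t₂-at-v

  star-at-v₁ : ∀ {x y} → SameEdge (x , y) (w₁ , w₂) ⊎ SameEdge (x , y) (w₂ , w₃) ⊎ (x ≡ w₁ × y ≡ w₃) → x ≡ w₁ ⊎ x ≡ w₂ ⊎ x ≡ w₃
  star-at-v₁ (inj₁ q) with SameEdge-∈₁ q
  ... | inj₁ e = inj₁ e
  ... | inj₂ e = inj₂ (inj₁ e)
  star-at-v₁ (inj₂ (inj₁ q)) with SameEdge-∈₁ q
  ... | inj₁ e = inj₂ (inj₁ e)
  ... | inj₂ e = inj₂ (inj₂ e)
  star-at-v₁ (inj₂ (inj₂ (e , _))) = inj₁ e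

  star-at-v₂ : ∀ {x y} → SameEdge (x , y) (w₁ , w₂) ⊎ SameEdge (x , y) (w₂ , w₃) ⊎ (x ≡ w₁ × y ≡ w₃) → y ≡ w₁ ⊎ y ≡ w₂ ⊎ y ≡ w₃
  star-at-v₂ (inj₁ q) with SameEdge-∈₂ q
  ... | inj₁ e = inj₁ e
  ... | inj₂ e = inj₂ (inj₁ e)
  star-at-v₂ (inj₂ (inj₁ q)) with SameEdge-∈₂ q
  ... | inj₁ e = inj₂ (inj₁ e)
  ... | inj₂ e = inj₂ (inj₂ e)
  star-at-v₂ (inj₂ (inj₂ (_ , e))) = inj₂ (inj₂ e)

  star-connected′ : ∀ w → Connected (LinkOrCorner TS′ FR′ w)
  star-connected′ w with w FinP.≟ v
  ... | yes refl = Connected-hub w₂ from-hub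
    where
    from-hub : ∀ {x} → Touches (LinkOrCorner TS′ FR′ v) x → EqClosure (LinkOrCorner TS′ FR′ v) w₂ x
    from-hub (y , inj₁ r) = LinkPath⇒LinkOrCorner (from-w₂ (star-at-v₁ (star-at-v r)))
    from-hub (y , inj₂ r) = LinkPath⇒LinkOrCorner (from-w₂ (star-at-v₂ (star-at-v r)))
  ... | no n = Connected-transfer (S.star-connected w) old-step old-anchor
    where
    old-step : ∀ {x y} → LinkOrCorner TS FR w x y → EqClosure (LinkOrCorner TS′ FR′ w) x y
    old-step (inj₁ l) = fwd (inj₁ (link-weaken l)) ◅ ε
    old-step (inj₂ f) = old-corner-path f
    old-anchor : ∀ {x} → Touches (LinkOrCorner TS′ FR′ w) x → ∃ λ z → Touches (LinkOrCorner TS FR w) z × EqClosure (LinkOrCorner TS′ FR′ w) z x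
    old-anchor (y , inj₁ r) = anchor₁ n r
    old-anchor (y , inj₂ r) = anchor₂ n r

  apex-link-v : Connected (LinkEdge TS′ v) × (∀ {x y} → FrontCorner FR′ v x y → Touches (LinkEdge TS′ v) x × Touches (LinkEdge TS′ v) y)
  apex-link-v = Connected-hub w₂ from-hub , λ f → touches-v (star-at-v₁ (star-at-v (inj₂ f))) , touches-v (star-at-v₂ (star-at-v (inj₂ f)))
    where
    from-hub : ∀ {x} → Touches (LinkEdge TS′ v) x → EqClosure (LinkEdge TS′ v) w₂ x
    from-hub (y , inj₁ r) = from-w₂ (star-at-v₁ (star-at-v (inj₁ r)))
    from-hub (y , inj₂ r) = from-w₂ (star-at-v₂ (star-at-v (inj₁ r)))

  module OldApex {w : Fin m} (w∈CR : w ∈ CR) where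
    w≢v : w ≢ v
    w≢v e = v∉VS (subst (_∈ VS) e (S.apexes⊆verts w∈CR))

    old-corners : ∀ {x y} → FrontCorner FR w x y → Touches (LinkEdge TS w) x × Touches (LinkEdge TS w) y
    old-corners = proj₂ (S.apex-link w w∈CR)

    touches-weaken : ∀ {x} → Touches (LinkEdge TS w) x → Touches (LinkEdge TS′ w) x
    touches-weaken = Touches-map {R = LinkEdge TS w} {R' = LinkEdge TS′ w} link-weaken

    new-link-edge′ : ∀ {x y} → LinkEdge TS′ w x y →
                     LinkEdge TS w x y ⊎ (∃ λ a → Touches (LinkEdge TS w) a × EqClosure (LinkEdge TS′ w) a v × SameEdge (x , y) (a , v))
    new-link-edge′ l with new-link-edge l w≢v
    ... | inj₁ l₀ = inj₁ l₀
    ... | inj₂ (inj₁ (refl , q)) = inj₂ (w₂ , proj₂ (old-corners (proj₂ corner-w₁)) , Opposite⇒LinkPath t₁∈ t₁-at-w₁ , q)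
    ... | inj₂ (inj₂ (inj₁ (refl , q))) = inj₂ (w₁ , proj₁ (old-corners corner-w₂) , Opposite⇒LinkPath t₁∈ t₁-at-w₂ , q)
    ... | inj₂ (inj₂ (inj₂ (inj₁ (refl , q)))) = inj₂ (w₃ , proj₂ (old-corners corner-w₂) , Opposite⇒LinkPath t₂∈ t₂-at-w₂ , q)
    ... | inj₂ (inj₂ (inj₂ (inj₂ (refl , q)))) = inj₂ (w₂ , proj₁ (old-corners (proj₂ corner-w₃)) , Opposite⇒LinkPath t₂∈ t₂-at-w₃ , q)

    anchor : ∀ {x} → Touches (LinkEdge TS′ w) x → ∃ λ z → Touches (LinkEdge TS w) z × EqClosure (LinkEdge TS′ w) z x
    anchor {x} (y , inj₁ r) with new-link-edge′ r
    ... | inj₁ l₀ = x , (y , inj₁ l₀) , ε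
    ... | inj₂ (a , ta , p , q) with SameEdge-∈₁ q
    ...   | inj₁ refl = a , ta , ε
    ...   | inj₂ refl = a , ta , p
    anchor {x} (y , inj₂ r) with new-link-edge′ r
    ... | inj₁ l₀ = x , (y , inj₂ l₀) , ε
    ... | inj₂ (a , ta , p , q) with SameEdge-∈₂ q
    ...   | inj₁ refl = a , ta , ε
    ...   | inj₂ refl = a , ta , p

    link′ : Connected (LinkEdge TS′ w)
    link′ = Connected-transfer (proj₁ (S.apex-link w w∈CR)) (LinkEdge-mono (there ∘ there)) anchor

    corner-in : ∀ {x y} → (x , w) ∈ cycleEdges F′ → (w , y) ∈ cycleEdges F′ → Touches (LinkEdge TS′ w) x
    corner-in (here refl) _ = ⊥-elim (w≢v refl)
    corner-in (there (here refl)) _ = Opposite⇒Touches₂ t₂∈ t₂-at-w₃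
    corner-in (there (there j)) _ =
      let (_ , o) = out-edge F (cycleEdges-∈₂ F (there (there j))) in touches-weaken (proj₁ (old-corners (here (there (there j) , o))))

    corner-out : ∀ {x y} → (x , w) ∈ cycleEdges F′ → (w , y) ∈ cycleEdges F′ → Touches (LinkEdge TS′ w) y
    corner-out _ (here refl) = Opposite⇒Touches₂ t₁∈ t₁-at-w₁
    corner-out _ (there (here refl)) = ⊥-elim (w≢v refl)
    corner-out _ (there (there j)) =
      let (_ , i) = in-edge F (cycleEdges-∈₁ F (there (there j))) in touches-weaken (proj₂ (old-corners (here (i , there (there j)))))

    corners′ : ∀ {x y} → FrontCorner FR′ w x y → Touches (LinkEdge TS′ w) x × Touches (LinkEdge TS′ w) y
    corners′ (here (i , o)) = corner-in i o , corner-out i o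
    corners′ (there j) = Product.map touches-weaken touches-weaken (old-corners (there j))

  apex-link′ : ∀ w → w ∈ v ∷ CR → Connected (LinkEdge TS′ w) ×
               (∀ {x y} → FrontCorner FR′ w x y → Touches (LinkEdge TS′ w) x × Touches (LinkEdge TS′ w) y)
  apex-link′ w (here refl) = apex-link-v
  apex-link′ w (there c) = OldApex.link′ c , OldApex.corners′ c

  tris-unique′ : Unique TS′
  tris-unique′ = unique-∷ (λ { (here e) → w₁∉t₂ (subst (w₁ ∈T_) e (∈T-tri₁ w₁ w₂ v)) ; (there i) → new-tri-fresh {w₁} {w₂} i })
                          (unique-∷ (new-tri-fresh {w₂} {w₃}) S.tris-unique)
    where
    w₁∉t₂ : w₁ ∈T t₂ → ⊥
    w₁∉t₂ h with ∈T-tri h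
    ... | inj₁ e = w₁≢w₂ e
    ... | inj₂ (inj₁ e) = w₁≢w₃ e
    ... | inj₂ (inj₂ e) = ≢v w₁∈ e

  F′-unique : Unique F′
  F′-unique = unique-∷ (λ { (here e) → ≢v w₁∈ e ; (there j) → Unique[x∷xs]⇒x∉xs F-unique (there j) })
                (unique-∷ v∉tail₁ (AllPairs.tail (AllPairs.tail F-unique)))

  tri-verts′ : ∀ {t w} → t ∈ TS′ → w ∈T t → w ∈ VS′
  tri-verts′ (here refl) = new-tri-verts w₁∈ w₂∈
  tri-verts′ (there (here refl)) = new-tri-verts w₂∈ w₃∈
  tri-verts′ (there (there i)) h = there (S.tri-verts i h)

  front-verts′ : ∀ {G w} → G ∈ FR′ → w ∈ G → w ∈ VS′
  front-verts′ (here refl) (here refl) = there w₁∈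
  front-verts′ (here refl) (there (here refl)) = here refl
  front-verts′ (here refl) (there (there j)) = there (F⊆VS (there (there j)))
  front-verts′ (there G∈) j = there (S.front-verts (there G∈) j)

  stage′ : Stage A VS′ ES′ TS′ FR′ (v ∷ CR) k
  stage′ = record
    { verts-unique = verts-unique′
    ; henneberg = henneberg′
    ; edge-endpoints = edge-endpoints′
    ; edge-no-loop = edge-no-loop′
    ; edges-unique = edges-unique′
    ; tri-verts = tri-verts′
    ; tris-unique = tris-unique′
    ; tris-canonical = new-tri-canonical w₁∈ w₂∈ w₁≢w₂ ∷ new-tri-canonical w₂∈ w₃∈ w₂≢w₃ ∷ S.tris-canonical
    ; front-verts = front-verts′
    ; front-cycle = λ { (here refl) → F′-unique , proj₂ (S.front-cycle (here refl)) ; (there j) → S.front-cycle (there j) }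
    ; side-count = side-count′
    ; star-connected = star-connected′
    ; apex-link = apex-link′
    ; reach = reach′
    ; vert-on-edge = vert-on-edge′
    ; euler = trans (ear-euler-arith (length VS) (length TS) k) (cong (3 +_) S.euler)
    ; apexes⊆verts = λ { (here refl) → here refl ; (there c) → there (S.apexes⊆verts c) }
    }

ear : {A VS : List (Fin m)} {ES : List (Fin m × Fin m)} {TS : List (Tri m)} {Os : List (List (Fin m))} {CR : List (Fin m)} {k : ℕ}
      {w₁ w₂ w₃ : Fin m} {R : List (Fin m)} (v : Fin m) →
      Stage A VS ES TS ((w₁ ∷ w₂ ∷ w₃ ∷ R) ∷ Os) CR k → All (Fin._< v) VS →
      Stage A (v ∷ VS) ((w₁ , v) ∷ (w₂ , v) ∷ (w₃ , v) ∷ ES) (tri w₁ w₂ v ∷ tri w₂ w₃ v ∷ TS) ((w₁ ∷ v ∷ w₃ ∷ R) ∷ Os) (v ∷ CR) k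
ear v stage fresh = Ear.stage′ v stage fresh

split-count-arith : (s₀₁ s₀ s₁ sⱼ T a c₁ c₂ o : ℕ) →
  (s₀₁ + s₀ + s₁) + T + (a + ((s₁ + (c₁ + (sⱼ + 0))) + ((sⱼ + (c₂ + (s₀ + 0))) + o)))
  ≡ (T + (a + ((s₀₁ + (c₁ + c₂)) + o))) + 2 * (s₀ + (s₁ + sⱼ))
split-count-arith = solve-∀

split-euler-arith : (a b k : ℕ) → suc a + suc b + suc k ≡ 3 + (a + b + k)
split-euler-arith = solve-∀

-- The split of the only front a0 a1 P aj Q glues on the triangle a0a1v and the edge aj v, which
-- cut it into the fronts v a1 P aj and v aj Q a0.
module Split {A VS : List (Fin m)} {ES : List (Fin m × Fin m)} {TS : List (Tri m)} {k : ℕ}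
             {a0 a1 aj : Fin m} {P Q : List (Fin m)} (v : Fin m)
             (stage : Stage A VS ES TS ((a0 ∷ a1 ∷ P ++ aj ∷ Q) ∷ []) [] k) (fresh : All (Fin._< v) VS) where
  private
    module S = Stage stage

  F F₁ F₂ : List (Fin m)
  F = a0 ∷ a1 ∷ P ++ aj ∷ Q
  F₁ = v ∷ a1 ∷ P ∷ʳ aj
  F₂ = v ∷ aj ∷ Q ∷ʳ a0

  S₁ S₂ : List (Fin m × Fin m)
  S₁ = pathEdges (a1 ∷ P ∷ʳ aj)
  S₂ = pathEdges (aj ∷ Q ∷ʳ a0)

  t₀ : Tri m
  t₀ = tri a0 a1 v

  TS′ : List (Tri m)
  TS′ = t₀ ∷ TS

  FR FR′ : List (List (Fin m))
  FR = F ∷ []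
  FR′ = F₁ ∷ F₂ ∷ []

  cycleEdges-F : cycleEdges F ≡ (a0 , a1) ∷ S₁ ++ S₂
  cycleEdges-F rewrite cycleEdges≡pathEdges a0 (a1 ∷ P ++ aj ∷ Q) | ++-assoc P (aj ∷ Q) [ a0 ] = cong ((a0 , a1) ∷_) (pathEdges-++ (a1 ∷ P) aj (Q ∷ʳ a0))
  cycleEdges-F₁ : cycleEdges F₁ ≡ (v , a1) ∷ S₁ ∷ʳ (aj , v)
  cycleEdges-F₁ rewrite cycleEdges≡pathEdges v (a1 ∷ P ∷ʳ aj) | ++-assoc P [ aj ] [ v ] = cong ((v , a1) ∷_) (pathEdges-++ (a1 ∷ P) aj [ v ])
  cycleEdges-F₂ : cycleEdges F₂ ≡ (v , aj) ∷ S₂ ∷ʳ (a0 , v)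
  cycleEdges-F₂ rewrite cycleEdges≡pathEdges v (aj ∷ Q ∷ʳ a0) | ++-assoc Q [ a0 ] [ v ] = cong ((v , aj) ∷_) (pathEdges-++ (aj ∷ Q) a0 [ v ])

  from-F : ∀ {e} → e ∈ (a0 , a1) ∷ S₁ ++ S₂ → e ∈ cycleEdges F
  from-F {e} i = subst (e ∈_) (sym cycleEdges-F) i
  to-F : ∀ {e} → e ∈ cycleEdges F → e ∈ (a0 , a1) ∷ S₁ ++ S₂
  to-F {e} i = subst (e ∈_) cycleEdges-F i
  from-F₁ : ∀ {e} → e ∈ (v , a1) ∷ S₁ ∷ʳ (aj , v) → e ∈ cycleEdges F₁
  from-F₁ {e} i = subst (e ∈_) (sym cycleEdges-F₁) i
  to-F₁ : ∀ {e} → e ∈ cycleEdges F₁ → e ∈ (v , a1) ∷ S₁ ∷ʳ (aj , v)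
  to-F₁ {e} i = subst (e ∈_) cycleEdges-F₁ i
  from-F₂ : ∀ {e} → e ∈ (v , aj) ∷ S₂ ∷ʳ (a0 , v) → e ∈ cycleEdges F₂
  from-F₂ {e} i = subst (e ∈_) (sym cycleEdges-F₂) i
  to-F₂ : ∀ {e} → e ∈ cycleEdges F₂ → e ∈ (v , aj) ∷ S₂ ∷ʳ (a0 , v)
  to-F₂ {e} i = subst (e ∈_) cycleEdges-F₂ i

  F-unique : Unique F
  F-unique = proj₁ (S.front-cycle (here refl))
  F⊆VS : ∀ {w} → w ∈ F → w ∈ VS
  F⊆VS = S.front-verts (here refl)
  a0∉ : a0 ∉ a1 ∷ P ++ aj ∷ Q
  a0∉ = Unique[x∷xs]⇒x∉xs F-unique
  a1P∩ajQ : ∀ {w} → w ∈ a1 ∷ P → w ∈ aj ∷ Q → ⊥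
  a1P∩ajQ = unique-++-disjoint (a1 ∷ P) (AllPairs.tail F-unique)
  a0∈ : a0 ∈ VS
  a0∈ = F⊆VS (here refl)
  a1∈ : a1 ∈ VS
  a1∈ = F⊆VS (there (here refl))
  aj∈ : aj ∈ VS
  aj∈ = F⊆VS (there (there (∈-++⁺ʳ P (here refl))))
  a0≢a1 : a0 ≢ a1
  a0≢a1 e = a0∉ (here e)
  a0≢aj : a0 ≢ aj
  a0≢aj e = a0∉ (there (∈-++⁺ʳ P (here e)))
  a1≢aj : a1 ≢ aj
  a1≢aj e = a1P∩ajQ (here refl) (here e)

  open NewVertex stage v a0 a1 aj fresh a0∈ a1∈ aj∈ a0≢a1 a0≢aj a1≢aj

  D : Distinct3 a0 a1 v
  D = a0≢a1 , ≢v a0∈ , ≢v a1∈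
  S₁-∈₁ : ∀ {a b} → (a , b) ∈ S₁ → a ∈ a1 ∷ P
  S₁-∈₁ i = pathEdges-∈₁-init (a1 ∷ P) aj i
  S₁-∈₂ : ∀ {a b} → (a , b) ∈ S₁ → b ∈ P ∷ʳ aj
  S₁-∈₂ i = pathEdges-∈₂-tail a1 (P ∷ʳ aj) i
  S₂-∈₁ : ∀ {a b} → (a , b) ∈ S₂ → a ∈ aj ∷ Q
  S₂-∈₁ i = pathEdges-∈₁-init (aj ∷ Q) a0 i
  S₂-∈₂ : ∀ {a b} → (a , b) ∈ S₂ → b ∈ Q ∷ʳ a0
  S₂-∈₂ i = pathEdges-∈₂-tail aj (Q ∷ʳ a0) i
  a1P⊆VS : ∀ {w} → w ∈ a1 ∷ P → w ∈ VS
  a1P⊆VS (here refl) = a1∈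
  a1P⊆VS (there j) = F⊆VS (there (there (∈-++⁺ˡ j)))
  Paj⊆VS : ∀ {w} → w ∈ P ∷ʳ aj → w ∈ VS
  Paj⊆VS j with ∈-++⁻ P j
  ... | inj₁ k = a1P⊆VS (there k)
  ... | inj₂ (here refl) = aj∈
  ajQ⊆VS : ∀ {w} → w ∈ aj ∷ Q → w ∈ VS
  ajQ⊆VS j = F⊆VS (there (there (∈-++⁺ʳ P j)))
  Qa0⊆VS : ∀ {w} → w ∈ Q ∷ʳ a0 → w ∈ VS
  Qa0⊆VS j with ∈-++⁻ Q j
  ... | inj₁ k = ajQ⊆VS (there k)
  ... | inj₂ (here refl) = a0∈
  a0∉a1P : a0 ∉ a1 ∷ P
  a0∉a1P j = a0∉ (∈-++⁺ˡ {xs = a1 ∷ P} j)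
  a0∉Paj : a0 ∉ P ∷ʳ aj
  a0∉Paj j with ∈-++⁻ P j
  ... | inj₁ k = a0∉a1P (there k)
  ... | inj₂ (here e) = a0≢aj e
  Paj∩ajQ : ∀ {w} → w ∈ P ∷ʳ aj → w ∈ aj ∷ Q → w ≡ aj
  Paj∩ajQ j k with ∈-++⁻ P j
  ... | inj₁ j' = ⊥-elim (a1P∩ajQ (there j') k)
  ... | inj₂ (here e) = e
  a1P∩Qa0 : ∀ {w} → w ∈ a1 ∷ P → w ∈ Q ∷ʳ a0 → ⊥
  a1P∩Qa0 j k with ∈-++⁻ Q k
  ... | inj₁ k' = a1P∩ajQ j (there k')
  ... | inj₂ (here refl) = a0∉a1P j

  -- The triangle covers a0a1, which leaves the front, and a0v, a1v once; the new fronts contain a0v,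
  -- a1v once and ajv twice.
  side-count′ : ∀ e → triCount e TS′ + countᵇ (sameEdge e) (openEdges A FR′) ≡ 2 * countᵇ (sameEdge e) ES′
  side-count′ e = begin
      triCount e TS′ + countᵇ se (openEdges A FR′)
        ≡⟨ cong₂ _+_ (cong (_+ Tc) (indicator-triEdges-tri e a0 a1 v D))
             (trans (countᵇ-++ se (cycleEdges A) _) (cong (cA +_) (trans (countᵇ-++ se (cycleEdges F₁) _)
               (cong₂ _+_ (trans (cong (countᵇ se) cycleEdges-F₁) (cong (indicator (se (v , a1)) +_) (countᵇ-++ se S₁ _)))
                          (trans (countᵇ-++ se (cycleEdges F₂) [])
                                 (cong (_+ 0) (trans (cong (countᵇ se) cycleEdges-F₂) (cong (indicator (se (v , aj)) +_) (countᵇ-++ se S₂ _))))))))) ⟩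
      (s01 + s0v + s1v) + Tc + (cA + ((indicator (se (v , a1)) + (cS1 + (indicator (se (aj , v)) + 0))) + ((indicator (se (v , aj)) + (cS2 + (indicator (se (a0 , v)) + 0))) + 0)))
        ≡⟨ cong₂ (λ z1 z2 → (s01 + s0v + s1v) + Tc + (cA + ((indicator z1 + (cS1 + (sjv + 0))) + ((indicator z2 + (cS2 + (s0v + 0))) + 0))))
                 (sameEdge-swapʳ e (a1 , v)) (sameEdge-swapʳ e (aj , v)) ⟩
      (s01 + s0v + s1v) + Tc + (cA + ((s1v + (cS1 + (sjv + 0))) + ((sjv + (cS2 + (s0v + 0))) + 0)))
        ≡⟨ split-count-arith s01 s0v s1v sjv Tc cA cS1 cS2 0 ⟩
      (Tc + (cA + ((s01 + (cS1 + cS2)) + 0))) + 2 * (s0v + (s1v + sjv))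
        ≡⟨ cong (_+ 2 * (s0v + (s1v + sjv))) (trans (cong (Tc +_) (sym (trans (countᵇ-++ se (cycleEdges A) _)
              (cong (cA +_) (trans (countᵇ-++ se (cycleEdges F) [])
                                   (cong (_+ 0) (trans (cong (countᵇ se) cycleEdges-F) (cong (s01 +_) (countᵇ-++ se S₁ S₂)))))))))
              (S.side-count e)) ⟩
      2 * countᵇ se ES + 2 * (s0v + (s1v + sjv))
        ≡⟨ ear-double-arith s0v s1v sjv (countᵇ se ES) ⟩
      2 * countᵇ se ES′ ∎
    where
    open ≡-Reasoning
    se = sameEdge e
    cA = countᵇ se (cycleEdges A)
    cS1 = countᵇ se S₁
    cS2 = countᵇ se S₂
    Tc = triCount e TS
    s01 = δ e (a0 , a1)
    s0v = δ e (a0 , v)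
    s1v = δ e (a1 , v)
    sjv = δ e (aj , v)

  t₀∈ : t₀ ∈ TS′
  t₀∈ = here refl
  opposite-path : ∀ {w x y} → Opposite w t₀ x y → EqClosure (LinkOrCorner TS′ FR′ w) x y
  opposite-path o = LinkPath⇒LinkOrCorner (Opposite⇒LinkPath t₀∈ o)
  t₀-at-v : Opposite v t₀ a0 a1
  t₀-at-v = Opposite-tri-apex a0 a1 v D
  t₀-at-a0 : Opposite a0 t₀ a1 v
  t₀-at-a0 = Opposite-tri₁ a0 a1 v D
  t₀-at-a1 : Opposite a1 t₀ a0 v
  t₀-at-a1 = Opposite-tri₂ a0 a1 v D
  corner₁ : ∀ {w x y} → (x , w) ∈ (v , a1) ∷ S₁ ∷ʳ (aj , v) → (w , y) ∈ (v , a1) ∷ S₁ ∷ʳ (aj , v) → EqClosure (LinkOrCorner TS′ FR′ w) x y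
  corner₁ i o = fwd (inj₂ (here (from-F₁ i , from-F₁ o))) ◅ ε
  corner₂ : ∀ {w x y} → (x , w) ∈ (v , aj) ∷ S₂ ∷ʳ (a0 , v) → (w , y) ∈ (v , aj) ∷ S₂ ∷ʳ (a0 , v) → EqClosure (LinkOrCorner TS′ FR′ w) x y
  corner₂ i o = fwd (inj₂ (there (here (from-F₂ i , from-F₂ o)))) ◅ ε

  old-corner-path′ : ∀ {w x y} → (x , w) ∈ (a0 , a1) ∷ S₁ ++ S₂ → (w , y) ∈ (a0 , a1) ∷ S₁ ++ S₂ → EqClosure (LinkOrCorner TS′ FR′ w) x y
  old-corner-path′ (here refl) (here e) = ⊥-elim (a0≢a1 (sym (cong proj₁ e)))
  old-corner-path′ (here refl) (there o) with ∈-++⁻ S₁ o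
  ... | inj₁ o1 = opposite-path t₀-at-a1 ◅◅ corner₁ (here refl) (there (∈-++⁺ˡ o1))
  ... | inj₂ o2 = ⊥-elim (a1P∩ajQ (here refl) (S₂-∈₁ o2))
  old-corner-path′ (there i) o with ∈-++⁻ S₁ i
  old-corner-path′ (there i) (here e) | inj₁ i1 = ⊥-elim (a0∉Paj (subst (_∈ P ∷ʳ aj) (cong proj₁ e) (S₁-∈₂ i1)))
  old-corner-path′ (there i) (there o) | inj₁ i1 with ∈-++⁻ S₁ o
  ... | inj₁ o1 = corner₁ (there (∈-++⁺ˡ i1)) (there (∈-++⁺ˡ o1))
  ... | inj₂ o2 with Paj∩ajQ (S₁-∈₂ i1) (S₂-∈₁ o2)
  ... | refl = corner₁ (there (∈-++⁺ˡ i1)) (there (∈-++⁺ʳ S₁ (here refl))) ◅◅ corner₂ (here refl) (there (∈-++⁺ˡ o2))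
  old-corner-path′ (there i) (here refl) | inj₂ i2 = corner₂ (there (∈-++⁺ˡ i2)) (there (∈-++⁺ʳ S₂ (here refl))) ◅◅ opposite-path (Opposite-sym t₀-at-a0)
  old-corner-path′ (there i) (there o) | inj₂ i2 with ∈-++⁻ S₁ o
  ... | inj₁ o1 = ⊥-elim (a1P∩Qa0 (S₁-∈₁ o1) (S₂-∈₂ i2))
  ... | inj₂ o2 = corner₂ (there (∈-++⁺ˡ i2)) (there (∈-++⁺ˡ o2))

  old-corner-path : ∀ {w x y} → FrontCorner FR w x y → EqClosure (LinkOrCorner TS′ FR′ w) x y
  old-corner-path (here (i , o)) = old-corner-path′ (to-F i) (to-F o)

  OldTouches : Fin m → Fin m → Set
  OldTouches w x = Touches (LinkOrCorner TS FR w) x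
  touches-in : ∀ {x w} → (x , w) ∈ (a0 , a1) ∷ S₁ ++ S₂ → OldTouches w x
  touches-in i = Touches-corner (Touches-in-edge (here refl) (from-F i))
  touches-out : ∀ {y w} → (w , y) ∈ (a0 , a1) ∷ S₁ ++ S₂ → OldTouches w y
  touches-out o = Touches-corner (Touches-out-edge (here refl) (from-F o))

  NewCorner : Fin m → Fin m → Fin m → Set
  NewCorner w x y = (OldTouches w x × OldTouches w y) ⊎ (x ≡ v × OldTouches w y) ⊎ (y ≡ v × OldTouches w x)

  NewCorner-SameEdge : ∀ {w x y a} → OldTouches w a → SameEdge (x , y) (a , v) → NewCorner w x y
  NewCorner-SameEdge va (inj₁ refl) = inj₂ (inj₂ (refl , va))
  NewCorner-SameEdge va (inj₂ refl) = inj₂ (inj₁ (refl , va))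

  new-corner₁ : ∀ {w x y} → w ≢ v → (x , w) ∈ (v , a1) ∷ S₁ ∷ʳ (aj , v) → (w , y) ∈ (v , a1) ∷ S₁ ∷ʳ (aj , v) → NewCorner w x y
  new-corner₁ n (here refl) (here e) = ⊥-elim (≢v a1∈ (cong proj₁ e))
  new-corner₁ n (here refl) (there o) with ∈-++⁻ S₁ o
  ... | inj₁ o1 = inj₂ (inj₁ (refl , touches-out (there (∈-++⁺ˡ o1))))
  ... | inj₂ (here e) = ⊥-elim (a1≢aj (cong proj₁ e))
  new-corner₁ n (there i) o with ∈-++⁻ S₁ i
  new-corner₁ n (there i) o | inj₂ (here e) = ⊥-elim (n (cong proj₂ e))
  new-corner₁ n (there i) (here e) | inj₁ i1 = ⊥-elim (n (cong proj₁ e))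
  new-corner₁ n (there i) (there o) | inj₁ i1 with ∈-++⁻ S₁ o
  ... | inj₁ o1 = inj₁ (touches-in (there (∈-++⁺ˡ i1)) , touches-out (there (∈-++⁺ˡ o1)))
  ... | inj₂ (here e) = inj₂ (inj₂ (cong proj₂ e , touches-in (there (∈-++⁺ˡ i1))))

  new-corner₂ : ∀ {w x y} → w ≢ v → (x , w) ∈ (v , aj) ∷ S₂ ∷ʳ (a0 , v) → (w , y) ∈ (v , aj) ∷ S₂ ∷ʳ (a0 , v) → NewCorner w x y
  new-corner₂ n (here refl) (here e) = ⊥-elim (≢v aj∈ (cong proj₁ e))
  new-corner₂ n (here refl) (there o) with ∈-++⁻ S₂ o
  ... | inj₁ o2 = inj₂ (inj₁ (refl , touches-out (there (∈-++⁺ʳ S₁ o2))))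
  ... | inj₂ (here e) = ⊥-elim (a0≢aj (sym (cong proj₁ e)))
  new-corner₂ n (there i) o with ∈-++⁻ S₂ i
  new-corner₂ n (there i) o | inj₂ (here e) = ⊥-elim (n (cong proj₂ e))
  new-corner₂ n (there i) (here e) | inj₁ i2 = ⊥-elim (n (cong proj₁ e))
  new-corner₂ n (there i) (there o) | inj₁ i2 with ∈-++⁻ S₂ o
  ... | inj₁ o2 = inj₁ (touches-in (there (∈-++⁺ʳ S₁ i2)) , touches-out (there (∈-++⁺ʳ S₁ o2)))
  ... | inj₂ (here e) = inj₂ (inj₂ (cong proj₂ e , touches-in (there (∈-++⁺ʳ S₁ i2))))

  new-star-edge : ∀ {w x y} → w ≢ v → LinkOrCorner TS′ FR′ w x y → NewCorner w x y
  new-star-edge {w} {x} {y} n (inj₁ l) with LinkEdge-∷ t₀ TS w l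
  ... | inj₂ l0 = inj₁ ((y , inj₁ (inj₁ l0)) , (x , inj₂ (inj₁ l0)))
  ... | inj₁ e with Opposite-tri a0 a1 v w x y (mkOpposite (inj₁ e))
  ... | inj₁ (p , _) = ⊥-elim (n p)
  ... | inj₂ (inj₁ (refl , q)) = NewCorner-SameEdge (touches-out (here refl)) q
  ... | inj₂ (inj₂ (refl , q)) = NewCorner-SameEdge (touches-in (here refl)) q
  new-star-edge n (inj₂ (here (i , o))) = new-corner₁ n (to-F₁ i) (to-F₁ o)
  new-star-edge n (inj₂ (there (here (i , o)))) = new-corner₂ n (to-F₂ i) (to-F₂ o)

  corner₁-at-v : ∀ {x y} → (x , v) ∈ (v , a1) ∷ S₁ ∷ʳ (aj , v) → (v , y) ∈ (v , a1) ∷ S₁ ∷ʳ (aj , v) → x ≡ aj × y ≡ a1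
  corner₁-at-v (here e) o = ⊥-elim (≢v a1∈ (sym (cong proj₂ e)))
  corner₁-at-v (there i) o with ∈-++⁻ S₁ i
  ... | inj₁ i1 = ⊥-elim (v∉VS (Paj⊆VS (S₁-∈₂ i1)))
  ... | inj₂ (here refl) with o
  ... | here refl = refl , refl
  ... | there o' with ∈-++⁻ S₁ o'
  ... | inj₁ o1 = ⊥-elim (v∉VS (a1P⊆VS (S₁-∈₁ o1)))
  ... | inj₂ (here e) = ⊥-elim (≢v aj∈ (sym (cong proj₁ e)))

  corner₂-at-v : ∀ {x y} → (x , v) ∈ (v , aj) ∷ S₂ ∷ʳ (a0 , v) → (v , y) ∈ (v , aj) ∷ S₂ ∷ʳ (a0 , v) → x ≡ a0 × y ≡ aj
  corner₂-at-v (here e) o = ⊥-elim (≢v aj∈ (sym (cong proj₂ e)))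
  corner₂-at-v (there i) o with ∈-++⁻ S₂ i
  ... | inj₁ i2 = ⊥-elim (v∉VS (Qa0⊆VS (S₂-∈₂ i2)))
  ... | inj₂ (here refl) with o
  ... | here refl = refl , refl
  ... | there o' with ∈-++⁻ S₂ o'
  ... | inj₁ o2 = ⊥-elim (v∉VS (ajQ⊆VS (S₂-∈₁ o2)))
  ... | inj₂ (here e) = ⊥-elim (≢v a0∈ (sym (cong proj₁ e)))

  star-at-v : ∀ {x y} → LinkOrCorner TS′ FR′ v x y → SameEdge (x , y) (a0 , a1) ⊎ (x ≡ aj × y ≡ a1) ⊎ (x ≡ a0 × y ≡ aj)
  star-at-v {x} {y} (inj₁ l) with LinkEdge-∷ t₀ TS v l
  ... | inj₂ l0 = let (t' , i , e) = LinkEdge⇒opp TS v l0 in ⊥-elim (v∉VS (S.tri-verts i (opp⇒∈T v t' e)))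
  ... | inj₁ e with Opposite-tri a0 a1 v v x y (mkOpposite (inj₁ e))
  ... | inj₁ (_ , q) = inj₁ q
  ... | inj₂ (inj₁ (p , _)) = ⊥-elim (≢v a0∈ (sym p))
  ... | inj₂ (inj₂ (p , _)) = ⊥-elim (≢v a1∈ (sym p))
  star-at-v (inj₂ (here (i , o))) = inj₂ (inj₁ (corner₁-at-v (to-F₁ i) (to-F₁ o)))
  star-at-v (inj₂ (there (here (i , o)))) = inj₂ (inj₂ (corner₂-at-v (to-F₂ i) (to-F₂ o)))

  from-a0 : ∀ {x} → x ≡ a0 ⊎ x ≡ a1 ⊎ x ≡ aj → EqClosure (LinkOrCorner TS′ FR′ v) a0 x
  from-a0 (inj₁ refl) = ε
  from-a0 (inj₂ (inj₁ refl)) = opposite-path t₀-at-v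
  from-a0 (inj₂ (inj₂ refl)) = corner₂ (there (∈-++⁺ʳ S₂ (here refl))) (here refl)

  star-at-v₁ : ∀ {x y} → SameEdge (x , y) (a0 , a1) ⊎ (x ≡ aj × y ≡ a1) ⊎ (x ≡ a0 × y ≡ aj) → x ≡ a0 ⊎ x ≡ a1 ⊎ x ≡ aj
  star-at-v₁ (inj₁ q) with SameEdge-∈₁ q
  ... | inj₁ e = inj₁ e
  ... | inj₂ e = inj₂ (inj₁ e)
  star-at-v₁ (inj₂ (inj₁ (e , _))) = inj₂ (inj₂ e)
  star-at-v₁ (inj₂ (inj₂ (e , _))) = inj₁ e

  star-at-v₂ : ∀ {x y} → SameEdge (x , y) (a0 , a1) ⊎ (x ≡ aj × y ≡ a1) ⊎ (x ≡ a0 × y ≡ aj) → y ≡ a0 ⊎ y ≡ a1 ⊎ y ≡ aj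
  star-at-v₂ (inj₁ q) with SameEdge-∈₂ q
  ... | inj₁ e = inj₁ e
  ... | inj₂ e = inj₂ (inj₁ e)
  star-at-v₂ (inj₂ (inj₁ (_ , e))) = inj₂ (inj₁ e)
  star-at-v₂ (inj₂ (inj₂ (_ , e))) = inj₂ (inj₂ e)

  star-connected′ : ∀ w → Connected (LinkOrCorner TS′ FR′ w)
  star-connected′ w with w FinP.≟ v
  ... | yes refl = Connected-hub a0 from-hub
    where
    from-hub : ∀ {x} → Touches (LinkOrCorner TS′ FR′ v) x → EqClosure (LinkOrCorner TS′ FR′ v) a0 x
    from-hub (y , inj₁ r) = from-a0 (star-at-v₁ (star-at-v r))
    from-hub (y , inj₂ r) = from-a0 (star-at-v₂ (star-at-v r))
  ... | no n = Connected-transfer (S.star-connected w) old-step old-anchor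
    where
    old-step : ∀ {x y} → LinkOrCorner TS FR w x y → EqClosure (LinkOrCorner TS′ FR′ w) x y
    old-step (inj₁ l) = fwd (inj₁ (LinkEdge-∷ʳ t₀ TS w l)) ◅ ε
    old-step (inj₂ f) = old-corner-path f
    old-anchor : ∀ {x} → Touches (LinkOrCorner TS′ FR′ w) x → ∃ λ z → Touches (LinkOrCorner TS FR w) z × EqClosure (LinkOrCorner TS′ FR′ w) z x
    old-anchor {x} (y , inj₁ r) with new-star-edge n r
    ... | inj₁ (vx , vy) = x , vx , ε
    ... | inj₂ (inj₁ (refl , vy)) = y , vy , bwd r ◅ ε
    ... | inj₂ (inj₂ (refl , vx)) = x , vx , ε
    old-anchor {x} (y , inj₂ r) with new-star-edge n r
    ... | inj₁ (vy , vx) = x , vx , ε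
    ... | inj₂ (inj₁ (refl , vx)) = x , vx , ε
    ... | inj₂ (inj₂ (refl , vy)) = y , vy , fwd r ◅ ε

  F₁-unique : Unique F₁
  F₁-unique = unique-∷ (λ j → v∉VS (a1Paj⊆VS j))
                (unique-∷ʳ (a1 ∷ P) aj (unique-++ˡ (a1 ∷ P) (AllPairs.tail F-unique)) (λ j → a1P∩ajQ j (here refl)))
    where
    a1Paj⊆VS : ∀ {w} → w ∈ a1 ∷ P ∷ʳ aj → w ∈ VS
    a1Paj⊆VS (here refl) = a1∈
    a1Paj⊆VS (there j) = Paj⊆VS j
  F₂-unique : Unique F₂
  F₂-unique = unique-∷ (λ j → v∉VS (ajQa0⊆VS j))
                (unique-∷ʳ (aj ∷ Q) a0 (unique-++ʳ (a1 ∷ P) (AllPairs.tail F-unique)) (λ j → a0∉ (there (∈-++⁺ʳ P j))))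
    where
    ajQa0⊆VS : ∀ {w} → w ∈ aj ∷ Q ∷ʳ a0 → w ∈ VS
    ajQa0⊆VS (here refl) = aj∈
    ajQa0⊆VS (there j) = Qa0⊆VS j

  tri-verts′ : ∀ {t w} → t ∈ TS′ → w ∈T t → w ∈ VS′
  tri-verts′ (here refl) = new-tri-verts a0∈ a1∈
  tri-verts′ (there i) h = there (S.tri-verts i h)

  front-verts′ : ∀ {G w} → G ∈ FR′ → w ∈ G → w ∈ VS′
  front-verts′ (here refl) (here refl) = here refl
  front-verts′ (here refl) (there (here refl)) = there a1∈
  front-verts′ (here refl) (there (there j)) = there (Paj⊆VS j)
  front-verts′ (there (here refl)) (here refl) = here refl
  front-verts′ (there (here refl)) (there (here refl)) = there aj∈
  front-verts′ (there (here refl)) (there (there j)) = there (Qa0⊆VS j)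

  stage′ : Stage A VS′ ES′ TS′ FR′ [] (suc k)
  stage′ = record
    { verts-unique = verts-unique′
    ; henneberg = henneberg′
    ; edge-endpoints = edge-endpoints′
    ; edge-no-loop = edge-no-loop′
    ; edges-unique = edges-unique′
    ; tri-verts = tri-verts′
    ; tris-unique = unique-∷ (new-tri-fresh {a0} {a1}) S.tris-unique
    ; tris-canonical = new-tri-canonical a0∈ a1∈ a0≢a1 ∷ S.tris-canonical
    ; front-verts = front-verts′
    ; front-cycle = λ { (here refl) → F₁-unique , s≤s (s≤s (subst (1 ≤_) (sym (length-∷ʳ P aj)) (s≤s z≤n)))
                      ; (there (here refl)) → F₂-unique , s≤s (s≤s (subst (1 ≤_) (sym (length-∷ʳ Q a0)) (s≤s z≤n))) }
    ; side-count = side-count′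
    ; star-connected = star-connected′
    ; apex-link = λ w ()
    ; reach = reach′
    ; vert-on-edge = vert-on-edge′
    ; euler = trans (split-euler-arith (length VS) (length TS) k) (cong (3 +_) S.euler)
    ; apexes⊆verts = λ ()
    }

split : {A VS : List (Fin m)} {ES : List (Fin m × Fin m)} {TS : List (Tri m)} {k : ℕ} {a0 a1 aj : Fin m} {P Q : List (Fin m)}
        (v : Fin m) → Stage A VS ES TS ((a0 ∷ a1 ∷ P ++ aj ∷ Q) ∷ []) [] k → All (Fin._< v) VS →
        Stage A (v ∷ VS) ((a0 , v) ∷ (a1 , v) ∷ (aj , v) ∷ ES) (tri a0 a1 v ∷ TS)
              ((v ∷ a1 ∷ P ∷ʳ aj) ∷ (v ∷ aj ∷ Q ∷ʳ a0) ∷ []) [] (suc k)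
split v stage fresh = Split.stage′ v stage fresh

earRotate : {A VS : List (Fin m)} {ES : List (Fin m × Fin m)} {TS : List (Tri m)} {Os : List (List (Fin m))} {CR : List (Fin m)} {k : ℕ}
            {u x x' : Fin m} {R : List (Fin m)} (y : Fin m) →
            Stage A VS ES TS ((u ∷ x ∷ x' ∷ R) ∷ Os) CR k → All (Fin._< y) VS →
            Stage A (y ∷ VS) ((u , y) ∷ (x , y) ∷ (x' , y) ∷ ES) (tri u x y ∷ tri x x' y ∷ TS) ((y ∷ x' ∷ R ∷ʳ u) ∷ Os) (y ∷ CR) k
earRotate y stage fresh = rotateFront (ear y stage fresh)

record PushedOff (A VS CR : List (Fin m)) (Os : List (List (Fin m))) (k : ℕ) (Ys Yall : List (Fin m)) (n : ℕ) : Set where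
  field
    verts′ : List (Fin m)
    edges′ : List (Fin m × Fin m)
    tris′ : List (Tri m)
    apexes′ : List (Fin m)
    front : List (Fin m)
    stage : Stage A verts′ edges′ tris′ (front ∷ Os) apexes′ k
    verts↭ : verts′ ↭ VS ++ Ys
    apexes↭ : apexes′ ↭ CR ++ Ys
    front⊆ : All (_∈ Yall) front
    front-length : length front ≡ n

fresh-uncons : {VS : List (Fin m)} {y : Fin m} {Ys : List (Fin m)} →
               All (λ u → All (u Fin.<_) (y ∷ Ys)) VS → AllPairs Fin._<_ (y ∷ Ys) →
               All (Fin._< y) VS × All (λ u → All (u Fin.<_) Ys) (y ∷ VS) × AllPairs Fin._<_ Ys
fresh-uncons fresh (y<Ys ∷ sorted) = All.map All.head fresh , (y<Ys ∷ All.map All.tail fresh) , sorted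

-- The front is y ∷ Old ++ New: y and New are already new vertices, Old still has to be pushed off.
-- Each ear puts the next fresh vertex over the corner (y, o, x') at the head of Old.
pushOffLoop : {A : List (Fin m)} {Os : List (List (Fin m))} {k : ℕ} (Yall Old : List (Fin m)) →
              ∀ {VS ES TS CR y New Ys} →
              Stage A VS ES TS ((y ∷ Old ++ New) ∷ Os) CR k → length Ys ≡ length Old →
              All (λ u → All (u Fin.<_) Ys) VS → AllPairs Fin._<_ Ys →
              All (_∈ Yall) (y ∷ New) → All (_∈ Yall) Ys →
              PushedOff A VS CR Os k Ys Yall (length (y ∷ Old ++ New))
pushOffLoop Yall [] {VS} {ES} {TS} {CR} {y} {New} {[]} stage _ _ _ new⊆ _ = record
  { verts′ = VS ; edges′ = ES ; tris′ = TS ; apexes′ = CR ; front = y ∷ New ; stage = stage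
  ; verts↭ = ↭-sym (PermP.++-identityʳ VS) ; apexes↭ = ↭-sym (PermP.++-identityʳ CR) ; front⊆ = new⊆ ; front-length = refl }
pushOffLoop {A = A} {Os} {k} Yall (o ∷ Old) {VS} {ES} {TS} {CR} {y} {New} {y' ∷ Ys} stage l fresh sorted (y∈ ∷ new⊆) (y'∈ ∷ Ys⊆)
  with Old ++ New in eq
... | [] with s≤s (s≤s ()) ← proj₂ (Stage.front-cycle stage (here refl))
... | x' ∷ R =
  let (y'-fresh , fresh′ , sorted′) = fresh-uncons fresh sorted
      stage′ = subst (λ G → Stage A (y' ∷ VS) ((y , y') ∷ (o , y') ∷ (x' , y') ∷ ES) (tri y o y' ∷ tri o x' y' ∷ TS) ((y' ∷ G) ∷ Os) (y' ∷ CR) k)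
                     (trans (cong (_∷ʳ y) (sym eq)) (++-assoc Old New [ y ])) (earRotate y' stage y'-fresh)
      r = pushOffLoop Yall Old {New = New ∷ʳ y} {Ys = Ys} stage′ (ℕₚ.suc-injective l) fresh′ sorted′ (y'∈ ∷ AllP.++⁺ new⊆ (y∈ ∷ [])) Ys⊆
      module r = PushedOff r
  in record
    { verts′ = r.verts′ ; edges′ = r.edges′ ; tris′ = r.tris′ ; apexes′ = r.apexes′ ; front = r.front ; stage = r.stage
    ; verts↭ = ↭-trans r.verts↭ (↭-sym (PermP.shift y' VS Ys))
    ; apexes↭ = ↭-trans r.apexes↭ (↭-sym (PermP.shift y' CR Ys))
    ; front⊆ = r.front⊆
    ; front-length = trans r.front-length (cong suc same-length)
    }
  where
  same-length : length (Old ++ New ∷ʳ y) ≡ length (o ∷ x' ∷ R)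
  same-length = begin
    length (Old ++ New ∷ʳ y)    ≡⟨ cong length (sym (++-assoc Old New [ y ])) ⟩
    length ((Old ++ New) ∷ʳ y)  ≡⟨ length-∷ʳ (Old ++ New) y ⟩
    suc (length (Old ++ New))   ≡⟨ cong (suc ∘ length) eq ⟩
    length (o ∷ x' ∷ R)         ∎
    where open ≡-Reasoning

pushOff : {A VS : List (Fin m)} {ES : List (Fin m × Fin m)} {TS : List (Tri m)} {Os : List (List (Fin m))} {CR : List (Fin m)} {k : ℕ}
          (F : List (Fin m)) → Stage A VS ES TS (F ∷ Os) CR k → (Ys : List (Fin m)) → length Ys ≡ length F →
          All (λ u → All (u Fin.<_) Ys) VS → AllPairs Fin._<_ Ys → PushedOff A VS CR Os k Ys Ys (length F)
pushOff [] stage with () ← proj₂ (Stage.front-cycle stage (here refl))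
pushOff (_ ∷ []) stage with s≤s () ← proj₂ (Stage.front-cycle stage (here refl))
pushOff (_ ∷ _ ∷ []) stage with s≤s (s≤s ()) ← proj₂ (Stage.front-cycle stage (here refl))
pushOff {A = A} {VS} {ES} {TS} {Os} {CR} {k} (f₀ ∷ f₁ ∷ f₂ ∷ R) stage (y₁ ∷ Ys) l fresh sorted =
  let (y₁-fresh , fresh′ , sorted′) = fresh-uncons fresh sorted
      stage′ = subst (λ G → Stage A (y₁ ∷ VS) ((f₀ , y₁) ∷ (f₁ , y₁) ∷ (f₂ , y₁) ∷ ES) (tri f₀ f₁ y₁ ∷ tri f₁ f₂ y₁ ∷ TS)
                                   ((y₁ ∷ G) ∷ Os) (y₁ ∷ CR) k)
                     (sym (Listₚ.++-identityʳ (f₂ ∷ R ∷ʳ f₀))) (earRotate y₁ stage y₁-fresh)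
      r = pushOffLoop (y₁ ∷ Ys) (f₂ ∷ R ∷ʳ f₀) {New = []} {Ys = Ys} stage′ same-length fresh′ sorted′ (here refl ∷ []) (All.tabulate there)
      module r = PushedOff r
  in record
    { verts′ = r.verts′ ; edges′ = r.edges′ ; tris′ = r.tris′ ; apexes′ = r.apexes′ ; front = r.front ; stage = r.stage
    ; verts↭ = ↭-trans r.verts↭ (↭-sym (PermP.shift y₁ VS Ys))
    ; apexes↭ = ↭-trans r.apexes↭ (↭-sym (PermP.shift y₁ CR Ys))
    ; front⊆ = r.front⊆
    ; front-length = trans r.front-length
                       (trans (cong (suc ∘ length) (Listₚ.++-identityʳ (f₂ ∷ R ∷ʳ f₀))) (cong suc (length-∷ʳ (f₂ ∷ R) f₀)))
    }
  where
  same-length : length Ys ≡ length (f₂ ∷ R ∷ʳ f₀)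
  same-length = trans (ℕₚ.suc-injective l) (sym (length-∷ʳ (f₂ ∷ R) f₀))

-- The triangulation of S₀ \ 3D

t+o≡2c⇒1≤t : (t o c : ℕ) → t + o ≡ 2 * c → 1 ≤ c → o ≤ 1 → 1 ≤ t
t+o≡2c⇒1≤t zero zero (suc c) () _ _
t+o≡2c⇒1≤t zero (suc zero) (suc c) e _ _ = ⊥-elim (ℕₚ.m+1+n≢0 c (sym (ℕₚ.suc-injective e)))
t+o≡2c⇒1≤t zero (suc (suc o)) c e _ (s≤s ())
t+o≡2c⇒1≤t (suc t) o c e _ _ = s≤s z≤n

t+o≡2c⇒1≤c : (t o c : ℕ) → t + o ≡ 2 * c → 1 ≤ t → 1 ≤ c
t+o≡2c⇒1≤c (suc t) o zero () _
t+o≡2c⇒1≤c t o (suc c) e _ = s≤s z≤n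

t+o≡2⇒t≡1⊎t≡2 : (t o : ℕ) → t + o ≡ 2 → o ≤ 1 → t ≡ 1 ⊎ t ≡ 2
t+o≡2⇒t≡1⊎t≡2 t zero e _ = inj₂ (trans (sym (ℕₚ.+-identityʳ t)) e)
t+o≡2⇒t≡1⊎t≡2 (suc zero) (suc zero) e _ = inj₁ refl
t+o≡2⇒t≡1⊎t≡2 (suc (suc t)) (suc zero) e _ = ⊥-elim (ℕₚ.m+1+n≢0 t (ℕₚ.suc-injective (ℕₚ.suc-injective e)))
t+o≡2⇒t≡1⊎t≡2 t (suc (suc o)) e (s≤s ())

t+o≡2⇒t≡1 : (t o : ℕ) → t + o ≡ 2 → 1 ≤ o → o ≤ 1 → t ≡ 1
t+o≡2⇒t≡1 t (suc zero) e _ _ = ℕₚ.suc-injective (trans (ℕₚ.+-comm 1 t) e)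
t+o≡2⇒t≡1 t (suc (suc o)) e _ (s≤s ())

t+o≡2⇒1≤o : (t o : ℕ) → t + o ≡ 2 → t ≡ 1 → 1 ≤ o
t+o≡2⇒1≤o .1 zero () refl
t+o≡2⇒1≤o .1 (suc o) e refl = s≤s z≤n

canonical-side : {t : Tri m} → Canonical t → ∀ {e} → e ∈ triEdges t → norm e ≡ e
canonical-side (x<y , y<z) (here refl) = norm-≤ (ℕₚ.<⇒≤ x<y)
canonical-side (x<y , y<z) (there (here refl)) = norm-≤ (ℕₚ.<⇒≤ y<z)
canonical-side (x<y , y<z) (there (there (here refl))) = norm-≤ (ℕₚ.<⇒≤ (ℕₚ.<-trans x<y y<z))

side-on-triangle : (t : Tri m) {e : Fin m × Fin m} → e ∈ triEdges t → any (sameEdge e) (triEdges t) ≡ true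
side-on-triangle t {e} i = any-∈ (sameEdge e) (triEdges t) i (sameEdge-refl e)

length-trisAt : (ts : List (Tri m)) (e : Fin m × Fin m) → length (trisAt ts e) ≡ triCount e ts
length-trisAt ts e = length-filterᵇ _ ts

-- With every vertex in place and two fronts B, C left (one split, so χ = -1), the stage already is
-- the triangulation: the side count then says that an edge lies on one triangle exactly when it is
-- on A, B or C, and on two triangles otherwise.
module Close {A VS : List (Fin m)} {ES : List (Fin m × Fin m)} {TS : List (Tri m)} {B C CR : List (Fin m)}
             (stage : Stage A VS ES TS (C ∷ B ∷ []) CR 1)
             (all-verts : ∀ w → w ∈ VS) (count-verts : length VS ≡ m) (A-unique : Unique A) (A-length : 3 ≤ length A)
             (A∩B : ∀ {z} → z ∈ A → z ∈ B → ⊥) (A∩C : ∀ {z} → z ∈ A → z ∈ C → ⊥) (B∩C : ∀ {z} → z ∈ B → z ∈ C → ⊥)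
             (B⊆CR : ∀ {w} → w ∈ B → w ∈ CR) (C⊆CR : ∀ {w} → w ∈ C → w ∈ CR) where
  private
    module S = Stage stage

  edgesH : List (Fin m × Fin m)
  edgesH = map norm ES

  open′ : List (Fin m × Fin m)
  open′ = openEdges A (C ∷ B ∷ [])

  boundary′ : List (Fin m × Fin m)
  boundary′ = cycleEdges A ++ cycleEdges B ++ cycleEdges C

  B-unique : Unique B
  B-unique = proj₁ (S.front-cycle (there (here refl)))
  C-unique : Unique C
  C-unique = proj₁ (S.front-cycle (here refl))
  B-length : 3 ≤ length B
  B-length = proj₂ (S.front-cycle (there (here refl)))
  C-length : 3 ≤ length C
  C-length = proj₂ (S.front-cycle (here refl))

  open↭boundary : open′ ↭ boundary′
  open↭boundary = PermP.++⁺ˡ (cycleEdges A)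
    (↭-trans (PermP.++⁺ˡ (cycleEdges C) (PermP.++-identityʳ (cycleEdges B))) (PermP.++-comm (cycleEdges C) (cycleEdges B)))

  boundary-unique : Unique (map norm boundary′)
  boundary-unique rewrite Listₚ.map-++ norm (cycleEdges A) (cycleEdges B ++ cycleEdges C) | Listₚ.map-++ norm (cycleEdges B) (cycleEdges C) =
    unique-++⁺ (unique-norm-cycleEdges A A-unique A-length)
      (unique-++⁺ (unique-norm-cycleEdges B B-unique B-length) (unique-norm-cycleEdges C C-unique C-length) (norm-cycleEdges-disjoint B C B∩C))
      (λ i j → Sum.[ norm-cycleEdges-disjoint A B A∩B i , norm-cycleEdges-disjoint A C A∩C i ] (∈-++⁻ (map norm (cycleEdges B)) j))

  sameEdge-norm≡ : (e a b : Fin m × Fin m) → sameEdge e a ≡ true → sameEdge e b ≡ true → norm a ≡ norm b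
  sameEdge-norm≡ e a b p q = trans (sym (sameEdge⇒norm≡ e a p)) (sameEdge⇒norm≡ e b q)

  open-count≤1 : ∀ e → countᵇ (sameEdge e) open′ ≤ 1
  open-count≤1 e = countᵇ≤1 norm (sameEdge e) open′ (unique-↭ (PermP.map⁺ norm (↭-sym open↭boundary)) boundary-unique)
                     (λ {a} {b} _ _ → sameEdge-norm≡ e a b)

  edge-count≡1 : ∀ e {e₀} → e₀ ∈ ES → sameEdge e e₀ ≡ true → countᵇ (sameEdge e) ES ≡ 1
  edge-count≡1 e i p = ℕₚ.≤-antisym (countᵇ≤1 norm (sameEdge e) ES S.edges-unique (λ {a} {b} _ _ → sameEdge-norm≡ e a b))
                                     (∈⇒1≤countᵇ (sameEdge e) ES i p)

  side-count₂ : ∀ e {e₀} → e₀ ∈ ES → sameEdge e e₀ ≡ true → triCount e TS + countᵇ (sameEdge e) open′ ≡ 2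
  side-count₂ e i p = trans (S.side-count e) (cong (2 *_) (edge-count≡1 e i p))

  norm∈edgesH : ∀ x {e₀} → e₀ ∈ ES → sameEdge x e₀ ≡ true → norm x ∈ edgesH
  norm∈edgesH x i p = subst (_∈ edgesH) (sym (sameEdge⇒norm≡ x _ p)) (MemP.∈-map⁺ norm i)

  edgesH⇒sameEdge : ∀ {e} → e ∈ edgesH → ∃ λ e₀ → e₀ ∈ ES × sameEdge e e₀ ≡ true × norm e ≡ e
  edgesH⇒sameEdge i with MemP.∈-map⁻ norm i
  ... | e₀ , j , refl = e₀ , j , norm≡⇒sameEdge (norm e₀) e₀ (norm-idem e₀) , norm-idem e₀

  edge-degree : All (λ e → length (trisAt TS e) ≡ 1 ⊎ length (trisAt TS e) ≡ 2) edgesH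
  edge-degree = All.tabulate λ {e} i → let (e₀ , j , p , _) = edgesH⇒sameEdge i in
    subst (λ n → n ≡ 1 ⊎ n ≡ 2) (sym (length-trisAt TS e))
      (t+o≡2⇒t≡1⊎t≡2 (triCount e TS) (countᵇ (sameEdge e) open′) (side-count₂ e j p) (open-count≤1 e))

  vertex-on-triangle : (w : Fin m) → Any (w ∈T_) TS
  vertex-on-triangle w with S.vert-on-edge (all-verts w)
  ... | e , i , on with 1≤countᵇ⇒∃ _ TS (t+o≡2c⇒1≤t (triCount e TS) (countᵇ (sameEdge e) open′) (countᵇ (sameEdge e) ES) (S.side-count e)
                                           (∈⇒1≤countᵇ (sameEdge e) ES i (sameEdge-refl e)) (open-count≤1 e))
  ... | t , t∈ , h = Any.map (λ { refl → Sum.[ (λ { refl → proj₁ ends }) , (λ { refl → proj₂ ends }) ] on }) t∈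
    where ends = triEdges-endpoints e t h

  triangle-sides : All (λ t → All (_∈ edgesH) (triEdges t)) TS
  triangle-sides = All.tabulate λ {t} t∈ → All.tabulate λ {e} e∈ →
    let on-edge = t+o≡2c⇒1≤c (triCount e TS) (countᵇ (sameEdge e) open′) (countᵇ (sameEdge e) ES) (S.side-count e)
                             (∈⇒1≤countᵇ _ TS t∈ (side-on-triangle t e∈))
        (e₀ , j , p) = 1≤countᵇ⇒∃ (sameEdge e) ES on-edge
    in subst (_∈ edgesH) (canonical-side (All.lookup S.tris-canonical t∈) e∈) (norm∈edgesH e j p)

  link-connected : ∀ w → Connected (LinkEdge TS w)
  link-connected w with DecMem._∈?_ FinP._≟_ w CR
  ... | yes w∈CR = proj₁ (S.apex-link w w∈CR)
  ... | no w∉CR = Connected-resp (S.star-connected w) inj₁ (λ { (inj₁ l) → l ; (inj₂ c) → ⊥-elim (w∉CR (corner⇒apex c)) })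
    where
    corner⇒apex : ∀ {x y} → FrontCorner (C ∷ B ∷ []) w x y → w ∈ CR
    corner⇒apex (here (i , _)) = C⊆CR (cycleEdges-∈₂ C i)
    corner⇒apex (there (here (i , _))) = B⊆CR (cycleEdges-∈₂ B i)

  link-reach : (v : Fin m) (e f : Fin m × Fin m) → e ∈ link TS v → f ∈ link TS v → Reach (link TS v) (proj₁ e) (proj₁ f)
  link-reach v (e₁ , e₂) (f₁ , f₂) i j = LinkPath⇒Reach (link-connected v (e₂ , inj₁ (mkLinkEdge i)) (f₂ , inj₁ (mkLinkEdge j)))

  once? : (e : Fin m × Fin m) → Dec (T ⌊ length (trisAt TS e) ≟ℕ 1 ⌋)
  once? e = Boolₚ.T? (⌊ length (trisAt TS e) ≟ℕ 1 ⌋)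

  boundary⊆ : ∀ {x} → x ∈ map norm boundary′ → x ∈ boundaryEdges TS edgesH
  boundary⊆ i with MemP.∈-map⁻ norm i
  ... | o , o∈ , refl =
    let e = norm o
        open-once = ∈⇒1≤countᵇ (sameEdge e) open′ (∈-resp-↭ (↭-sym open↭boundary) o∈) (norm≡⇒sameEdge e o (norm-idem o))
        on-edge = t+o≡2c⇒1≤c (countᵇ (sameEdge e) open′) (triCount e TS) (countᵇ (sameEdge e) ES)
                             (trans (+-comm _ (triCount e TS)) (S.side-count e)) open-once
        (e₀ , j , p) = 1≤countᵇ⇒∃ (sameEdge e) ES on-edge
        one-tri = t+o≡2⇒t≡1 (triCount e TS) (countᵇ (sameEdge e) open′) (side-count₂ e j p) open-once (open-count≤1 e)
    in MemP.∈-filter⁺ once? (subst (_∈ edgesH) (norm-idem o) (norm∈edgesH e j p))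
                             (fromWitness (trans (length-trisAt TS e) one-tri))

  boundary⊇ : ∀ {x} → x ∈ boundaryEdges TS edgesH → x ∈ map norm boundary′
  boundary⊇ {x} i with MemP.∈-filter⁻ once? {xs = edgesH} i
  ... | x∈ , once with edgesH⇒sameEdge x∈
  ... | e₀ , j , p , normal =
    let one-tri = trans (sym (length-trisAt TS x)) (toWitness once)
        (o , o∈ , q) = 1≤countᵇ⇒∃ (sameEdge x) open′ (t+o≡2⇒1≤o (triCount x TS) (countᵇ (sameEdge x) open′) (side-count₂ x j p) one-tri)
    in subst (_∈ map norm boundary′) (trans (sym (sameEdge⇒norm≡ x o q)) normal) (MemP.∈-map⁺ norm (∈-resp-↭ open↭boundary o∈))

  boundary↭ : map norm boundary′ ↭ boundaryEdges TS edgesH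
  boundary↭ = BagAndSet.∼bag⇒↭ (WithK.unique∧set⇒bag boundary-unique (Uniqueₚ.filter⁺ once? S.edges-unique) (mk⇔ boundary⊆ boundary⊇))

  triangulation : TriangulationS03D m TS edgesH A B C
  triangulation = record
    { edges-canon = All.tabulate λ i → let (e₀ , j , q) = MemP.∈-map⁻ norm i in
                      subst (λ e → proj₁ e Fin.< proj₂ e) (sym q) (norm-< e₀ (S.edge-no-loop j))
    ; edges-uniq = S.edges-unique
    ; tris-canon = S.tris-canonical
    ; tris-uniq = S.tris-unique
    ; vert-on-tri = vertex-on-triangle
    ; tri-sides = triangle-sides
    ; edge-deg = edge-degree
    ; link-conn = link-reach
    ; connected = λ x y → Reach-map-norm (S.reach (all-verts x) (all-verts y))
    ; euler = trans (cong (λ n → n + length TS + 1) (sym count-verts)) (trans S.euler (sym (length-map norm ES)))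
    ; a-uniq = A-unique
    ; b-uniq = B-unique
    ; c-uniq = C-unique
    ; a-len = A-length
    ; b-len = B-length
    ; c-len = C-length
    ; ab-disj = λ (p , q) → A∩B p q
    ; ac-disj = λ (p , q) → A∩C p q
    ; bc-disj = λ (p , q) → B∩C p q
    ; boundary = boundary↭
    }

record Triangulated (m : ℕ) (A : List (Fin m)) (lb lc : ℕ) : Set where
  field
    VS : List (Fin m)
    ES : List (Fin m × Fin m)
    TS : List (Tri m)
    B C : List (Fin m)
    triangulation : TriangulationS03D m TS (map norm ES) A B C
    B-length : length B ≡ lb
    C-length : length C ≡ lc
    henneberg : Henneberg0 A (cycleEdges A) VS ES
    verts↭ : VS ↭ allFin m

-- The vertices of the cycle A come first in Fin m, then the apex v0 of the split, then the vertices Y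
-- pushed off the front F₁ and finally those Z pushed off F₂; so each new vertex exceeds all earlier ones.
module Construction {a0 a1 aj v0 : Fin m} {P Q Y Z : List (Fin m)}
                    (layout : allFin m ≡ (a0 ∷ a1 ∷ P ++ aj ∷ Q) ++ v0 ∷ Y ++ Z)
                    (Y-length : length Y ≡ length (v0 ∷ a1 ∷ P ∷ʳ aj)) (Z-length : length Z ≡ length (v0 ∷ aj ∷ Q ∷ʳ a0)) where
  A : List (Fin m)
  A = a0 ∷ a1 ∷ P ++ aj ∷ Q

  whole : List (Fin m)
  whole = A ++ v0 ∷ Y ++ Z

  sorted : AllPairs Fin._<_ whole
  sorted = subst (AllPairs Fin._<_) layout (AllPairsₚ.tabulate⁺-< (λ i<j → i<j))

  whole-unique : Unique whole
  whole-unique = AllPairs.map FinP.<⇒≢ sorted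

  A<rest : All (λ x → All (x Fin.<_) (v0 ∷ Y ++ Z)) A
  A<rest = proj₂ (proj₂ (AllPairs-++⁻ A sorted))

  rest-sorted : AllPairs Fin._<_ (v0 ∷ Y ++ Z)
  rest-sorted = proj₁ (proj₂ (AllPairs-++⁻ A sorted))

  Y-sorted : AllPairs Fin._<_ Y
  Y-sorted = proj₁ (AllPairs-++⁻ Y (AllPairs.tail rest-sorted))

  Z-sorted : AllPairs Fin._<_ Z
  Z-sorted = proj₁ (proj₂ (AllPairs-++⁻ Y (AllPairs.tail rest-sorted)))

  Y<Z : All (λ x → All (x Fin.<_) Z) Y
  Y<Z = proj₂ (proj₂ (AllPairs-++⁻ Y (AllPairs.tail rest-sorted)))

  A-unique : Unique A
  A-unique = unique-++ˡ A whole-unique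

  A-length : 3 ≤ length A
  A-length = s≤s (s≤s (subst (1 ≤_) (sym (trans (length-++ P) (+-suc (length P) (length Q)))) (s≤s z≤n)))

  stage₁ : Stage A (v0 ∷ A) ((a0 , v0) ∷ (a1 , v0) ∷ (aj , v0) ∷ cycleEdges A) (tri a0 a1 v0 ∷ [])
                 ((v0 ∷ a1 ∷ P ∷ʳ aj) ∷ (v0 ∷ aj ∷ Q ∷ʳ a0) ∷ []) [] 1
  stage₁ = split v0 (initialStage A A-unique A-length) (All.map All.head A<rest)

  pushed₁ : PushedOff A (v0 ∷ A) [] ((v0 ∷ aj ∷ Q ∷ʳ a0) ∷ []) 1 Y Y (length (v0 ∷ a1 ∷ P ∷ʳ aj))
  pushed₁ = pushOff (v0 ∷ a1 ∷ P ∷ʳ aj) stage₁ Y Y-length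
              (AllP.++⁻ˡ Y (AllPairs.head rest-sorted) ∷ All.map (AllP.++⁻ˡ Y ∘ All.tail) A<rest) Y-sorted

  module P₁ = PushedOff pushed₁

  Z-fresh : All (λ u → All (u Fin.<_) Z) P₁.verts′
  Z-fresh = PermP.All-resp-↭ (↭-sym P₁.verts↭)
              (AllP.++⁺ (AllP.++⁻ʳ Y (AllPairs.head rest-sorted) ∷ All.map (AllP.++⁻ʳ Y ∘ All.tail) A<rest) Y<Z)

  pushed₂ : PushedOff A P₁.verts′ P₁.apexes′ (P₁.front ∷ []) 1 Z Z (length (v0 ∷ aj ∷ Q ∷ʳ a0))
  pushed₂ = pushOff (v0 ∷ aj ∷ Q ∷ʳ a0) (swapFronts P₁.stage) Z Z-length Z-fresh Z-sorted

  module P₂ = PushedOff pushed₂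

  verts↭whole : P₂.verts′ ↭ whole
  verts↭whole = begin
    P₂.verts′              ↭⟨ P₂.verts↭ ⟩
    P₁.verts′ ++ Z         ↭⟨ PermP.++⁺ʳ Z P₁.verts↭ ⟩
    ((v0 ∷ A) ++ Y) ++ Z   ≡⟨ cong (v0 ∷_) (++-assoc A Y Z) ⟩
    v0 ∷ A ++ Y ++ Z       ↭⟨ ↭-sym (PermP.shift v0 A (Y ++ Z)) ⟩
    whole                  ∎
    where open PermutationReasoning

  B⊆Y : ∀ {w} → w ∈ P₁.front → w ∈ Y
  B⊆Y = All.lookup P₁.front⊆

  C⊆Z : ∀ {w} → w ∈ P₂.front → w ∈ Z
  C⊆Z = All.lookup P₂.front⊆

  open Close P₂.stage
    (λ w → ∈-resp-↭ (↭-sym verts↭whole) (subst (w ∈_) layout (MemP.∈-allFin w)))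
    (trans (PermP.↭-length verts↭whole) (trans (cong length (sym layout)) (Listₚ.length-tabulate (λ i → i))))
    A-unique A-length
    (λ i j → unique-++-disjoint A whole-unique i (there (∈-++⁺ˡ (B⊆Y j))))
    (λ i j → unique-++-disjoint A whole-unique i (there (∈-++⁺ʳ Y (C⊆Z j))))
    (λ i j → unique-++-disjoint Y (AllPairs.tail (unique-++ʳ A whole-unique)) (B⊆Y i) (C⊆Z j))
    (λ i → ∈-resp-↭ (↭-sym P₂.apexes↭) (∈-++⁺ˡ (∈-resp-↭ (↭-sym P₁.apexes↭) (B⊆Y i))))
    (λ i → ∈-resp-↭ (↭-sym P₂.apexes↭) (∈-++⁺ʳ P₁.apexes′ (C⊆Z i)))

  triangulated : Triangulated m A (length Y) (length Z)
  triangulated = record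
    { VS = P₂.verts′ ; ES = P₂.edges′ ; TS = P₂.tris′ ; B = P₁.front ; C = P₂.front
    ; triangulation = triangulation
    ; B-length = trans P₁.front-length (sym Y-length)
    ; C-length = trans P₂.front-length (sym Z-length)
    ; henneberg = Stage.henneberg P₂.stage
    ; verts↭ = ↭-trans verts↭whole (↭-reflexive (sym layout))
    }

-- Sparsity counts and tightness of the join

module Sparsity {V : Set} (_≟V_ : DecidableEquality V) where

  inS : List V → V → Bool
  inS S x = any (λ y → ⌊ x ≟V y ⌋) S

  inS⇒∈ : ∀ S {x} → inS S x ≡ true → x ∈ S
  inS⇒∈ (y ∷ S) {x} h with x ≟V y
  ... | yes x≡y = here x≡y
  ... | no _ = there (inS⇒∈ S h)

  ∈⇒inS : ∀ S {x} → x ∈ S → inS S x ≡ true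
  ∈⇒inS (y ∷ S) {x} (here x≡y) rewrite ⌊⌋-true (x ≟V y) x≡y = refl
  ∈⇒inS (y ∷ S) {x} (there i) rewrite ∈⇒inS S i = ∨-zeroʳ _

  ∉⇒inS : ∀ S {x} → x ∉ S → inS S x ≡ false
  ∉⇒inS S x∉S = ¬-not (x∉S ∘ inS⇒∈ S)

  both : List V → V × V → Bool
  both S e = inS S (proj₁ e) ∧ inS S (proj₂ e)

  inducedEdges : List V → List (V × V) → ℕ
  inducedEdges S E = countᵇ (both S) E

  -- slack s bounds the edges of a simple graph on s ≤ 2 vertices (0, 0 and 1 edge), so that the bound
  -- e + 6 ≤ 3 s + slack s holds for every vertex set of a (3,6)-sparse simple graph.
  slack : ℕ → ℕ
  slack 0 = 6
  slack 1 = 3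
  slack 2 = 1
  slack _ = 0

  slack-≥3 : ∀ s → 3 ≤ s → slack s ≡ 0
  slack-≥3 (suc (suc (suc s))) _ = refl
  slack-≥3 (suc zero) (s≤s ())
  slack-≥3 (suc (suc zero)) (s≤s (s≤s ()))

  SparseCount : (V → Set) → List (V × V) → Set
  SparseCount Vm E = ∀ S → Unique S → All Vm S → inducedEdges S E + 6 ≤ 3 * length S + slack (length S)

  SparseCount-↭ : {Vm : V → Set} {E E' : List (V × V)} → E ↭ E' → SparseCount Vm E → SparseCount Vm E'
  SparseCount-↭ {E = E} E↭E' sparse S u S⊆ rewrite sym (countᵇ-↭ (both S) E↭E') = sparse S u S⊆

  remove : (S : List V) {x : V} → x ∈ S → Unique S →
           ∃ λ S' → length S ≡ suc (length S') × Unique S' × (∀ {y} → y ∈ S' → y ∈ S × y ≢ x) × (∀ {y} → y ∈ S → y ≢ x → y ∈ S')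
  remove (z ∷ S) (here refl) u = S , refl , AllPairs.tail u , (λ i → there i , λ e → Unique[x∷xs]⇒x∉xs u (subst (_∈ S) e i)) , rest
    where
    rest : ∀ {y} → y ∈ z ∷ S → y ≢ z → y ∈ S
    rest (here y≡z) y≢z = ⊥-elim (y≢z y≡z)
    rest (there i) _ = i
  remove (z ∷ S) (there i) u with remove S i (AllPairs.tail u)
  ... | S' , l , u' , sub , sup = z ∷ S' , cong suc l ,
        unique-∷ (λ j → Unique[x∷xs]⇒x∉xs u (proj₁ (sub j))) u' ,
        (λ { (here refl) → here refl , λ e → Unique[x∷xs]⇒x∉xs u (subst (_∈ S) (sym e) i) ; (there j) → Product.map₁ there (sub j) }) ,
        (λ { (here e) _ → here e ; (there j) y≢x → there (sup j y≢x) })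

  ∈⇒1≤length : ∀ {S : List V} {x} → x ∈ S → 1 ≤ length S
  ∈⇒1≤length (here _) = s≤s z≤n
  ∈⇒1≤length (there _) = s≤s z≤n

  distinct₂⇒2≤length : ∀ {S : List V} {x y} → Unique S → x ∈ S → y ∈ S → x ≢ y → 2 ≤ length S
  distinct₂⇒2≤length {S} u i j x≢y with remove S i u
  ... | _ , l , _ , _ , sup = subst (2 ≤_) (sym l) (s≤s (∈⇒1≤length (sup j (x≢y ∘ sym))))

  distinct₃⇒3≤length : ∀ {S : List V} {x y z} → Unique S → x ∈ S → y ∈ S → z ∈ S → x ≢ y → x ≢ z → y ≢ z → 3 ≤ length S
  distinct₃⇒3≤length {S} u i j k x≢y x≢z y≢z with remove S i u
  ... | _ , l , u' , _ , sup = subst (3 ≤_) (sym l) (s≤s (distinct₂⇒2≤length u' (sup j (x≢y ∘ sym)) (sup k (x≢z ∘ sym)) y≢z))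

  members≤length : ∀ (S : List V) w₁ w₂ w₃ → Unique S → w₁ ≢ w₂ → w₁ ≢ w₃ → w₂ ≢ w₃ →
                   indicator (inS S w₁) + indicator (inS S w₂) + indicator (inS S w₃) ≤ length S
  members≤length S w₁ w₂ w₃ u w₁≢w₂ w₁≢w₃ w₂≢w₃ with inS S w₁ in i₁ | inS S w₂ in i₂ | inS S w₃ in i₃
  ... | false | false | false = z≤n
  ... | true | false | false = ∈⇒1≤length (inS⇒∈ S i₁)
  ... | false | true | false = ∈⇒1≤length (inS⇒∈ S i₂)
  ... | false | false | true = ∈⇒1≤length (inS⇒∈ S i₃)
  ... | true | true | false = distinct₂⇒2≤length u (inS⇒∈ S i₁) (inS⇒∈ S i₂) w₁≢w₂
  ... | true | false | true = distinct₂⇒2≤length u (inS⇒∈ S i₁) (inS⇒∈ S i₃) w₁≢w₃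
  ... | false | true | true = distinct₂⇒2≤length u (inS⇒∈ S i₂) (inS⇒∈ S i₃) w₂≢w₃
  ... | true | true | true = distinct₃⇒3≤length u (inS⇒∈ S i₁) (inS⇒∈ S i₂) (inS⇒∈ S i₃) w₁≢w₂ w₁≢w₃ w₂≢w₃

  indicator₃≤3 : ∀ a b c → indicator a + indicator b + indicator c ≤ 3
  indicator₃≤3 a b c = ℕₚ.+-mono-≤ (ℕₚ.+-mono-≤ (bound a) (bound b)) (bound c)
    where
    bound : ∀ b → indicator b ≤ 1
    bound true = s≤s z≤n
    bound false = z≤n

  sparse-step : ∀ s k c → k ≤ 3 → k ≤ s → c + 6 ≤ 3 * s + slack s → k + c + 6 ≤ 3 * suc s + slack (suc s)
  sparse-step s k c k≤3 k≤s h = ℕₚ.≤-trans (ℕₚ.≤-reflexive (ℕₚ.+-assoc k c 6)) (by-size s k≤3 k≤s h)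
    where
    small : ∀ s → k ≤ s → c + 6 ≤ 3 * s + slack s → s + (3 * s + slack s) ≤ 3 * suc s + slack (suc s) → k + (c + 6) ≤ 3 * suc s + slack (suc s)
    small s k≤s h bound = ℕₚ.≤-trans (ℕₚ.+-mono-≤ k≤s h) bound
    by-size : ∀ s → k ≤ 3 → k ≤ s → c + 6 ≤ 3 * s + slack s → k + (c + 6) ≤ 3 * suc s + slack (suc s)
    by-size zero _ k≤s h = small 0 k≤s h (s≤s (s≤s (s≤s (s≤s (s≤s (s≤s z≤n))))))
    by-size (suc zero) _ k≤s h = small 1 k≤s h ℕₚ.≤-refl
    by-size (suc (suc zero)) _ k≤s h = small 2 k≤s h ℕₚ.≤-refl
    by-size (suc (suc (suc s))) k≤3 _ h =
      ℕₚ.≤-trans (ℕₚ.+-mono-≤ k≤3 (ℕₚ.≤-trans h (ℕₚ.≤-reflexive (ℕₚ.+-identityʳ _))))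
                 (ℕₚ.≤-reflexive (trans (arith s) (sym (ℕₚ.+-identityʳ _))))
      where
      arith : ∀ s → 3 + 3 * suc (suc (suc s)) ≡ 3 * suc (suc (suc (suc s)))
      arith = solve-∀

  -- A 0-extension adds a vertex v of degree 3: a vertex set S avoiding v spans no new edge, and one
  -- containing v spans at most min(3, |S| - 1) new edges, which the bound for S minus v absorbs.
  module ZeroExtension {Vm Vm' : V → Set} {E : List (V × V)} (sparse : SparseCount Vm E)
                       (E⊆Vm : ∀ {e} → e ∈ E → Vm (proj₁ e) × Vm (proj₂ e))
                       (v w₁ w₂ w₃ : V) (v∉Vm : ¬ Vm v) (w₁∈ : Vm w₁) (w₂∈ : Vm w₂) (w₃∈ : Vm w₃)
                       (w₁≢w₂ : w₁ ≢ w₂) (w₁≢w₃ : w₁ ≢ w₃) (w₂≢w₃ : w₂ ≢ w₃) (Vm'⊆ : ∀ {x} → Vm' x → x ≡ v ⊎ Vm x) where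
    E′ : List (V × V)
    E′ = (w₁ , v) ∷ (w₂ , v) ∷ (w₃ , v) ∷ E

    ≢v : ∀ {x} → Vm x → x ≢ v
    ≢v x∈ x≡v = v∉Vm (subst Vm x≡v x∈)

    true≢false : true ≢ false
    true≢false ()

    without-v : ∀ S → Unique S → All Vm' S → inS S v ≡ false → inducedEdges S E′ + 6 ≤ 3 * length S + slack (length S)
    without-v S u S⊆ v∉S = subst (λ n → n + 6 ≤ 3 * length S + slack (length S)) (sym induced-count) (sparse S u S⊆Vm)
      where
      no-edge : ∀ w → indicator (both S (w , v)) ≡ 0
      no-edge w = cong indicator (trans (cong (inS S w ∧_) v∉S) (Boolₚ.∧-zeroʳ (inS S w)))
      induced-count : inducedEdges S E′ ≡ inducedEdges S E
      induced-count = cong₂ _+_ (no-edge w₁) (cong₂ _+_ (no-edge w₂) (cong₂ _+_ (no-edge w₃) refl))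
      S⊆Vm : All Vm S
      S⊆Vm = All.tabulate λ i → Sum.[ (λ { refl → ⊥-elim (true≢false (trans (sym (∈⇒inS S i)) v∉S)) }) , (λ x∈ → x∈) ]
                                     (Vm'⊆ (All.lookup S⊆ i))

    module WithV (S : List V) (u : Unique S) (S⊆ : All Vm' S) (v∈S : inS S v ≡ true) where
      removed = remove S (inS⇒∈ S v∈S) u
      S' = proj₁ removed

      S-length : length S ≡ suc (length S')
      S-length = proj₁ (proj₂ removed)

      S'-unique : Unique S'
      S'-unique = proj₁ (proj₂ (proj₂ removed))

      S'⊆S : ∀ {y} → y ∈ S' → y ∈ S × y ≢ v
      S'⊆S = proj₁ (proj₂ (proj₂ (proj₂ removed)))

      S⊆S' : ∀ {y} → y ∈ S → y ≢ v → y ∈ S'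
      S⊆S' = proj₂ (proj₂ (proj₂ (proj₂ removed)))

      same-inS : ∀ {x} → x ≢ v → inS S x ≡ inS S' x
      same-inS x≢v = true⇔true⇒≡ (λ h → ∈⇒inS S' (S⊆S' (inS⇒∈ S h) x≢v)) (λ h → ∈⇒inS S (proj₁ (S'⊆S (inS⇒∈ S' h))))

      new-edge : ∀ {w} → Vm w → both S (w , v) ≡ inS S' w
      new-edge {w} w∈ = trans (cong (inS S w ∧_) v∈S) (trans (Boolₚ.∧-identityʳ (inS S w)) (same-inS (≢v w∈)))

      induced-count : inducedEdges S E′ ≡ indicator (inS S' w₁) + (indicator (inS S' w₂) + (indicator (inS S' w₃) + inducedEdges S' E))
      induced-count = cong₂ _+_ (cong indicator (new-edge w₁∈)) (cong₂ _+_ (cong indicator (new-edge w₂∈)) (cong₂ _+_ (cong indicator (new-edge w₃∈))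
        (countᵇ-cong (both S) (both S') E (λ e i → cong₂ _∧_ (same-inS (≢v (proj₁ (E⊆Vm i)))) (same-inS (≢v (proj₂ (E⊆Vm i))))))))

      S'⊆Vm : All Vm S'
      S'⊆Vm = All.tabulate λ i → let (i′ , y≢v) = S'⊆S i in Sum.[ ⊥-elim ∘ y≢v , (λ y∈ → y∈) ] (Vm'⊆ (All.lookup S⊆ i′))

      bound : inducedEdges S E′ + 6 ≤ 3 * length S + slack (length S)
      bound rewrite S-length | induced-count =
        subst (_≤ 3 * suc (length S') + slack (suc (length S')))
              (rearrange (indicator (inS S' w₁)) (indicator (inS S' w₂)) (indicator (inS S' w₃)) (inducedEdges S' E))
              (sparse-step (length S') _ (inducedEdges S' E) (indicator₃≤3 (inS S' w₁) (inS S' w₂) (inS S' w₃))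
                           (members≤length S' w₁ w₂ w₃ S'-unique w₁≢w₂ w₁≢w₃ w₂≢w₃)
                           (sparse S' S'-unique S'⊆Vm))
        where
        rearrange : ∀ a b c x → a + b + c + x + 6 ≡ a + (b + (c + x)) + 6
        rearrange = solve-∀

    sparse′ : SparseCount Vm' E′
    sparse′ S u S⊆ = by-v (inS S v) refl
      where
      by-v : ∀ b → inS S v ≡ b → inducedEdges S E′ + 6 ≤ 3 * length S + slack (length S)
      by-v false v∉S = without-v S u S⊆ v∉S
      by-v true v∈S = WithV.bound S u S⊆ v∈S

lookupAssoc-∉ : {m n : ℕ} (as : List (Fin m)) (ds : List (Fin n)) {u : Fin m} → u ∉ as → lookupAssoc (zip as ds) u ≡ nothing
lookupAssoc-∉ [] ds u∉ = refl
lookupAssoc-∉ (a ∷ as) [] u∉ = refl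
lookupAssoc-∉ (a ∷ as) (d ∷ ds) {u} u∉ rewrite ⌊⌋-false (u FinP.≟ a) (u∉ ∘ here) = lookupAssoc-∉ as ds (u∉ ∘ there)

lookupAssoc-∈ : {m n : ℕ} (as : List (Fin m)) (ds : List (Fin n)) → length as ≡ length ds →
                ∀ {u} → u ∈ as → ∃ λ x → lookupAssoc (zip as ds) u ≡ just x
lookupAssoc-∈ (a ∷ as) (d ∷ ds) l {u} i with u FinP.≟ a | i
... | yes _ | _ = d , refl
... | no u≢a | here u≡a = ⊥-elim (u≢a u≡a)
... | no _ | there j = lookupAssoc-∈ as ds (ℕₚ.suc-injective l) j

lookupAssoc-just : {m n : ℕ} (as : List (Fin m)) (ds : List (Fin n)) {u : Fin m} {x : Fin n} → lookupAssoc (zip as ds) u ≡ just x → x ∈ ds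
lookupAssoc-just (a ∷ as) (d ∷ ds) {u} h with u FinP.≟ a
lookupAssoc-just (a ∷ as) (d ∷ ds) {u} refl | yes _ = here refl
... | no _ = there (lookupAssoc-just as ds h)

lookupAssoc-injective : {m n : ℕ} (as : List (Fin m)) (ds : List (Fin n)) → Unique ds → {u u' : Fin m} {x : Fin n} →
                        lookupAssoc (zip as ds) u ≡ just x → lookupAssoc (zip as ds) u' ≡ just x → u ≡ u'
lookupAssoc-injective (a ∷ as) (d ∷ ds) ud {u} {u'} h h' with u FinP.≟ a | u' FinP.≟ a
... | yes u≡a | yes u'≡a = trans u≡a (sym u'≡a)
lookupAssoc-injective (a ∷ as) (d ∷ ds) ud refl h' | yes _ | no _ = ⊥-elim (Unique[x∷xs]⇒x∉xs ud (lookupAssoc-just as ds h'))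
lookupAssoc-injective (a ∷ as) (d ∷ ds) ud h refl | no _ | yes _ = ⊥-elim (Unique[x∷xs]⇒x∉xs ud (lookupAssoc-just as ds h))
... | no _ | no _ = lookupAssoc-injective as ds (AllPairs.tail ud) h h'

module BaseSparsity {n : ℕ} (G : Graph (Fin n)) (fg : FinGraph n G) (simple : IsSimple G) (sparse : Sparse36 G) where
  open Sparsity (FinP._≟_ {n})

  edge-< : ∀ {e} → e ∈ edges G → proj₁ e Fin.< proj₂ e
  edge-< = All.lookup (proj₁ simple)

  induced-subgraph : (S : List (Fin n)) → Unique S → Subgraph G
  induced-subgraph S u = record
    { S = S ; E' = filterᵇ (both S) (edges G) ; S-uniq = u
    ; S-sub = All.tabulate λ {x} _ → subst (x ∈_) (sym fg) (MemP.∈-allFin x)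
    ; E'-sub = SubListₚ.filter-⊆ (Boolₚ.T? ∘ both S) (edges G)
    ; E'-in = All.tabulate λ {e} i →
        let (in₁ , in₂) = T-∧⇒≡true (proj₂ (MemP.∈-filter⁻ (Boolₚ.T? ∘ both S) {xs = edges G} i)) in inS⇒∈ S in₁ , inS⇒∈ S in₂
    }

  large-sets : ∀ S → Unique S → 3 ≤ length S → inducedEdges S (edges G) + 6 ≤ 3 * length S
  large-sets S u l = subst (_≤ 3 * length S) (trans (cong (6 +_) (length-filterᵇ (both S) (edges G))) (+-comm 6 _))
                           (sparse (induced-subgraph S u) l)

  no-loop : ∀ {x e} → e ∈ edges G → proj₁ e ≡ x → proj₂ e ≡ x → ⊥
  no-loop i refl refl = FinP.<-irrefl refl (edge-< i)

  small-sets : ∀ S → Unique S → length S ≤ 2 → inducedEdges S (edges G) + 6 ≤ 3 * length S + slack (length S)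
  small-sets [] u _ = ℕₚ.≤-reflexive (cong (_+ 6) (countᵇ-none _ (edges G) (λ e _ → refl)))
  small-sets (x ∷ []) u _ = ℕₚ.≤-reflexive (cong (_+ 6) (countᵇ-none _ (edges G) no-edge))
    where
    no-edge : ∀ e → e ∈ edges G → both (x ∷ []) e ≡ false
    no-edge e i with inS (x ∷ []) (proj₁ e) in i₁ | inS (x ∷ []) (proj₂ e) in i₂
    ... | false | _ = refl
    ... | true | false = refl
    ... | true | true with inS⇒∈ (x ∷ []) i₁ | inS⇒∈ (x ∷ []) i₂
    ...   | here p | here q = ⊥-elim (no-loop i p q)
  small-sets (x ∷ y ∷ []) u _ = ℕₚ.+-monoˡ-≤ 6 (countᵇ≤1 (λ e → e) (both (x ∷ y ∷ [])) (edges G)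
                                                 (subst Unique (sym (Listₚ.map-id (edges G))) (proj₂ simple)) same-edge)
    where
    in-pair : ∀ {z} → inS (x ∷ y ∷ []) z ≡ true → z ≡ x ⊎ z ≡ y
    in-pair h with inS⇒∈ (x ∷ y ∷ []) h
    ... | here p = inj₁ p
    ... | there (here p) = inj₂ p
    ends : ∀ {e} → both (x ∷ y ∷ []) e ≡ true → (proj₁ e ≡ x ⊎ proj₁ e ≡ y) × (proj₂ e ≡ x ⊎ proj₂ e ≡ y)
    ends {e} h = let (h₁ , h₂) = ∧≡true⇒≡true h in in-pair h₁ , in-pair h₂
    same-edge : ∀ {e f} → e ∈ edges G → f ∈ edges G → both (x ∷ y ∷ []) e ≡ true → both (x ∷ y ∷ []) f ≡ true → e ≡ f
    same-edge {e₁ , e₂} {f₁ , f₂} i j p q with ends {e₁ , e₂} p | ends {f₁ , f₂} q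
    ... | inj₁ refl , inj₁ refl | _ = ⊥-elim (no-loop i refl refl)
    ... | inj₂ refl , inj₂ refl | _ = ⊥-elim (no-loop i refl refl)
    ... | _ | inj₁ refl , inj₁ refl = ⊥-elim (no-loop j refl refl)
    ... | _ | inj₂ refl , inj₂ refl = ⊥-elim (no-loop j refl refl)
    ... | inj₁ refl , inj₂ refl | inj₁ refl , inj₂ refl = refl
    ... | inj₂ refl , inj₁ refl | inj₂ refl , inj₁ refl = refl
    ... | inj₁ refl , inj₂ refl | inj₂ refl , inj₁ refl = ⊥-elim (FinP.<-asym (edge-< i) (edge-< j))
    ... | inj₂ refl , inj₁ refl | inj₁ refl , inj₂ refl = ⊥-elim (FinP.<-asym (edge-< i) (edge-< j))
  small-sets (x ∷ y ∷ z ∷ S) u (s≤s (s≤s ()))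

  sparse-count : SparseCount (λ _ → ⊤) (edges G)
  sparse-count S u _ with length S ≤?ℕ 2
  ... | yes l = small-sets S u l
  ... | no l = subst (λ s → inducedEdges S (edges G) + 6 ≤ 3 * length S + s) (sym (slack-≥3 (length S) (ℕₚ.≰⇒> l)))
                     (ℕₚ.≤-trans (large-sets S u (ℕₚ.≰⇒> l)) (ℕₚ.m≤m+n _ 0))

inj₁≟inj₁ : {n m : ℕ} (i y : Fin n) → ⌊ Sumₚ.≡-dec FinP._≟_ FinP._≟_ (inj₁ {B = Fin m} i) (inj₁ y) ⌋ ≡ ⌊ i FinP.≟ y ⌋
inj₁≟inj₁ i y with i FinP.≟ y
... | yes _ = refl
... | no _ = refl

module JoinTight {n m : ℕ} (G : Graph (Fin n)) (fg : FinGraph n G) (simple : IsSimple G) (tight : Tight36 G)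
                 (d : List (Fin n)) (d-unique : Unique d) (a : List (Fin m)) (a-length : length a ≡ length d) where
  open Sparsity (Sumₚ.≡-dec (FinP._≟_ {n}) (FinP._≟_ {m}))
  private
    module Sₙ = Sparsity (FinP._≟_ {n})
    module Sₘ = Sparsity (FinP._≟_ {m})

  V₊ : Set
  V₊ = Fin n ⊎ Fin m

  φ : Fin m → V₊
  φ = joinMap d a

  φ-outside : ∀ {u} → u ∉ a → φ u ≡ inj₂ u
  φ-outside u∉a rewrite lookupAssoc-∉ a d u∉a = refl

  φ-on-a : ∀ {u} → u ∈ a → ∃ λ x → φ u ≡ inj₁ x
  φ-on-a u∈a with lookupAssoc-∈ a d a-length u∈a
  ... | x , e rewrite e = x , refl

  φ-injective : ∀ {u u'} → φ u ≡ φ u' → u ≡ u'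
  φ-injective {u} {u'} h with lookupAssoc (zip a d) u in e | lookupAssoc (zip a d) u' in e'
  φ-injective refl | just x | just .x = lookupAssoc-injective a d d-unique e e'
  φ-injective refl | nothing | nothing = refl

  InJoin : List (Fin m) → V₊ → Set
  InJoin vs x = (∃ λ i → x ≡ inj₁ i) ⊎ (∃ λ u → x ≡ inj₂ u × u ∈ vs × u ∉ a)

  InJoin-∷ : ∀ {v vs x} → InJoin vs x → InJoin (v ∷ vs) x
  InJoin-∷ = Sum.map₂ λ (u , e , i , u∉a) → u , e , there i , u∉a

  InJoin-φ : ∀ {vs u} → u ∈ vs → InJoin vs (φ u)
  InJoin-φ {u = u} i with DecMem._∈?_ FinP._≟_ u a
  ... | yes u∈a = inj₁ (φ-on-a u∈a)
  ... | no u∉a = inj₂ (u , φ-outside u∉a , i , u∉a)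

  G-edges : List (V₊ × V₊)
  G-edges = map (λ e → inj₁ (proj₁ e) , inj₁ (proj₂ e)) (edges G)

  φ₂ : Fin m × Fin m → V₊ × V₊
  φ₂ e = φ (proj₁ e) , φ (proj₂ e)

  off-a : Fin m × Fin m → Bool
  off-a e = not (any (sameEdge e) (cycleEdges a))

  outside-a : Fin m → Bool
  outside-a u = not (memb u a)

  joinEdges : List (Fin m × Fin m) → List (V₊ × V₊)
  joinEdges es = G-edges ++ map φ₂ (filterᵇ off-a es)

  inS-inj₁ : ∀ S₀ i → inS (map inj₁ S₀) (inj₁ i) ≡ Sₙ.inS S₀ i
  inS-inj₁ [] i = refl
  inS-inj₁ (y ∷ S₀) i = cong₂ _∨_ (inj₁≟inj₁ i y) (inS-inj₁ S₀ i)

  all-inj₁ : (S : List V₊) → All (λ x → ∃ λ i → x ≡ inj₁ i) S → ∃ λ S₀ → S ≡ map inj₁ S₀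
  all-inj₁ [] [] = [] , refl
  all-inj₁ (_ ∷ S) ((i , refl) ∷ S⊆) = let (S₀ , e) = all-inj₁ S S⊆ in i ∷ S₀ , cong (inj₁ i ∷_) e

  G-sparse : SparseCount (λ x → ∃ λ i → x ≡ inj₁ i) G-edges
  G-sparse S u S⊆ with all-inj₁ S S⊆
  ... | S₀ , refl = subst₂ (λ c s → c + 6 ≤ 3 * s + slack s) (sym induced) (sym (length-map inj₁ S₀))
                      (BaseSparsity.sparse-count G fg simple (proj₁ tight) S₀ (Uniqueₚ.map⁻ u) (All.tabulate (λ _ → tt)))
    where
    induced : inducedEdges (map inj₁ S₀) G-edges ≡ Sₙ.inducedEdges S₀ (edges G)
    induced = trans (countᵇ-map (both (map inj₁ S₀)) _ (edges G))
                    (countᵇ-cong _ _ (edges G) (λ e _ → cong₂ _∧_ (inS-inj₁ S₀ (proj₁ e)) (inS-inj₁ S₀ (proj₂ e))))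

  off-a-cycle : ∀ {e} → e ∈ cycleEdges a → off-a e ≡ false
  off-a-cycle {e} i rewrite any-∈ (sameEdge e) (cycleEdges a) i (sameEdge-refl e) = refl

  off-a-norm : ∀ e → off-a (norm e) ≡ off-a e
  off-a-norm e = cong not (any-cong _ _ (cycleEdges a) (λ f → sameEdge-respˡ (norm e) e f (norm-SameEdge e)))

  both-norm : ∀ S e → both S (φ₂ (norm e)) ≡ both S (φ₂ e)
  both-norm S e with norm e | norm-SameEdge e
  ... | .e | inj₁ refl = refl
  ... | .(swap e) | inj₂ refl = Boolₚ.∧-comm (inS S (φ (proj₂ e))) (inS S (φ (proj₁ e)))

  record JoinStage (vs : List (Fin m)) (es : List (Fin m × Fin m)) : Set where
    field
      sparse : SparseCount (InJoin vs) (joinEdges es)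
      endpoints : ∀ {e} → e ∈ joinEdges es → InJoin vs (proj₁ e) × InJoin vs (proj₂ e)
      edge-count : countᵇ off-a es ≡ 3 * countᵇ outside-a vs
      a⊆ : ∀ {x} → x ∈ a → x ∈ vs

  joinStage-cycle : JoinStage a (cycleEdges a)
  joinStage-cycle = record
    { sparse = subst (SparseCount (InJoin a)) (sym only-G) (λ S u S⊆ → G-sparse S u (All.map on-G S⊆))
    ; endpoints = λ {e} i → G-endpoints (subst (e ∈_) only-G i)
    ; edge-count = trans (countᵇ-none off-a (cycleEdges a) (λ _ → off-a-cycle))
                         (cong (3 *_) (sym (countᵇ-none outside-a a (λ u i → cong not (Sₘ.∈⇒inS a {u} i)))))
    ; a⊆ = λ i → i
    }
    where
    only-G : joinEdges (cycleEdges a) ≡ G-edges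
    only-G = trans (cong (λ es → G-edges ++ map φ₂ es) (filterᵇ-none off-a (cycleEdges a) off-a-cycle)) (Listₚ.++-identityʳ G-edges)
    on-G : ∀ {x} → InJoin a x → ∃ λ i → x ≡ inj₁ i
    on-G (inj₁ p) = p
    on-G (inj₂ (u , _ , i , u∉a)) = ⊥-elim (u∉a i)
    G-endpoints : ∀ {e} → e ∈ G-edges → InJoin a (proj₁ e) × InJoin a (proj₂ e)
    G-endpoints i with MemP.∈-map⁻ _ i
    ... | (x , y) , _ , refl = inj₁ (x , refl) , inj₁ (y , refl)

  module JoinExt {vs : List (Fin m)} {es : List (Fin m × Fin m)} (stage : JoinStage vs es) (v w₁ w₂ w₃ : Fin m) (v∉vs : v ∉ vs)
                 (w₁∈ : w₁ ∈ vs) (w₂∈ : w₂ ∈ vs) (w₃∈ : w₃ ∈ vs) (w₁≢w₂ : w₁ ≢ w₂) (w₁≢w₃ : w₁ ≢ w₃) (w₂≢w₃ : w₂ ≢ w₃) where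
    private
      module J = JoinStage stage

    es′ : List (Fin m × Fin m)
    es′ = (w₁ , v) ∷ (w₂ , v) ∷ (w₃ , v) ∷ es

    v∉a : v ∉ a
    v∉a = v∉vs ∘ J.a⊆

    new-edge-off-a : ∀ {w e} → e ∈ cycleEdges a → ¬ SameEdge (w , v) e
    new-edge-off-a i (inj₁ refl) = v∉a (cycleEdges-∈₂ a i)
    new-edge-off-a i (inj₂ refl) = v∉a (cycleEdges-∈₁ a i)

    off-a-new : ∀ w → off-a (w , v) ≡ true
    off-a-new w rewrite any-none (sameEdge (w , v)) (cycleEdges a) (λ {e} i → sameEdge-false (w , v) e (new-edge-off-a i)) = refl

    new-joinEdges : joinEdges es′ ≡ G-edges ++ φ₂ (w₁ , v) ∷ φ₂ (w₂ , v) ∷ φ₂ (w₃ , v) ∷ map φ₂ (filterᵇ off-a es)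
    new-joinEdges = cong (λ es → G-edges ++ map φ₂ es)
      (trans (filterᵇ-accept off-a ((w₂ , v) ∷ (w₃ , v) ∷ es) (off-a-new w₁))
        (cong ((w₁ , v) ∷_) (trans (filterᵇ-accept off-a ((w₃ , v) ∷ es) (off-a-new w₂))
          (cong ((w₂ , v) ∷_) (filterᵇ-accept off-a es (off-a-new w₃))))))

    joinEdges↭ : joinEdges es′ ↭ (φ w₁ , φ v) ∷ (φ w₂ , φ v) ∷ (φ w₃ , φ v) ∷ joinEdges es
    joinEdges↭ = subst (_↭ (φ w₁ , φ v) ∷ (φ w₂ , φ v) ∷ (φ w₃ , φ v) ∷ joinEdges es) (sym new-joinEdges)
                   (PermP.shifts G-edges (φ₂ (w₁ , v) ∷ φ₂ (w₂ , v) ∷ φ₂ (w₃ , v) ∷ []))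

    φv∉ : ¬ InJoin vs (φ v)
    φv∉ x rewrite φ-outside v∉a with x
    ... | inj₂ (u , refl , i , _) = v∉vs i

    InJoin-new : ∀ {x} → InJoin (v ∷ vs) x → x ≡ φ v ⊎ InJoin vs x
    InJoin-new (inj₁ p) = inj₂ (inj₁ p)
    InJoin-new (inj₂ (u , e , here refl , _)) = inj₁ (trans e (sym (φ-outside v∉a)))
    InJoin-new (inj₂ (u , e , there i , u∉a)) = inj₂ (inj₂ (u , e , i , u∉a))

    φv∈ : InJoin (v ∷ vs) (φ v)
    φv∈ = inj₂ (v , φ-outside v∉a , here refl , v∉a)

    endpoints′ : ∀ {e} → e ∈ (φ w₁ , φ v) ∷ (φ w₂ , φ v) ∷ (φ w₃ , φ v) ∷ joinEdges es → InJoin (v ∷ vs) (proj₁ e) × InJoin (v ∷ vs) (proj₂ e)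
    endpoints′ (here refl) = InJoin-∷ (InJoin-φ w₁∈) , φv∈
    endpoints′ (there (here refl)) = InJoin-∷ (InJoin-φ w₂∈) , φv∈
    endpoints′ (there (there (here refl))) = InJoin-∷ (InJoin-φ w₃∈) , φv∈
    endpoints′ (there (there (there i))) = Product.map InJoin-∷ InJoin-∷ (J.endpoints i)

    edge-count′ : countᵇ off-a es′ ≡ 3 * countᵇ outside-a (v ∷ vs)
    edge-count′ rewrite off-a-new w₁ | off-a-new w₂ | off-a-new w₃ | J.edge-count | Sₘ.∉⇒inS a v∉a =
      three-more (countᵇ outside-a vs)
      where
      three-more : ∀ c → 1 + (1 + (1 + 3 * c)) ≡ 3 * (1 + c)
      three-more = solve-∀

    stage′ : JoinStage (v ∷ vs) es′
    stage′ = record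
      { sparse = SparseCount-↭ (↭-sym joinEdges↭)
          (ZeroExtension.sparse′ J.sparse J.endpoints (φ v) (φ w₁) (φ w₂) (φ w₃) φv∉ (InJoin-φ w₁∈) (InJoin-φ w₂∈) (InJoin-φ w₃∈)
                                 (w₁≢w₂ ∘ φ-injective) (w₁≢w₃ ∘ φ-injective) (w₂≢w₃ ∘ φ-injective) InJoin-new)
      ; endpoints = endpoints′ ∘ ∈-resp-↭ joinEdges↭
      ; edge-count = edge-count′
      ; a⊆ = there ∘ J.a⊆
      }

  joinStage : ∀ {vs es} → Henneberg0 a (cycleEdges a) vs es → JoinStage vs es
  joinStage base = joinStage-cycle
  joinStage (ext v w₁ w₂ w₃ h v∉ w₁∈ w₂∈ w₃∈ w₁≢w₂ w₁≢w₃ w₂≢w₃) =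
    JoinExt.stage′ (joinStage h) v w₁ w₂ w₃ v∉ w₁∈ w₂∈ w₃∈ w₁≢w₂ w₁≢w₃ w₂≢w₃

  module Joined {VS : List (Fin m)} {ES : List (Fin m × Fin m)} (hen : Henneberg0 a (cycleEdges a) VS ES) (VS↭ : VS ↭ allFin m) where
    private
      module J = JoinStage (joinStage hen)

    G⁺ : Graph (Fin n ⊎ Fin m)
    G⁺ = join G d a (map norm ES)

    same-induced : ∀ S → inducedEdges S (edges G⁺) ≡ inducedEdges S (joinEdges ES)
    same-induced S = begin
      inducedEdges S (edges G⁺)
        ≡⟨ countᵇ-++ (both S) G-edges _ ⟩
      inducedEdges S G-edges + countᵇ (both S) (map φ₂ (filterᵇ off-a (map norm ES)))
        ≡⟨ cong (inducedEdges S G-edges +_) (begin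
             countᵇ (both S) (map φ₂ (filterᵇ off-a (map norm ES)))   ≡⟨ countᵇ-map-filterᵇ (both S) φ₂ off-a (map norm ES) ⟩
             countᵇ (λ e → off-a e ∧ both S (φ₂ e)) (map norm ES)      ≡⟨ countᵇ-map _ norm ES ⟩
             countᵇ (λ e → off-a (norm e) ∧ both S (φ₂ (norm e))) ES   ≡⟨ countᵇ-cong _ _ ES (λ e _ → cong₂ _∧_ (off-a-norm e) (both-norm S e)) ⟩
             countᵇ (λ e → off-a e ∧ both S (φ₂ e)) ES                 ≡⟨ countᵇ-map-filterᵇ (both S) φ₂ off-a ES ⟨
             countᵇ (both S) (map φ₂ (filterᵇ off-a ES))               ∎) ⟩
      inducedEdges S G-edges + countᵇ (both S) (map φ₂ (filterᵇ off-a ES))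
        ≡⟨ countᵇ-++ (both S) G-edges _ ⟨
      inducedEdges S (joinEdges ES) ∎
      where open ≡-Reasoning

    InJoin-verts : ∀ {x} → x ∈ verts G⁺ → InJoin VS x
    InJoin-verts i with ∈-++⁻ (map inj₁ (verts G)) i
    ... | inj₁ j with MemP.∈-map⁻ inj₁ j
    ...   | y , _ , refl = inj₁ (y , refl)
    InJoin-verts i | inj₂ j with MemP.∈-map⁻ inj₂ j
    ... | u , k , refl with MemP.∈-filter⁻ (Boolₚ.T? ∘ outside-a) {xs = allFin m} k
    ...   | u∈ , outside = inj₂ (u , refl , ∈-resp-↭ (↭-sym VS↭) u∈ ,
                                 λ u∈a → subst (T ∘ not) (Sₘ.∈⇒inS a u∈a) outside)

    sparse : Sparse36 G⁺
    sparse sub l = let S = Subgraph.S sub in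
      ℕₚ.≤-trans (ℕₚ.≤-reflexive (+-comm 6 _))
        (ℕₚ.≤-trans (ℕₚ.+-monoˡ-≤ 6 (ℕₚ.≤-trans (⊆⇒length≤countᵇ (both S) (Subgraph.E'-sub sub)
                                                  (All.map (λ (p , q) → cong₂ _∧_ (∈⇒inS S p) (∈⇒inS S q)) (Subgraph.E'-in sub)))
                                                (ℕₚ.≤-reflexive (same-induced S))))
          (ℕₚ.≤-trans (J.sparse S (Subgraph.S-uniq sub) (All.map InJoin-verts (Subgraph.S-sub sub)))
            (ℕₚ.≤-reflexive (trans (cong (3 * length S +_) (slack-≥3 (length S) l)) (ℕₚ.+-identityʳ _)))))

    edge-count : 6 + length (edges G⁺) ≡ 3 * length (verts G⁺)
    edge-count = begin
      6 + length (edges G⁺)                                        ≡⟨ cong (6 +_) edges-length ⟩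
      6 + (length (edges G) + 3 * countᵇ outside-a VS)             ≡⟨ +-assoc 6 (length (edges G)) (3 * countᵇ outside-a VS) ⟨
      6 + length (edges G) + 3 * countᵇ outside-a VS               ≡⟨ cong (_+ 3 * countᵇ outside-a VS) (proj₂ tight) ⟩
      3 * length (verts G) + 3 * countᵇ outside-a VS               ≡⟨ ℕₚ.*-distribˡ-+ 3 (length (verts G)) (countᵇ outside-a VS) ⟨
      3 * (length (verts G) + countᵇ outside-a VS)                 ≡⟨ cong (3 *_) verts-length ⟨
      3 * length (verts G⁺)                                        ∎
      where
      open ≡-Reasoning
      edges-length : length (edges G⁺) ≡ length (edges G) + 3 * countᵇ outside-a VS
      edges-length = trans (length-++ G-edges) (cong₂ _+_ (length-map _ (edges G))
        (trans (length-map φ₂ (filterᵇ off-a (map norm ES))) (trans (length-filterᵇ off-a (map norm ES))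
          (trans (countᵇ-map off-a norm ES) (trans (countᵇ-cong _ _ ES (λ e _ → off-a-norm e)) J.edge-count)))))
      verts-length : length (verts G⁺) ≡ length (verts G) + countᵇ outside-a VS
      verts-length = trans (length-++ (map inj₁ (verts G))) (cong₂ _+_ (length-map inj₁ (verts G))
        (trans (length-map inj₂ (filterᵇ outside-a (allFin m))) (trans (length-filterᵇ outside-a (allFin m)) (countᵇ-↭ outside-a (↭-sym VS↭)))))

    tight⁺ : Tight36 G⁺
    tight⁺ = sparse , edge-count

-- Laying out the vertices

split-length : (xs : List X) (k r : ℕ) → length xs ≡ k + r → ∃ λ ys → ∃ λ zs → xs ≡ ys ++ zs × length ys ≡ k × length zs ≡ r
split-length xs zero r l = [] , xs , refl , refl , l
split-length (x ∷ xs) (suc k) r l with split-length xs k r (ℕₚ.suc-injective l)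
... | ys , zs , refl , ys-length , zs-length = x ∷ ys , zs , refl , cong suc ys-length , zs-length

split-head : (xs : List X) (r : ℕ) → length xs ≡ suc r → ∃ λ y → ∃ λ zs → xs ≡ y ∷ zs × length zs ≡ r
split-head (y ∷ zs) r l = y , zs , refl , ℕₚ.suc-injective l

record Layout (L : List (Fin m)) (p q lb lc : ℕ) : Set where
  field
    a0 a1 aj v0 : Fin m
    P Q Y Z : List (Fin m)
    decomposition : L ≡ (a0 ∷ a1 ∷ P ++ aj ∷ Q) ++ v0 ∷ Y ++ Z
    P-length : length P ≡ p
    Q-length : length Q ≡ q
    Y-length : length Y ≡ lb
    Z-length : length Z ≡ lc

layout : (p q lb lc : ℕ) (L : List (Fin m)) → length L ≡ suc (suc (p + suc (q + suc (lb + lc)))) → Layout L p q lb lc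
layout p q lb lc L l with split-head L _ l
... | a0 , L₁ , refl , l₁ with split-head L₁ _ l₁
... | a1 , L₂ , refl , l₂ with split-length L₂ p _ l₂
... | P , L₃ , refl , P-length , l₃ with split-head L₃ _ l₃
... | aj , L₄ , refl , l₄ with split-length L₄ q _ l₄
... | Q , L₅ , refl , Q-length , l₅ with split-head L₅ _ l₅
... | v0 , L₆ , refl , l₆ with split-length L₆ lb lc l₆
... | Y , Z , refl , Y-length , Z-length = record
  { a0 = a0 ; a1 = a1 ; aj = aj ; v0 = v0 ; P = P ; Q = Q ; Y = Y ; Z = Z
  ; decomposition = cong (λ xs → a0 ∷ a1 ∷ xs) (sym (++-assoc P (aj ∷ Q) (v0 ∷ Y ++ Z)))
  ; P-length = P-length ; Q-length = Q-length ; Y-length = Y-length ; Z-length = Z-length }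

-- H has vertex set Fin size with size = |d| + 1 + lb + lc, laid out as in Construction with |P| = lb - 3 and
-- |Q| = lc - 3, so that the cycle A has length 3 + (lb - 3) + (lc - 3) = |d|.
module VertexLayout (lb lc : ℕ) (3≤lb : 3 ≤ lb) (3≤lc : 3 ≤ lc) where
  p q size : ℕ
  p = lb ∸ 3
  q = lc ∸ 3
  size = suc (suc (p + suc (q + suc (lb + lc))))

  open Layout (layout p q lb lc (allFin size) (Listₚ.length-tabulate (λ i → i))) public

  A : List (Fin size)
  A = a0 ∷ a1 ∷ P ++ aj ∷ Q

  front-length : (x y z : Fin size) (r : List (Fin size)) {l : ℕ} → 3 ≤ l → length r ≡ l ∸ 3 → l ≡ length (x ∷ y ∷ r ∷ʳ z)
  front-length x y z r 3≤l r-length =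
    trans (sym (ℕₚ.m+[n∸m]≡n 3≤l)) (cong (suc ∘ suc) (sym (trans (length-∷ʳ r z) (cong suc r-length))))

  triangulated : Triangulated size A lb lc
  triangulated = subst₂ (Triangulated size A) Y-length Z-length
    (Construction.triangulated {a0 = a0} {a1 = a1} {aj = aj} {v0 = v0} {P = P} {Q = Q} {Y = Y} {Z = Z} decomposition
      (trans Y-length (front-length v0 a1 aj P 3≤lb P-length)) (trans Z-length (front-length v0 aj a0 Q 3≤lc Q-length)))

  A-length : ∀ k → 3 ≤ k → k ∸ 3 ≡ p + q → length A ≡ k
  A-length k 3≤k k∸3 = begin
    suc (suc (length (P ++ aj ∷ Q)))      ≡⟨ cong (suc ∘ suc) (length-++ P) ⟩
    suc (suc (length P + suc (length Q))) ≡⟨ cong (suc ∘ suc) (+-suc (length P) (length Q)) ⟩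
    3 + (length P + length Q)             ≡⟨ cong (3 +_) (trans (cong₂ _+_ P-length Q-length) (sym k∸3)) ⟩
    3 + (k ∸ 3)                           ≡⟨ ℕₚ.m+[n∸m]≡n 3≤k ⟩
    k                                     ∎
    where open ≡-Reasoning

lemma4p2 : (n : ℕ) (G : Graph (Fin n)) → FinGraph n G → IsSimple G → Tight36 G →
           (d : List (Fin n)) → IsCycle G d →
           (lb lc : ℕ) → 3 ≤ lb → 3 ≤ lc → length d ∸ 3 ≡ (lb ∸ 3) + (lc ∸ 3) →
           ∃ λ (m : ℕ) → ∃ λ (ts : List (Tri m)) → ∃ λ (esH : List (Fin m × Fin m)) →
           ∃ λ (a : List (Fin m)) → ∃ λ (b : List (Fin m)) → ∃ λ (c : List (Fin m)) →
             TriangulationS03D m ts esH a b c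
             × length a ≡ length d × length b ≡ lb × length c ≡ lc
             × Tight36 (join G d a esH)
             × ObtainedFromCycle m a esH
lemma4p2 n G fg simple tight d (d-unique , 3≤d , _ , _) lb lc 3≤lb 3≤lc lengths =
  size , TS , map norm ES , A , B , C , triangulation , A≡d , B-length , C-length ,
  JoinTight.Joined.tight⁺ G fg simple tight d d-unique A A≡d henneberg verts↭ ,
  (VS , ES , henneberg , verts↭ , ↭-reflexive (sym (map-norm-idem ES)))
  where
  open VertexLayout lb lc 3≤lb 3≤lc
  open Triangulated triangulated
  A≡d : length A ≡ length d
  A≡d = A-length (length d) 3≤d lengths
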